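{- Let NQUEENS be the definite program consisting of the four clauses $pqs(0,X_1,X_2,X_3).$ $pqs(s(I),Cs,Us,[Y|Ds]) \gets pqs(I,Cs,[Z|Us],Ds),\ pq(s(I),Cs,Us,Ds).$ $pq(I,[I|X_1],[I|X_2],[I|X_3]).$ $pq(I,[Y_1|Cs],[Y_2|Us],[Y_3|Ds]) \gets pq(I,Cs,Us,Ds).$ (all capitalized identifiers are variables). Then $\mathcal{O}(\mathrm{NQUEENS}) \subseteq S$, where $S = S_{pq} \cup S_{pqs1} \cup S_{pqs2}$ and $S_{pq}$ is the set of atoms $pq(v,[c_1,\dots,c_k,v|c_0],[u_1,\dots,u_k,v|u_0],[d_1,\dots,d_k,v|d_0])$ with $k \ge 0$ and $v,c_0,\dots,c_k,u_0,\dots,u_k,d_0,\dots,d_k$ distinct variables; $S_{pqs1}$ is the set of atoms $pqs(i,cs,us,[w|ds])$ such that $i>0$, $w$ is a variable not occurring in $cs,us,ds$, $cs$ is correct up to $i$, the pair $(us,ds)$ is correct up to $i$ w.r.t. $i$ and $cs$, and the terms $cs,us,ds$ are variable disjoint; $S_{pqs2}$ is the set of atoms $pqs(0,cs,us,ds)$ with $cs,us,ds$ distinct variables.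
   Context: Natural number $n$ is represented by the term $s^n(0)$, and we write $n$ for this term. The s-semantics $\mathcal{O}(P)$ of a definite program $P$ is the set of all atoms $p(V_1,\dots,V_n)\theta$ where $p$ is an $n$-ary predicate symbol, $V_1,\dots,V_n$ are distinct variables and $\theta$ is an SLD-computed answer substitution for the query $p(V_1,\dots,V_n)$. Prolog list notation is used. An open list of length $n\ge 0$ is a term $[t_1,\dots,t_n|v]$ with $v$ a variable (for $n=0$ it is just the variable $v$); $t_i$ is its $i$-th member. More generally, a term $s$ is the $k$-th member ($k>0$) of a term $t$ if $t = [t_1,\dots,t_{k-1},s|t_0]$ for some terms. A term is linear if no variable occurs in it twice. A term $t$ is a g.v.d. if it is linear, is an open list with pairwise distinct members, and each member is either a ground term or a variable. If the queen $j$ (a positive natural number) is the $k$-th member of an open list $cs$, then for a natural number $i$ the up diagonal number of $j$ in $cs$ w.r.t. $i$ is $k+j-i$ and its down diagonal number is $k+i-j$ (distinctness of such numbers among several queens does not depend on $i$). An open list $cs$ is correct up to $m$ (where $m\ge 0$) if $cs$ is a g.v.d., the set of its ground members is exactly $\{1,\dots,m\}$, the up diagonal numbers of these members in $cs$ are pairwise distinct, and their down diagonal numbers in $cs$ are pairwise distinct. A pair of terms $(us,ds)$ is correct up to $m$ w.r.t. $i\in\mathbb{N}$ and an open list $cs$ if for each $j\in\{1,\dots,m\}$: $j$ is a member of $cs$, and if the up (resp. down) diagonal number of $j$ in $cs$ w.r.t. $i$ is $l>0$ then the $l$-th member of $us$ (resp. $ds$) is $j$. -}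

module Defs where

open import Data.Nat using (ℕ; zero; suc; _≤_; _<_)
open import Data.Integer as ℤ using (ℤ; +_)
open import Data.List using (List; []; _∷_; _++_; length; map; concatMap)
open import Data.List.Membership.Propositional using (_∈_; _∉_)
open import Data.List.Relation.Unary.All using (All)
open import Data.List.Relation.Unary.Unique.Propositional using (Unique)
open import Data.Product using (Σ; ∃; _×_; _,_)
open import Data.Sum using (_⊎_)
open import Data.Empty using (⊥)
open import Relation.Nullary using (¬_)
open import Relation.Binary.PropositionalEquality using (_≡_; _≢_)
open import Function.Definitions using (Injective)

data Term : Set where
  var  : ℕ → Term
  zro  : Term
  suc' : Term → Term
  nil  : Term
  cons : Term → Term → Term

Var : Set
Var = ℕ

vars : Term → List Var
vars (var x)    = x ∷ []
vars zro        = []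
vars (suc' t)   = vars t
vars nil        = []
vars (cons s t) = vars s ++ vars t

num : ℕ → Term
num zero    = zro
num (suc n) = suc' (num n)

mkList : List Term → Term → Term
mkList []       t = t
mkList (x ∷ xs) t = cons x (mkList xs t)

Subst : Set
Subst = Var → Term

_⟨_⟩ : Term → Subst → Term
var x    ⟨ θ ⟩ = θ x
zro      ⟨ θ ⟩ = zro
suc' t   ⟨ θ ⟩ = suc' (t ⟨ θ ⟩)
nil      ⟨ θ ⟩ = nil
cons s t ⟨ θ ⟩ = cons (s ⟨ θ ⟩) (t ⟨ θ ⟩)

_⨾_ : Subst → Subst → Subst
(θ ⨾ σ) x = θ x ⟨ σ ⟩

data Pred : Set where
  pq pqs : Pred

data Atom : Set where
  atom : Pred → Term → Term → Term → Term → Atom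

atomVars : Atom → List Var
atomVars (atom _ a b c d) = vars a ++ vars b ++ vars c ++ vars d

_⟪_⟫ : Atom → Subst → Atom
atom p a b c d ⟪ θ ⟫ = atom p (a ⟨ θ ⟩) (b ⟨ θ ⟩) (c ⟨ θ ⟩) (d ⟨ θ ⟩)

goalApply : List Atom → Subst → List Atom
goalApply Q θ = map (λ a → a ⟪ θ ⟫) Q

IsUnifier : Subst → Atom → Atom → Set
IsUnifier θ a b = a ⟪ θ ⟫ ≡ b ⟪ θ ⟫

MoreGeneral : Subst → Subst → Set
MoreGeneral θ σ = Σ Subst λ δ → ∀ x → (θ ⨾ δ) x ≡ σ x

IsMGU : Subst → Atom → Atom → Set
IsMGU θ a b = IsUnifier θ a b × (∀ σ → IsUnifier σ a b → MoreGeneral θ σ)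

record Clause : Set where
  constructor _←_
  field
    head : Atom
    body : List Atom

open Clause public

clauseVars : Clause → List Var
clauseVars (h ← bs) = atomVars h ++ concatMap atomVars bs

renameClause : (Var → Var) → Clause → Clause
renameClause ρ (h ← bs) = (h ⟪ (λ x → var (ρ x)) ⟫) ← goalApply bs (λ x → var (ρ x))

private
  v : ℕ → Term
  v = var

-- pqs(0,X1,X2,X3).                       X1=0, X2=1, X3=2
clause1 : Clause
clause1 = atom pqs zro (v 0) (v 1) (v 2) ← []

-- pqs(s(I),Cs,Us,[Y|Ds]) <- pqs(I,Cs,[Z|Us],Ds), pq(s(I),Cs,Us,Ds).
--                                         I=0, Cs=1, Us=2, Y=3, Ds=4, Z=5
clause2 : Clause
clause2 = atom pqs (suc' (v 0)) (v 1) (v 2) (cons (v 3) (v 4))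
        ← (atom pqs (v 0) (v 1) (cons (v 5) (v 2)) (v 4)
          ∷ atom pq (suc' (v 0)) (v 1) (v 2) (v 4) ∷ [])

-- pq(I,[I|X1],[I|X2],[I|X3]).            I=0, X1=1, X2=2, X3=3
clause3 : Clause
clause3 = atom pq (v 0) (cons (v 0) (v 1)) (cons (v 0) (v 2)) (cons (v 0) (v 3)) ← []

-- pq(I,[Y1|Cs],[Y2|Us],[Y3|Ds]) <- pq(I,Cs,Us,Ds).
--                        I=0, Y1=1, Cs=2, Y2=3, Us=4, Y3=5, Ds=6
clause4 : Clause
clause4 = atom pq (v 0) (cons (v 1) (v 2)) (cons (v 3) (v 4)) (cons (v 5) (v 6))
        ← (atom pq (v 0) (v 2) (v 4) (v 6) ∷ [])

NQUEENS : List Clause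
NQUEENS = clause1 ∷ clause2 ∷ clause3 ∷ clause4 ∷ []

-- Successful SLD-derivations (arbitrary selection rule, arbitrary mgus,
-- standardised apart).  SLD P U Q η : there is a successful
-- SLD-derivation of the query Q via program P whose composed mgus
-- θ1 θ2 ... θn equal η; U is the list of variables already used
-- (initial query, earlier clause variants, earlier mgus), which the
-- next clause variant must avoid.

data SLD (P : List Clause) : List Var → List Atom → Subst → Set where
  done : ∀ {U} → SLD P U [] var
  step : ∀ {U} (A B : List Atom) (a : Atom) (c : Clause) → c ∈ P →
         (ρ : Var → Var) → Injective _≡_ _≡_ ρ →
         (∀ x → x ∈ clauseVars (renameClause ρ c) → x ∉ U) →
         (θ : Subst) (D : List Var) → (∀ x → x ∉ D → θ x ≡ var x) →
         IsMGU θ a (head (renameClause ρ c)) →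
         ∀ {σ} →
         SLD P (U ++ clauseVars (renameClause ρ c) ++ D ++ concatMap (λ x → vars (θ x)) D)
               (goalApply (A ++ body (renameClause ρ c) ++ B) θ) σ →
         SLD P U (A ++ a ∷ B) (θ ⨾ σ)

-- θ is an SLD-computed answer substitution for Q (restriction to the
-- variables of Q is irrelevant below since it is only applied to Q).
ComputedAnswer : List Clause → List Atom → Subst → Set
ComputedAnswer P Q θ = SLD P (concatMap atomVars Q) Q θ

InO : List Clause → Atom → Set
InO P A = Σ Pred λ p → Σ Var λ v₁ → Σ Var λ v₂ → Σ Var λ v₃ → Σ Var λ v₄ →
  Unique (v₁ ∷ v₂ ∷ v₃ ∷ v₄ ∷ []) ×
  Σ Subst λ θ →
    ComputedAnswer P (atom p (var v₁) (var v₂) (var v₃) (var v₄) ∷ []) θ ×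
    A ≡ atom p (var v₁) (var v₂) (var v₃) (var v₄) ⟪ θ ⟫

IsVar : Term → Set
IsVar t = Σ Var λ x → t ≡ var x

Ground : Term → Set
Ground t = vars t ≡ []

Linear : Term → Set
Linear t = Unique (vars t)

OpenList : Term → List Term → Set
OpenList t ms = Σ Var λ x → t ≡ mkList ms (var x)

KthMember : Term → ℕ → Term → Set
KthMember s zero    t = ⊥
KthMember s (suc k) t = Σ (List Term) λ ts → Σ Term λ t₀ →
  length ts ≡ k × t ≡ mkList ts (cons s t₀)

Member : Term → Term → Set
Member s t = Σ ℕ λ k → KthMember s k t

GVD : Term → Set
GVD t = Linear t × Σ (List Term) λ ms → OpenList t ms × Unique ms ×
        All (λ m → Ground m ⊎ IsVar m) ms

-- Diagonal numbers (queen j being the k-th member, w.r.t. i)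

upDiag : ℕ → ℕ → ℕ → ℤ
upDiag i j k = (+ k ℤ.+ + j) ℤ.- + i

downDiag : ℕ → ℕ → ℕ → ℤ
downDiag i j k = (+ k ℤ.+ + i) ℤ.- + j

InRange : ℕ → ℕ → Set
InRange m j = 1 ≤ j × j ≤ m

-- cs is correct up to m.  (Distinctness of diagonal numbers does not
-- depend on i; we require it for every i.)
CorrectUpTo : ℕ → Term → Set
CorrectUpTo m cs =
  GVD cs ×
  (∀ t → (Member t cs × Ground t) → Σ ℕ λ j → InRange m j × t ≡ num j) ×
  (∀ j → InRange m j → Member (num j) cs) ×
  (∀ i j j′ k k′ → InRange m j → InRange m j′ → j ≢ j′ →
     KthMember (num j) k cs → KthMember (num j′) k′ cs →
     upDiag i j k ≢ upDiag i j′ k′ × downDiag i j k ≢ downDiag i j′ k′)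

PairCorrectUpTo : ℕ → ℕ → Term → Term → Term → Set
PairCorrectUpTo m i cs us ds =
  ∀ j → InRange m j →
    Member (num j) cs ×
    (∀ k l → KthMember (num j) k cs → 0 < l →
       (upDiag i j k ≡ + l → KthMember (num j) l us) ×
       (downDiag i j k ≡ + l → KthMember (num j) l ds))

VarDisjoint : Term → Term → Set
VarDisjoint s t = ∀ x → x ∈ vars s → x ∉ vars t

S-pq : Atom → Set
S-pq A = Σ ℕ λ k → Σ Var λ v → Σ (List Var) λ cs → Σ (List Var) λ us →
  Σ (List Var) λ ds → Σ Var λ c₀ → Σ Var λ u₀ → Σ Var λ d₀ →
  length cs ≡ k × length us ≡ k × length ds ≡ k ×
  Unique (v ∷ c₀ ∷ u₀ ∷ d₀ ∷ cs ++ us ++ ds) ×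
  A ≡ atom pq (var v)
        (mkList (map var cs) (cons (var v) (var c₀)))
        (mkList (map var us) (cons (var v) (var u₀)))
        (mkList (map var ds) (cons (var v) (var d₀)))

S-pqs1 : Atom → Set
S-pqs1 A = Σ ℕ λ i → Σ Term λ cs → Σ Term λ us → Σ Var λ w → Σ Term λ ds →
  A ≡ atom pqs (num i) cs us (cons (var w) ds) ×
  0 < i ×
  w ∉ vars cs × w ∉ vars us × w ∉ vars ds ×
  CorrectUpTo i cs ×
  PairCorrectUpTo i i cs us ds ×
  VarDisjoint cs us × VarDisjoint cs ds × VarDisjoint us ds

S-pqs2 : Atom → Set
S-pqs2 A = Σ Var λ c → Σ Var λ u → Σ Var λ d →
  Unique (c ∷ u ∷ d ∷ []) ×
  A ≡ atom pqs (num 0) (var c) (var u) (var d)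

S : Atom → Set
S A = S-pq A ⊎ S-pqs1 A ⊎ S-pqs2 A

-- The program is checked against a stronger invariant Spec: the pqs-atoms with
-- i > 0 are described by open lists of slots (numerals or variables) satisfying a positional
-- form of the correctness conditions (Placement).  For every clause, an idempotent mgu of its
-- body with variable-disjoint Spec-atoms is computed explicitly (a solved form, then the
-- position-wise merge of open lists that places queen i+1), and its head instance is again in
-- Spec.  By induction on the derivation, a computed answer unifies the query most generally
-- with a fresh Spec-atom; as the query has distinct variables, the answer is a renaming of
-- that atom.  Spec is closed under renamings and implies S.

module Submission where

open import Defs
open import Data.Nat using (ℕ; zero; suc; _+_; _≤_; _<_; z≤n; s≤s; _≟_)
open import Data.Nat.Properties
  using (≤-trans; ≤-refl; ≤-reflexive; +-mono-≤; m≤m+n; m≤n+m; +-suc; +-comm; +-cancelʳ-≡; suc-injective;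
         1+n≰n; n≤1+n; ≤-pred; ≤∧≢⇒<; +-identityʳ; +-commutativeSemigroup)
open import Data.Empty using (⊥; ⊥-elim)
import Data.Integer as ℤ
open import Data.Integer using (+_)
import Data.Integer.Properties as ℤ
open import Data.List using (List; []; _∷_; _++_; length; map; concatMap)
open import Data.List.Membership.DecPropositional _≟_ using (_∈?_)
open import Data.List.Membership.Propositional using (_∈_; _∉_; lose)
open import Data.List.Membership.Propositional.Properties using (∈-++⁺ˡ; ∈-++⁺ʳ; ∈-++⁻; ∈-map⁻; ∈-concatMap⁺)
open import Data.List.Properties using (map-++; ++-identityʳ; ++-assoc; length-map; length-++; ∷-injectiveˡ; ∷-injectiveʳ)
open import Data.List.Relation.Unary.All using (All; []; _∷_)
import Data.List.Relation.Unary.All as All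
open import Data.List.Relation.Unary.All.Properties using (++⁺; ++⁻; ¬Any⇒All¬; All¬⇒¬Any)
open import Data.List.Relation.Unary.AllPairs using ([]; _∷_)
open import Data.List.Relation.Unary.Any using (here; there)
open import Data.List.Relation.Unary.Unique.Propositional using (Unique)
open import Algebra.Properties.CommutativeSemigroup +-commutativeSemigroup using (xy∙z≈xz∙y)
open import Data.Product using (Σ; ∃; _×_; _,_; proj₁; proj₂)
open import Data.Sum using (_⊎_; inj₁; inj₂)
open import Data.Unit using (⊤; tt)
open import Function.Definitions using (Injective)
open import Relation.Nullary using (yes; no)
open import Relation.Binary.PropositionalEquality

var-injective : ∀ {x y} → var x ≡ var y → x ≡ y
var-injective refl = refl

suc'-injective : ∀ {s t} → suc' s ≡ suc' t → s ≡ t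
suc'-injective refl = refl

cons-injectiveˡ : ∀ {s t s′ t′} → cons s t ≡ cons s′ t′ → s ≡ s′
cons-injectiveˡ refl = refl

cons-injectiveʳ : ∀ {s t s′ t′} → cons s t ≡ cons s′ t′ → t ≡ t′
cons-injectiveʳ refl = refl

⟨⟩-cong : ∀ t {σ τ : Subst} → (∀ x → x ∈ vars t → σ x ≡ τ x) → t ⟨ σ ⟩ ≡ t ⟨ τ ⟩
⟨⟩-cong (var x)    h = h x (here refl)
⟨⟩-cong zro        h = refl
⟨⟩-cong (suc' t)   h = cong suc' (⟨⟩-cong t h)
⟨⟩-cong nil        h = refl
⟨⟩-cong (cons s t) h =
  cong₂ cons (⟨⟩-cong s (λ x m → h x (∈-++⁺ˡ m))) (⟨⟩-cong t (λ x m → h x (∈-++⁺ʳ (vars s) m)))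

⟨⟩-⨾ : ∀ t (σ τ : Subst) → t ⟨ σ ⨾ τ ⟩ ≡ t ⟨ σ ⟩ ⟨ τ ⟩
⟨⟩-⨾ (var x)    σ τ = refl
⟨⟩-⨾ zro        σ τ = refl
⟨⟩-⨾ (suc' t)   σ τ = cong suc' (⟨⟩-⨾ t σ τ)
⟨⟩-⨾ nil        σ τ = refl
⟨⟩-⨾ (cons s t) σ τ = cong₂ cons (⟨⟩-⨾ s σ τ) (⟨⟩-⨾ t σ τ)

⟨⟩-identity : ∀ t → t ⟨ var ⟩ ≡ t
⟨⟩-identity (var x)    = refl
⟨⟩-identity zro        = refl
⟨⟩-identity (suc' t)   = cong suc' (⟨⟩-identity t)
⟨⟩-identity nil        = refl
⟨⟩-identity (cons s t) = cong₂ cons (⟨⟩-identity s) (⟨⟩-identity t)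

⟨⟩-fixes : ∀ t (σ : Subst) → (∀ y → y ∈ vars t → σ y ≡ var y) → t ⟨ σ ⟩ ≡ t
⟨⟩-fixes t σ h = trans (⟨⟩-cong t h) (⟨⟩-identity t)

⟨⟩-fixes⁻ : ∀ t (σ : Subst) → t ⟨ σ ⟩ ≡ t → ∀ y → y ∈ vars t → σ y ≡ var y
⟨⟩-fixes⁻ (var x)    σ e .x (here refl) = e
⟨⟩-fixes⁻ (suc' t)   σ e y m = ⟨⟩-fixes⁻ t σ (suc'-injective e) y m
⟨⟩-fixes⁻ (cons s t) σ e y m with ∈-++⁻ (vars s) m
... | inj₁ m′ = ⟨⟩-fixes⁻ s σ (cons-injectiveˡ e) y m′
... | inj₂ m′ = ⟨⟩-fixes⁻ t σ (cons-injectiveʳ e) y m′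

∈-vars-⟨⟩⁻ : ∀ t (σ : Subst) {y} → y ∈ vars (t ⟨ σ ⟩) → ∃ λ x → x ∈ vars t × y ∈ vars (σ x)
∈-vars-⟨⟩⁻ (var x)    σ m = x , here refl , m
∈-vars-⟨⟩⁻ (suc' t)   σ m = ∈-vars-⟨⟩⁻ t σ m
∈-vars-⟨⟩⁻ (cons s t) σ m with ∈-++⁻ (vars (s ⟨ σ ⟩)) m
... | inj₁ m′ = let x , x∈s , y∈σx = ∈-vars-⟨⟩⁻ s σ m′ in x , ∈-++⁺ˡ x∈s , y∈σx
... | inj₂ m′ = let x , x∈t , y∈σx = ∈-vars-⟨⟩⁻ t σ m′ in x , ∈-++⁺ʳ (vars s) x∈t , y∈σx

⟨⟩≡var⇒var : ∀ t (σ : Subst) {x} → t ⟨ σ ⟩ ≡ var x → ∃ λ y → t ≡ var y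
⟨⟩≡var⇒var (var y) σ e = y , refl

vars-num : ∀ n → vars (num n) ≡ []
vars-num zero    = refl
vars-num (suc n) = vars-num n

∉-vars-num : ∀ n {y} → y ∉ vars (num n)
∉-vars-num n m with subst (_ ∈_) (vars-num n) m
... | ()

num-⟨⟩ : ∀ n (σ : Subst) → num n ⟨ σ ⟩ ≡ num n
num-⟨⟩ zero    σ = refl
num-⟨⟩ (suc n) σ = cong suc' (num-⟨⟩ n σ)

num-injective : ∀ {m n} → num m ≡ num n → m ≡ n
num-injective {zero}  {zero}  e = refl
num-injective {suc m} {suc n} e = cong suc (num-injective (suc'-injective e))

atom-injective : ∀ {p a b c d p′ a′ b′ c′ d′} → atom p a b c d ≡ atom p′ a′ b′ c′ d′ →
                 p ≡ p′ × a ≡ a′ × b ≡ b′ × c ≡ c′ × d ≡ d′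
atom-injective refl = refl , refl , refl , refl , refl

atom-cong : ∀ {p a b c d a′ b′ c′ d′} → a ≡ a′ → b ≡ b′ → c ≡ c′ → d ≡ d′ → atom p a b c d ≡ atom p a′ b′ c′ d′
atom-cong refl refl refl refl = refl

⟪⟫-cong : ∀ a {σ τ : Subst} → (∀ x → x ∈ atomVars a → σ x ≡ τ x) → a ⟪ σ ⟫ ≡ a ⟪ τ ⟫
⟪⟫-cong (atom p a b c d) h = atom-cong
  (⟨⟩-cong a (λ x m → h x (∈-++⁺ˡ m)))
  (⟨⟩-cong b (λ x m → h x (∈-++⁺ʳ (vars a) (∈-++⁺ˡ m))))
  (⟨⟩-cong c (λ x m → h x (∈-++⁺ʳ (vars a) (∈-++⁺ʳ (vars b) (∈-++⁺ˡ m)))))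
  (⟨⟩-cong d (λ x m → h x (∈-++⁺ʳ (vars a) (∈-++⁺ʳ (vars b) (∈-++⁺ʳ (vars c) m)))))

⟪⟫-⨾ : ∀ a (σ τ : Subst) → a ⟪ σ ⨾ τ ⟫ ≡ a ⟪ σ ⟫ ⟪ τ ⟫
⟪⟫-⨾ (atom p a b c d) σ τ = atom-cong (⟨⟩-⨾ a σ τ) (⟨⟩-⨾ b σ τ) (⟨⟩-⨾ c σ τ) (⟨⟩-⨾ d σ τ)

⟪⟫-identity : ∀ a → a ⟪ var ⟫ ≡ a
⟪⟫-identity (atom p a b c d) = atom-cong (⟨⟩-identity a) (⟨⟩-identity b) (⟨⟩-identity c) (⟨⟩-identity d)

∈-atomVars-⟪⟫⁻ : ∀ a (σ : Subst) {y} → y ∈ atomVars (a ⟪ σ ⟫) → ∃ λ x → x ∈ atomVars a × y ∈ vars (σ x)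
∈-atomVars-⟪⟫⁻ (atom p a b c d) σ m with ∈-++⁻ (vars (a ⟨ σ ⟩)) m
... | inj₁ m′ = let x , x∈ , y∈ = ∈-vars-⟨⟩⁻ a σ m′ in x , ∈-++⁺ˡ x∈ , y∈
... | inj₂ m₁ with ∈-++⁻ (vars (b ⟨ σ ⟩)) m₁
... | inj₁ m′ = let x , x∈ , y∈ = ∈-vars-⟨⟩⁻ b σ m′ in x , ∈-++⁺ʳ (vars a) (∈-++⁺ˡ x∈) , y∈
... | inj₂ m₂ with ∈-++⁻ (vars (c ⟨ σ ⟩)) m₂
... | inj₁ m′ = let x , x∈ , y∈ = ∈-vars-⟨⟩⁻ c σ m′ in x , ∈-++⁺ʳ (vars a) (∈-++⁺ʳ (vars b) (∈-++⁺ˡ x∈)) , y∈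
... | inj₂ m′ = let x , x∈ , y∈ = ∈-vars-⟨⟩⁻ d σ m′ in x , ∈-++⁺ʳ (vars a) (∈-++⁺ʳ (vars b) (∈-++⁺ʳ (vars c) x∈)) , y∈

goalVars : List Atom → List Var
goalVars = concatMap atomVars

goalVars-++ : ∀ G H → goalVars (G ++ H) ≡ goalVars G ++ goalVars H
goalVars-++ []      H = refl
goalVars-++ (a ∷ G) H rewrite goalVars-++ G H = sym (++-assoc (atomVars a) (goalVars G) (goalVars H))

∈-goalVars-++⁻ : ∀ G H {x} → x ∈ goalVars (G ++ H) → x ∈ goalVars G ⊎ x ∈ goalVars H
∈-goalVars-++⁻ G H m = ∈-++⁻ (goalVars G) (subst (_ ∈_) (goalVars-++ G H) m)

∈-goalVars-++⁺ˡ : ∀ G H {x} → x ∈ goalVars G → x ∈ goalVars (G ++ H)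
∈-goalVars-++⁺ˡ G H m = subst (_ ∈_) (sym (goalVars-++ G H)) (∈-++⁺ˡ m)

∈-goalVars-++⁺ʳ : ∀ G H {x} → x ∈ goalVars H → x ∈ goalVars (G ++ H)
∈-goalVars-++⁺ʳ G H m = subst (_ ∈_) (sym (goalVars-++ G H)) (∈-++⁺ʳ (goalVars G) m)

goalApply-cong : ∀ G {σ τ : Subst} → (∀ x → x ∈ goalVars G → σ x ≡ τ x) → goalApply G σ ≡ goalApply G τ
goalApply-cong []      h = refl
goalApply-cong (a ∷ G) h =
  cong₂ _∷_ (⟪⟫-cong a (λ x m → h x (∈-++⁺ˡ m))) (goalApply-cong G (λ x m → h x (∈-++⁺ʳ (atomVars a) m)))

goalApply-⨾ : ∀ G (σ τ : Subst) → goalApply G (σ ⨾ τ) ≡ goalApply (goalApply G σ) τ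
goalApply-⨾ []      σ τ = refl
goalApply-⨾ (a ∷ G) σ τ = cong₂ _∷_ (⟪⟫-⨾ a σ τ) (goalApply-⨾ G σ τ)

goalApply-fixes : ∀ G (σ : Subst) → (∀ y → y ∈ goalVars G → σ y ≡ var y) → goalApply G σ ≡ G
goalApply-fixes []      σ h = refl
goalApply-fixes (a ∷ G) σ h =
  cong₂ _∷_ (trans (⟪⟫-cong a (λ x m → h x (∈-++⁺ˡ m))) (⟪⟫-identity a))
            (goalApply-fixes G σ (λ x m → h x (∈-++⁺ʳ (atomVars a) m)))

∈-goalVars-goalApply⁻ : ∀ G (σ : Subst) {y} → y ∈ goalVars (goalApply G σ) →
                        ∃ λ x → x ∈ goalVars G × y ∈ vars (σ x)
∈-goalVars-goalApply⁻ (a ∷ G) σ m with ∈-++⁻ (atomVars (a ⟪ σ ⟫)) m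
... | inj₁ m′ = let x , x∈ , y∈ = ∈-atomVars-⟪⟫⁻ a σ m′ in x , ∈-++⁺ˡ x∈ , y∈
... | inj₂ m′ = let x , x∈ , y∈ = ∈-goalVars-goalApply⁻ G σ m′ in x , ∈-++⁺ʳ (atomVars a) x∈ , y∈

rename : (Var → Var) → Subst
rename f x = var (f x)

InjectiveOn : List Var → (Var → Var) → Set
InjectiveOn xs f = ∀ {x y} → x ∈ xs → y ∈ xs → f x ≡ f y → x ≡ y

occ : Var → List Var → ℕ
occ x []       = 0
occ x (y ∷ ys) with x ≟ y
... | yes _ = suc (occ x ys)
... | no  _ = occ x ys

-- Distinctness through multiplicities, so that rearranging and dropping parts of a list
-- become inequalities between sums of naturals.
Distinct : List Var → Set
Distinct xs = ∀ x → occ x xs ≤ 1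

occ-++ : ∀ x xs ys → occ x (xs ++ ys) ≡ occ x xs + occ x ys
occ-++ x []       ys = refl
occ-++ x (y ∷ xs) ys with x ≟ y
... | yes _ = cong suc (occ-++ x xs ys)
... | no  _ = occ-++ x xs ys

∈⇒occ-pos : ∀ {x xs} → x ∈ xs → 1 ≤ occ x xs
∈⇒occ-pos {x} {y ∷ xs} x∈ with x ≟ y | x∈
... | yes _  | _          = s≤s z≤n
... | no x≢y | here x≡y   = ⊥-elim (x≢y x≡y)
... | no _   | there x∈xs = ∈⇒occ-pos x∈xs

occ-pos⇒∈ : ∀ {x} xs → 1 ≤ occ x xs → x ∈ xs
occ-pos⇒∈ {x} (y ∷ xs) p with x ≟ y
... | yes x≡y = here x≡y
... | no  _   = there (occ-pos⇒∈ xs p)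

record _⊑_ (xs ys : List Var) : Set where
  constructor mk⊑
  field occ-≤ : ∀ x → occ x xs ≤ occ x ys
open _⊑_

infix 4 _⊑_

Distinct-⊑ : ∀ {xs ys} → xs ⊑ ys → Distinct ys → Distinct xs
Distinct-⊑ xs⊑ys d x = ≤-trans (occ-≤ xs⊑ys x) (d x)

⊑-∈ : ∀ {xs ys} → xs ⊑ ys → ∀ {x} → x ∈ xs → x ∈ ys
⊑-∈ {ys = ys} xs⊑ys {x} x∈ = occ-pos⇒∈ ys (≤-trans (∈⇒occ-pos x∈) (occ-≤ xs⊑ys x))

⊑-refl : ∀ {xs} → xs ⊑ xs
⊑-refl = mk⊑ λ _ → ≤-refl

⊑-trans : ∀ {xs ys zs} → xs ⊑ ys → ys ⊑ zs → xs ⊑ zs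
⊑-trans p q = mk⊑ λ x → ≤-trans (occ-≤ p x) (occ-≤ q x)

++⁺-⊑ : ∀ {xs ys xs′ ys′} → xs ⊑ xs′ → ys ⊑ ys′ → xs ++ ys ⊑ xs′ ++ ys′
++⁺-⊑ {xs} {ys} {xs′} {ys′} p q = mk⊑ λ x →
  subst₂ _≤_ (sym (occ-++ x xs ys)) (sym (occ-++ x xs′ ys′)) (+-mono-≤ (occ-≤ p x) (occ-≤ q x))

xs⊑xs++ys : ∀ xs ys → xs ⊑ xs ++ ys
xs⊑xs++ys xs ys = mk⊑ λ x → subst (occ x xs ≤_) (sym (occ-++ x xs ys)) (m≤m+n (occ x xs) (occ x ys))

ys⊑xs++ys : ∀ xs ys → ys ⊑ xs ++ ys
ys⊑xs++ys xs ys = mk⊑ λ x → subst (occ x ys ≤_) (sym (occ-++ x xs ys)) (m≤n+m (occ x ys) (occ x xs))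

Distinct-++⁻ˡ : ∀ xs {ys} → Distinct (xs ++ ys) → Distinct xs
Distinct-++⁻ˡ xs {ys} = Distinct-⊑ (xs⊑xs++ys xs ys)

Distinct-++⁻ʳ : ∀ xs {ys} → Distinct (xs ++ ys) → Distinct ys
Distinct-++⁻ʳ xs {ys} = Distinct-⊑ (ys⊑xs++ys xs ys)

Distinct-++⇒disjoint : ∀ xs ys → Distinct (xs ++ ys) → ∀ {x} → x ∈ xs → x ∉ ys
Distinct-++⇒disjoint xs ys d {x} x∈xs x∈ys =
  1+n≰n (≤-trans (+-mono-≤ (∈⇒occ-pos x∈xs) (∈⇒occ-pos x∈ys)) (subst (_≤ 1) (occ-++ x xs ys) (d x)))

Distinct-∷⇒∉ : ∀ {y} xs → Distinct (y ∷ xs) → y ∉ xs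
Distinct-∷⇒∉ xs d = Distinct-++⇒disjoint (_ ∷ []) xs d (here refl)

Distinct-++⁺ : ∀ xs ys → Distinct xs → Distinct ys → (∀ {x} → x ∈ xs → x ∉ ys) → Distinct (xs ++ ys)
Distinct-++⁺ xs ys dxs dys disj x rewrite occ-++ x xs ys with occ x xs in eq₁ | occ x ys in eq₂
... | zero  | _     = subst (_≤ 1) eq₂ (dys x)
... | suc m | zero  = subst (λ n → suc n ≤ 1) (+-comm 0 m) (subst (_≤ 1) eq₁ (dxs x))
... | suc _ | suc _ = ⊥-elim (disj (occ-pos⇒∈ xs (subst (1 ≤_) (sym eq₁) (s≤s z≤n)))
                                   (occ-pos⇒∈ ys (subst (1 ≤_) (sym eq₂) (s≤s z≤n))))

Distinct-[] : Distinct []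
Distinct-[] x = z≤n

Distinct-∷⁺ : ∀ {y xs} → y ∉ xs → Distinct xs → Distinct (y ∷ xs)
Distinct-∷⁺ {y} {xs} y∉ d = Distinct-++⁺ (y ∷ []) xs single d λ { (here refl) → y∉ }
  where
  single : Distinct (y ∷ [])
  single x with x ≟ y
  ... | yes _ = s≤s z≤n
  ... | no  _ = z≤n

Distinct⇒Unique : ∀ xs → Distinct xs → Unique xs
Distinct⇒Unique []       d = []
Distinct⇒Unique (x ∷ xs) d = ¬Any⇒All¬ xs (Distinct-∷⇒∉ xs d) ∷ Distinct⇒Unique xs (Distinct-++⁻ʳ (x ∷ []) d)

Distinct-map : ∀ (f : Var → Var) xs → (∀ {x y} → x ∈ xs → y ∈ xs → f x ≡ f y → x ≡ y) →
               Distinct xs → Distinct (map f xs)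
Distinct-map f []       inj d = Distinct-[]
Distinct-map f (x ∷ xs) inj d =
  Distinct-∷⁺ fx∉ (Distinct-map f xs (λ mx my → inj (there mx) (there my)) (Distinct-++⁻ʳ (x ∷ []) d))
  where
  fx∉ : f x ∉ map f xs
  fx∉ m with ∈-map⁻ f m
  ... | y , y∈ , fx≡fy = Distinct-∷⇒∉ xs d (subst (_∈ xs) (sym (inj (here refl) (there y∈) fx≡fy)) y∈)

∉-++⁺ : ∀ {x : Var} {xs ys} → x ∉ xs → x ∉ ys → x ∉ xs ++ ys
∉-++⁺ {xs = xs} x∉xs x∉ys m with ∈-++⁻ xs m
... | inj₁ m′ = x∉xs m′
... | inj₂ m′ = x∉ys m′

Unique⇒Distinct : ∀ xs → Unique xs → Distinct xs
Unique⇒Distinct []       []       = Distinct-[]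
Unique⇒Distinct (x ∷ xs) (h ∷ hs) = Distinct-∷⁺ (All¬⇒¬Any h) (Unique⇒Distinct xs hs)

-- Lists assembled by _++_ from named parts; ⊑-bag turns their rearrangements into arithmetic.
infixr 5 _⊕_
data Bag : Set where
  ⌊_⌋ : List Var → Bag
  _⊕_ : Bag → Bag → Bag

⟦_⟧ᴮ : Bag → List Var
⟦ ⌊ xs ⌋ ⟧ᴮ = xs
⟦ b ⊕ c ⟧ᴮ  = ⟦ b ⟧ᴮ ++ ⟦ c ⟧ᴮ

occᴮ : Var → Bag → ℕ
occᴮ x ⌊ xs ⌋ = occ x xs
occᴮ x (b ⊕ c) = occᴮ x b + occᴮ x c

occ-⟦⟧ᴮ : ∀ x b → occ x ⟦ b ⟧ᴮ ≡ occᴮ x b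
occ-⟦⟧ᴮ x ⌊ xs ⌋  = refl
occ-⟦⟧ᴮ x (b ⊕ c) = trans (occ-++ x ⟦ b ⟧ᴮ ⟦ c ⟧ᴮ) (cong₂ _+_ (occ-⟦⟧ᴮ x b) (occ-⟦⟧ᴮ x c))

⊑-bag : ∀ b c → (∀ x → occᴮ x b ≤ occᴮ x c) → ⟦ b ⟧ᴮ ⊑ ⟦ c ⟧ᴮ
⊑-bag b c h = mk⊑ λ x → subst₂ _≤_ (sym (occ-⟦⟧ᴮ x b)) (sym (occ-⟦⟧ᴮ x c)) (h x)

⊑-interchange : ∀ A B C D → (A ++ C) ++ (B ++ D) ⊑ (A ++ B) ++ (C ++ D)
⊑-interchange A B C D = ⊑-bag ((⌊ A ⌋ ⊕ ⌊ C ⌋) ⊕ ⌊ B ⌋ ⊕ ⌊ D ⌋) ((⌊ A ⌋ ⊕ ⌊ B ⌋) ⊕ ⌊ C ⌋ ⊕ ⌊ D ⌋)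
  (λ x → ≤-reflexive (swap (occ x A) (occ x B) (occ x C) (occ x D)))
  where
  open import Data.Nat.Tactic.RingSolver using (solve-∀)
  swap : ∀ a b c d → (a + c) + (b + d) ≡ (a + b) + (c + d)
  swap = solve-∀

Equations : Set
Equations = List (Term × Term)

Unifies : Subst → Equations → Set
Unifies ρ = All λ (s , t) → s ⟨ ρ ⟩ ≡ t ⟨ ρ ⟩

eqsVars : Equations → List Var
eqsVars []            = []
eqsVars ((s , t) ∷ E) = vars s ++ vars t ++ eqsVars E

-- ν ⨾ ρ = ρ for every unifier ρ characterises the idempotent most general unifiers.
IsIdemMgu : Equations → Subst → Set
IsIdemMgu E ν = Unifies ν E × (∀ ρ → Unifies ρ E → ∀ z → ν z ⟨ ρ ⟩ ≡ ρ z)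

record Confined (K : List Var) (ν : Subst) : Set where
  field
    outside : ∀ z → z ∉ K → ν z ≡ var z
    inside  : ∀ z → z ∈ K → ∀ y → y ∈ vars (ν z) → y ∈ K
open Confined public

Unifies-⨾ˡ : ∀ (ν ρ : Subst) E → Unifies ν E → Unifies (ν ⨾ ρ) E
Unifies-⨾ˡ ν ρ []            []      = []
Unifies-⨾ˡ ν ρ ((s , t) ∷ E) (p ∷ u) =
  trans (⟨⟩-⨾ s ν ρ) (trans (cong (_⟨ ρ ⟩) p) (sym (⟨⟩-⨾ t ν ρ))) ∷ Unifies-⨾ˡ ν ρ E u

Unifies-⨾ʳ : ∀ (ν : Subst) E → (∀ y → y ∈ eqsVars E → ν y ≡ var y) → ∀ ρ → Unifies ρ E → Unifies (ν ⨾ ρ) E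
Unifies-⨾ʳ ν []            fix ρ []      = []
Unifies-⨾ʳ ν ((s , t) ∷ E) fix ρ (p ∷ u) =
  trans (⟨⟩-⨾ s ν ρ) (trans (cong (_⟨ ρ ⟩) (⟨⟩-fixes s ν (λ y m → fix y (∈-++⁺ˡ m))))
    (trans p (sym (trans (⟨⟩-⨾ t ν ρ) (cong (_⟨ ρ ⟩) (⟨⟩-fixes t ν (λ y m → fix y (∈-++⁺ʳ (vars s) (∈-++⁺ˡ m))))))))) ∷
  Unifies-⨾ʳ ν E (λ y m → fix y (∈-++⁺ʳ (vars s) (∈-++⁺ʳ (vars t) m))) ρ u

IsIdemMgu-++ : ∀ E₁ E₂ {ν₁ ν₂} → IsIdemMgu E₁ ν₁ → IsIdemMgu E₂ ν₂ →
               (∀ y → y ∈ eqsVars E₂ → ν₁ y ≡ var y) → IsIdemMgu (E₁ ++ E₂) (ν₁ ⨾ ν₂)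
IsIdemMgu-++ E₁ E₂ {ν₁} {ν₂} (u₁ , mg₁) (u₂ , mg₂) fix =
  ++⁺ (Unifies-⨾ˡ ν₁ ν₂ E₁ u₁) (Unifies-⨾ʳ ν₁ E₂ fix ν₂ u₂) , mg
  where
  mg : ∀ ρ → Unifies ρ (E₁ ++ E₂) → ∀ z → (ν₁ ⨾ ν₂) z ⟨ ρ ⟩ ≡ ρ z
  mg ρ u z = trans (sym (⟨⟩-⨾ (ν₁ z) ν₂ ρ)) (trans (⟨⟩-cong (ν₁ z) (λ y _ → mg₂ ρ (++⁻ E₁ u .proj₂) y))
                                                   (mg₁ ρ (++⁻ E₁ u .proj₁) z))

IsIdemMgu-resp : ∀ {E E′ ν} → (∀ ρ → Unifies ρ E → Unifies ρ E′) → (∀ ρ → Unifies ρ E′ → Unifies ρ E) →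
                 IsIdemMgu E ν → IsIdemMgu E′ ν
IsIdemMgu-resp to from (u , mg) = to _ u , λ ρ u′ → mg ρ (from ρ u′)

IsIdemMgu-refl : ∀ t → IsIdemMgu ((t , t) ∷ []) var
IsIdemMgu-refl t = refl ∷ [] , λ _ _ _ → refl

Confined-var : ∀ K → Confined K var
Confined-var K = record { outside = λ _ _ → refl ; inside = λ { z z∈ y (here refl) → z∈ } }

Confined-⨾ : ∀ {K ν₁ ν₂} → Confined K ν₁ → Confined K ν₂ → Confined K (ν₁ ⨾ ν₂)
Confined-⨾ {K} {ν₁} {ν₂} c₁ c₂ = record { outside = out ; inside = ins }
  where
  out : ∀ z → z ∉ K → (ν₁ ⨾ ν₂) z ≡ var z
  out z z∉ rewrite outside c₁ z z∉ = outside c₂ z z∉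
  ins : ∀ z → z ∈ K → ∀ y → y ∈ vars ((ν₁ ⨾ ν₂) z) → y ∈ K
  ins z z∈ y y∈ with ∈-vars-⟨⟩⁻ (ν₁ z) ν₂ y∈
  ... | x , x∈ , y∈ν₂x = inside c₂ x (inside c₁ z z∈ x x∈) y y∈ν₂x

Confined-mono : ∀ {K K′ ν} → (∀ {x} → x ∈ K → x ∈ K′) → Confined K ν → Confined K′ ν
Confined-mono {K} {K′} {ν} K⊆K′ c = record { outside = out ; inside = ins }
  where
  out : ∀ z → z ∉ K′ → ν z ≡ var z
  out z z∉ = outside c z (λ z∈ → z∉ (K⊆K′ z∈))
  ins : ∀ z → z ∈ K′ → ∀ y → y ∈ vars (ν z) → y ∈ K′
  ins z z∈ y y∈ with z ∈? K
  ... | yes z∈K = K⊆K′ (inside c z z∈K y y∈)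
  ... | no  z∉K with subst (λ t → y ∈ vars t) (outside c z z∉K) y∈
  ... | here refl = z∈

Confined-fixes : ∀ {K ν} → Confined K ν → ∀ t → (∀ y → y ∈ vars t → y ∉ K) → t ⟨ ν ⟩ ≡ t
Confined-fixes {ν = ν} c t h = ⟨⟩-fixes t ν (λ y m → outside c y (h y m))

[_↦_] : Var → Term → Subst
[ x ↦ t ] z with z ≟ x
... | yes _ = t
... | no  _ = var z

[↦]-at : ∀ x t → [ x ↦ t ] x ≡ t
[↦]-at x t with x ≟ x
... | yes _   = refl
... | no  x≢x = ⊥-elim (x≢x refl)

[↦]-off : ∀ x t {z} → z ≢ x → [ x ↦ t ] z ≡ var z
[↦]-off x t {z} z≢x with z ≟ x
... | yes z≡x = ⊥-elim (z≢x z≡x)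
... | no  _   = refl

[↦]-fixes : ∀ x t s → x ∉ vars s → s ⟨ [ x ↦ t ] ⟩ ≡ s
[↦]-fixes x t s x∉ = ⟨⟩-fixes s [ x ↦ t ] (λ y m → [↦]-off x t (λ y≡x → x∉ (subst (_∈ vars s) y≡x m)))

IsIdemMgu-[↦] : ∀ x t → x ∉ vars t → IsIdemMgu ((var x , t) ∷ []) [ x ↦ t ]
IsIdemMgu-[↦] x t x∉ = trans ([↦]-at x t) (sym ([↦]-fixes x t t x∉)) ∷ [] , mg
  where
  mg : ∀ ρ → Unifies ρ ((var x , t) ∷ []) → ∀ z → [ x ↦ t ] z ⟨ ρ ⟩ ≡ ρ z
  mg ρ (ρx≡ρt ∷ []) z with z ≟ x
  ... | yes refl = sym ρx≡ρt
  ... | no  _    = refl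

IsIdemMgu-[↦]′ : ∀ x t → x ∉ vars t → IsIdemMgu ((t , var x) ∷ []) [ x ↦ t ]
IsIdemMgu-[↦]′ x t x∉ = IsIdemMgu-resp flip flip (IsIdemMgu-[↦] x t x∉)
  where
  flip : ∀ {s t} ρ → Unifies ρ ((s , t) ∷ []) → Unifies ρ ((t , s) ∷ [])
  flip ρ (e ∷ []) = sym e ∷ []

Confined-[↦] : ∀ {K} x t → x ∈ K → (∀ y → y ∈ vars t → y ∈ K) → Confined K [ x ↦ t ]
Confined-[↦] {K} x t x∈ t⊆K = record { outside = out ; inside = ins }
  where
  out : ∀ z → z ∉ K → [ x ↦ t ] z ≡ var z
  out z z∉ = [↦]-off x t (λ z≡x → z∉ (subst (_∈ K) (sym z≡x) x∈))
  ins : ∀ z → z ∈ K → ∀ y → y ∈ vars ([ x ↦ t ] z) → y ∈ K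
  ins z z∈ y y∈ with z ≟ x
  ... | yes _ = t⊆K y y∈
  ins z z∈ y (here refl) | no _ = z∈

Bindings : Set
Bindings = List (Var × Term)

bindingEqs : Bindings → Equations
bindingEqs = map λ (x , t) → var x , t

⟦_⟧ˢ : Bindings → Subst
⟦ [] ⟧ˢ          = var
⟦ (x , t) ∷ S ⟧ˢ = [ x ↦ t ] ⨾ ⟦ S ⟧ˢ

dom : Bindings → List Var
dom = map proj₁

rangeVars : Bindings → List Var
rangeVars []            = []
rangeVars ((x , t) ∷ S) = vars t ++ rangeVars S

∈-eqsVars-bindingEqs⁻ : ∀ S {y} → y ∈ eqsVars (bindingEqs S) → y ∈ dom S ⊎ y ∈ rangeVars S
∈-eqsVars-bindingEqs⁻ ((x , t) ∷ S) (here refl) = inj₁ (here refl)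
∈-eqsVars-bindingEqs⁻ ((x , t) ∷ S) (there m) with ∈-++⁻ (vars t) m
... | inj₁ y∈t = inj₂ (∈-++⁺ˡ y∈t)
... | inj₂ m′ with ∈-eqsVars-bindingEqs⁻ S m′
...   | inj₁ y∈dom = inj₁ (there y∈dom)
...   | inj₂ y∈rng = inj₂ (∈-++⁺ʳ (vars t) y∈rng)

IsIdemMgu-solved : ∀ S → Distinct (dom S) → (∀ {x} → x ∈ dom S → x ∉ rangeVars S) →
                   IsIdemMgu (bindingEqs S) ⟦ S ⟧ˢ
IsIdemMgu-solved []            _ _     = [] , λ _ _ _ → refl
IsIdemMgu-solved ((x , t) ∷ S) d apart =
  IsIdemMgu-++ ((var x , t) ∷ []) (bindingEqs S)
    (IsIdemMgu-[↦] x t (λ x∈t → apart (here refl) (∈-++⁺ˡ x∈t)))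
    (IsIdemMgu-solved S (Distinct-++⁻ʳ (x ∷ []) d) (λ y∈ y∈rng → apart (there y∈) (∈-++⁺ʳ (vars t) y∈rng)))
    untouched
  where
  x∉ : x ∈ dom S ⊎ x ∈ rangeVars S → ⊥
  x∉ (inj₁ x∈dom) = Distinct-∷⇒∉ (dom S) d x∈dom
  x∉ (inj₂ x∈rng) = apart (here refl) (∈-++⁺ʳ (vars t) x∈rng)
  untouched : ∀ y → y ∈ eqsVars (bindingEqs S) → [ x ↦ t ] y ≡ var y
  untouched y m = [↦]-off x t λ { refl → x∉ (∈-eqsVars-bindingEqs⁻ S m) }

⟦⟧ˢ-off : ∀ S {z} → z ∉ dom S → ⟦ S ⟧ˢ z ≡ var z
⟦⟧ˢ-off []            z∉ = refl
⟦⟧ˢ-off ((x , t) ∷ S) z∉ rewrite [↦]-off x t (λ z≡x → z∉ (here z≡x)) = ⟦⟧ˢ-off S (λ m → z∉ (there m))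

Confined-solved : ∀ {K} S → (∀ {x} → x ∈ dom S → x ∈ K) → (∀ {y} → y ∈ rangeVars S → y ∈ K) →
                  Confined K ⟦ S ⟧ˢ
Confined-solved {K} []            _   _   = Confined-var K
Confined-solved     ((x , t) ∷ S) dom⊆ rng⊆ =
  Confined-⨾ (Confined-[↦] x t (dom⊆ (here refl)) (λ y m → rng⊆ (∈-++⁺ˡ m)))
             (Confined-solved S (λ m → dom⊆ (there m)) (λ m → rng⊆ (∈-++⁺ʳ (vars t) m)))

ApartFrom : List Atom → List Atom → Set
ApartFrom G H = ∀ x → x ∈ goalVars G → x ∉ goalVars H

Apart : List Atom → Set
Apart []      = ⊤
Apart (a ∷ G) = ApartFrom (a ∷ []) G × Apart G

Apart-++⁻ : ∀ G H → Apart (G ++ H) → Apart G × Apart H × ApartFrom G H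
Apart-++⁻ []      H d         = tt , d , λ _ ()
Apart-++⁻ (a ∷ G) H (a∉ , d) with Apart-++⁻ G H d
... | dG , dH , G∉H = (a∉G , dG) , dH , a∷G∉H
  where
  a∉G : ApartFrom (a ∷ []) G
  a∉G x m x∈G = a∉ x m (∈-goalVars-++⁺ˡ G H x∈G)
  a∷G∉H : ApartFrom (a ∷ G) H
  a∷G∉H x m x∈H with ∈-++⁻ (atomVars a) m
  ... | inj₁ x∈a = a∉ x (∈-++⁺ˡ x∈a) (∈-goalVars-++⁺ʳ G H x∈H)
  ... | inj₂ x∈G = G∉H x x∈G x∈H

Apart-++⁺ : ∀ G H → Apart G → Apart H → ApartFrom G H → Apart (G ++ H)
Apart-++⁺ []      H dG       dH G∉H = dH
Apart-++⁺ (a ∷ G) H (a∉ , dG) dH G∉H =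
  a∉G++H , Apart-++⁺ G H dG dH (λ x m → G∉H x (∈-++⁺ʳ (atomVars a) m))
  where
  a∉G++H : ApartFrom (a ∷ []) (G ++ H)
  a∉G++H x m x∈ with ∈-goalVars-++⁻ G H x∈ | ∈-++⁻ (atomVars a) m
  ... | inj₁ x∈G | _          = a∉ x m x∈G
  ... | inj₂ x∈H | inj₁ x∈a   = G∉H x (∈-++⁺ˡ x∈a) x∈H

IsIdemMguᴳ : List Atom → List Atom → Subst → Set
IsIdemMguᴳ G H ν = goalApply G ν ≡ goalApply H ν × (∀ ρ → goalApply G ρ ≡ goalApply H ρ → ∀ z → ν z ⟨ ρ ⟩ ≡ ρ z)

splitAt-length : ∀ {A : Set} (xs : List A) m n → length xs ≡ m + n →
                 ∃ λ ys → ∃ λ zs → xs ≡ ys ++ zs × length ys ≡ m × length zs ≡ n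
splitAt-length xs       zero    n e = [] , xs , refl , refl , e
splitAt-length (x ∷ xs) (suc m) n e with splitAt-length xs m n (suc-injective e)
... | ys , zs , refl , l₁ , l₂ = x ∷ ys , zs , refl , cong suc l₁ , l₂

++-cancel-length : ∀ {A : Set} (xs xs′ ys ys′ : List A) → length xs ≡ length xs′ →
                   xs ++ ys ≡ xs′ ++ ys′ → xs ≡ xs′ × ys ≡ ys′
++-cancel-length []       []        ys ys′ _ e = refl , e
++-cancel-length (x ∷ xs) (x′ ∷ xs′) ys ys′ l e with ++-cancel-length xs xs′ ys ys′ (suc-injective l) (∷-injectiveʳ e)
... | refl , refl = cong (_∷ xs) (∷-injectiveˡ e) , refl

goalApply-++ : ∀ G H σ → goalApply (G ++ H) σ ≡ goalApply G σ ++ goalApply H σ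
goalApply-++ G H σ = map-++ _ G H

goalApply-split : ∀ G H G′ H′ σ → length G ≡ length G′ →
                  goalApply (G ++ H) σ ≡ goalApply (G′ ++ H′) σ →
                  goalApply G σ ≡ goalApply G′ σ × goalApply H σ ≡ goalApply H′ σ
goalApply-split G H G′ H′ σ l e =
  ++-cancel-length (goalApply G σ) (goalApply G′ σ) (goalApply H σ) (goalApply H′ σ)
    (trans (length-map _ G) (trans l (sym (length-map _ G′))))
    (trans (sym (goalApply-++ G H σ)) (trans e (goalApply-++ G′ H′ σ)))

goalApply-join : ∀ G H G′ H′ σ → goalApply G σ ≡ goalApply G′ σ → goalApply H σ ≡ goalApply H′ σ →
                 goalApply (G ++ H) σ ≡ goalApply (G′ ++ H′) σ
goalApply-join G H G′ H′ σ e₁ e₂ =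
  trans (goalApply-++ G H σ) (trans (cong₂ _++_ e₁ e₂) (sym (goalApply-++ G′ H′ σ)))

usedAfter : List Var → Clause → Subst → List Var → List Var
usedAfter U rc θ D = U ++ clauseVars rc ++ D ++ concatMap (λ x → vars (θ x)) D

module Soundness (P : List Clause) (Inv : Atom → Set) where

  ClauseStep : Clause → Set
  ClauseStep c = ∀ (ρ : Var → Var) → Injective _≡_ _≡_ ρ → let rc = renameClause ρ c in
    (C : List Atom) → All Inv C → Apart C → (∀ x → x ∈ goalVars C → x ∉ clauseVars rc) →
    (τ : Subst) → goalApply (body rc) τ ≡ goalApply C τ →
    ∃ λ ν → IsIdemMguᴳ (body rc) C ν × Confined (clauseVars rc ++ goalVars C) ν × Inv (head rc ⟪ ν ⟫)

  -- The invariant of the induction along a derivation of G with answer σ.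
  record CoveredBy (U : List Var) (G : List Atom) (σ : Subst) (C : List Atom) : Set where
    field
      inv     : All Inv C
      length≡ : length C ≡ length G
      fresh   : ∀ x → x ∈ goalVars C → x ∉ U
      apart   : Apart C
      unifies : goalApply G σ ≡ goalApply C σ
      general : ∀ ρ → goalApply G ρ ≡ goalApply C ρ → ∃ λ δ → ∀ x → x ∈ U ++ goalVars C → σ x ⟨ δ ⟩ ≡ ρ x

  Covered : List Var → List Atom → Subst → Set
  Covered U G σ = ∃ (CoveredBy U G σ)

  module Resolution (clauses-ok : ∀ {c} → c ∈ P → ClauseStep c)
    {U : List Var} (A B : List Atom) (a : Atom) {c : Clause} (c∈P : c ∈ P)
    (ρ : Var → Var) (ρ-inj : Injective _≡_ _≡_ ρ)
    (renamed-apart : ∀ x → x ∈ clauseVars (renameClause ρ c) → x ∉ U)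
    {θ : Subst} (D : List Var) (θ-off : ∀ x → x ∉ D → θ x ≡ var x)
    (θ-mgu : IsMGU θ a (head (renameClause ρ c)))
    (G⊆U : ∀ x → x ∈ goalVars (A ++ a ∷ B) → x ∈ U)
    {σ : Subst} (CA Cb CB : List Atom)
    (|CA| : length CA ≡ length A) (|Cb| : length Cb ≡ length (body (renameClause ρ c))) (|CB| : length CB ≡ length B)
    (cov : CoveredBy (usedAfter U (renameClause ρ c) θ D)
                     (goalApply (A ++ body (renameClause ρ c) ++ B) θ) σ (CA ++ Cb ++ CB))
    where

    rc : Clause
    rc = renameClause ρ c
    h : Atom
    h  = head rc
    bd CC : List Atom
    bd = body rc
    CV U′ : List Var
    CV = clauseVars rc
    U′ = usedAfter U rc θ D
    CC = CA ++ Cb ++ CB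
    τ : Subst
    τ  = θ ⨾ σ
    open CoveredBy cov

    ∈CC : ∀ {x} → x ∈ goalVars CA ⊎ x ∈ goalVars Cb ⊎ x ∈ goalVars CB → x ∈ goalVars CC
    ∈CC (inj₁ m)        = ∈-goalVars-++⁺ˡ CA (Cb ++ CB) m
    ∈CC (inj₂ (inj₁ m)) = ∈-goalVars-++⁺ʳ CA (Cb ++ CB) (∈-goalVars-++⁺ˡ Cb CB m)
    ∈CC (inj₂ (inj₂ m)) = ∈-goalVars-++⁺ʳ CA (Cb ++ CB) (∈-goalVars-++⁺ʳ Cb CB m)

    ∈U⇒∈U′ : ∀ {x} → x ∈ U → x ∈ U′
    ∈U⇒∈U′ = ∈-++⁺ˡ

    ∈CV⇒∈U′ : ∀ {x} → x ∈ CV → x ∈ U′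
    ∈CV⇒∈U′ m = ∈-++⁺ʳ U (∈-++⁺ˡ m)

    ∈A⇒∈U : ∀ {x} → x ∈ goalVars A → x ∈ U
    ∈A⇒∈U m = G⊆U _ (∈-goalVars-++⁺ˡ A (a ∷ B) m)

    ∈a⇒∈U : ∀ {x} → x ∈ atomVars a → x ∈ U
    ∈a⇒∈U m = G⊆U _ (∈-goalVars-++⁺ʳ A (a ∷ B) (∈-++⁺ˡ m))

    ∈B⇒∈U : ∀ {x} → x ∈ goalVars B → x ∈ U
    ∈B⇒∈U m = G⊆U _ (∈-goalVars-++⁺ʳ A (a ∷ B) (∈-++⁺ʳ (atomVars a) m))

    inv-split : All Inv CA × All Inv Cb × All Inv CB
    inv-split = let sA , sbB = ++⁻ CA inv ; sb , sB = ++⁻ Cb sbB in sA , sb , sB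

    apart-split : Apart CA × ApartFrom CA (Cb ++ CB) × Apart Cb × Apart CB × ApartFrom Cb CB
    apart-split = let dA , dbB , A∉ = Apart-++⁻ CA (Cb ++ CB) apart ; db , dB , b∉ = Apart-++⁻ Cb CB dbB
                  in dA , A∉ , db , dB , b∉

    θ-fixes-CC : goalApply CC θ ≡ CC
    θ-fixes-CC = goalApply-fixes CC θ off
      where
      off : ∀ y → y ∈ goalVars CC → θ y ≡ var y
      off y m with y ∈? D
      ... | yes y∈D = ⊥-elim (fresh y m (∈-++⁺ʳ U (∈-++⁺ʳ CV (∈-++⁺ˡ y∈D))))
      ... | no  y∉D = θ-off y y∉D

    τ-unifies : goalApply (A ++ bd ++ B) τ ≡ goalApply CC τ
    τ-unifies = begin
      goalApply (A ++ bd ++ B) τ               ≡⟨ goalApply-⨾ (A ++ bd ++ B) θ σ ⟩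
      goalApply (goalApply (A ++ bd ++ B) θ) σ ≡⟨ unifies ⟩
      goalApply CC σ                           ≡⟨ cong (λ G → goalApply G σ) θ-fixes-CC ⟨
      goalApply (goalApply CC θ) σ             ≡⟨ goalApply-⨾ CC θ σ ⟨
      goalApply CC τ                           ∎
      where open ≡-Reasoning

    τ-unifies-A : goalApply A τ ≡ goalApply CA τ
    τ-unifies-A = proj₁ (goalApply-split A (bd ++ B) CA (Cb ++ CB) τ (sym |CA|) τ-unifies)

    τ-unifies-bd,B : goalApply bd τ ≡ goalApply Cb τ × goalApply B τ ≡ goalApply CB τ
    τ-unifies-bd,B = goalApply-split bd B Cb CB τ (sym |Cb|)
                       (proj₂ (goalApply-split A (bd ++ B) CA (Cb ++ CB) τ (sym |CA|) τ-unifies))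

    Cb-apart-from-rc : ∀ x → x ∈ goalVars Cb → x ∉ CV
    Cb-apart-from-rc x m x∈CV = fresh x (∈CC (inj₂ (inj₁ m))) (∈CV⇒∈U′ x∈CV)

    clause-step : ∃ λ ν → IsIdemMguᴳ bd Cb ν × Confined (CV ++ goalVars Cb) ν × Inv (h ⟪ ν ⟫)
    clause-step = clauses-ok c∈P ρ ρ-inj Cb (proj₁ (proj₂ inv-split)) (proj₁ (proj₂ (proj₂ apart-split)))
                       Cb-apart-from-rc τ (proj₁ τ-unifies-bd,B)

    ν : Subst
    ν  = proj₁ clause-step
    K : List Var
    K  = CV ++ goalVars Cb
    hν : Atom
    hν = h ⟪ ν ⟫
    C : List Atom
    C  = CA ++ hν ∷ CB

    ν-mgu : IsIdemMguᴳ bd Cb ν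
    ν-mgu = proj₁ (proj₂ clause-step)

    ν-confined : Confined K ν
    ν-confined = proj₁ (proj₂ (proj₂ clause-step))

    ν-idempotent : ∀ z → ν z ⟨ ν ⟩ ≡ ν z
    ν-idempotent = proj₂ ν-mgu ν (proj₁ ν-mgu)

    ∈hν : ∀ {y} → y ∈ atomVars hν → y ∈ K × ν y ≡ var y
    ∈hν m with ∈-atomVars-⟪⟫⁻ h ν m
    ... | z , z∈h , y∈νz = inside ν-confined z (∈-++⁺ˡ (∈-++⁺ˡ z∈h)) _ y∈νz ,
                           ⟨⟩-fixes⁻ (ν z) ν (ν-idempotent z) _ y∈νz

    U∉K : ∀ {x} → x ∈ U → x ∉ K
    U∉K x∈U x∈K with ∈-++⁻ CV x∈K
    ... | inj₁ x∈CV = renamed-apart _ x∈CV x∈U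
    ... | inj₂ x∈Cb = fresh _ (∈CC (inj₂ (inj₁ x∈Cb))) (∈U⇒∈U′ x∈U)

    CA∉K : ∀ {x} → x ∈ goalVars CA → x ∉ K
    CA∉K x∈CA x∈K with ∈-++⁻ CV x∈K
    ... | inj₁ x∈CV = fresh _ (∈CC (inj₁ x∈CA)) (∈CV⇒∈U′ x∈CV)
    ... | inj₂ x∈Cb = proj₁ (proj₂ apart-split) _ x∈CA (∈-goalVars-++⁺ˡ Cb CB x∈Cb)

    CB∉K : ∀ {x} → x ∈ goalVars CB → x ∉ K
    CB∉K x∈CB x∈K with ∈-++⁻ CV x∈K
    ... | inj₁ x∈CV = fresh _ (∈CC (inj₂ (inj₂ x∈CB))) (∈CV⇒∈U′ x∈CV)
    ... | inj₂ x∈Cb = proj₂ (proj₂ (proj₂ (proj₂ apart-split))) _ x∈Cb x∈CB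

    C-inv : All Inv C
    C-inv = let sA , _ , sB = inv-split in ++⁺ sA (proj₂ (proj₂ (proj₂ clause-step)) ∷ sB)

    C-length : length C ≡ length (A ++ a ∷ B)
    C-length = begin
      length (CA ++ hν ∷ CB)     ≡⟨ length-++ CA ⟩
      length CA + suc (length CB) ≡⟨ cong₂ (λ m n → m + suc n) |CA| |CB| ⟩
      length A + suc (length B)   ≡⟨ length-++ A ⟨
      length (A ++ a ∷ B)         ∎
      where open ≡-Reasoning

    C-fresh : ∀ x → x ∈ goalVars C → x ∉ U
    C-fresh x m x∈U with ∈-goalVars-++⁻ CA (hν ∷ CB) m
    ... | inj₁ x∈CA = fresh x (∈CC (inj₁ x∈CA)) (∈U⇒∈U′ x∈U)
    ... | inj₂ m′ with ∈-++⁻ (atomVars hν) m′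
    ...   | inj₁ x∈hν = U∉K x∈U (proj₁ (∈hν x∈hν))
    ...   | inj₂ x∈CB = fresh x (∈CC (inj₂ (inj₂ x∈CB))) (∈U⇒∈U′ x∈U)

    C-apart : Apart C
    C-apart = let dA , A∉ , _ , dB , b∉ = apart-split in
      Apart-++⁺ CA (hν ∷ CB) dA (hν∉CB , dB) (CA∉hν∷CB A∉)
      where
      hν∉CB : ApartFrom (hν ∷ []) CB
      hν∉CB x m x∈CB with ∈-++⁻ (atomVars hν) m
      ... | inj₁ x∈hν = CB∉K x∈CB (proj₁ (∈hν x∈hν))
      CA∉hν∷CB : ApartFrom CA (Cb ++ CB) → ApartFrom CA (hν ∷ CB)
      CA∉hν∷CB A∉ x x∈CA m with ∈-++⁻ (atomVars hν) m
      ... | inj₁ x∈hν = CA∉K x∈CA (proj₁ (∈hν x∈hν))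
      ... | inj₂ x∈CB = A∉ x x∈CA (∈-goalVars-++⁺ʳ Cb CB x∈CB)

    C-unifies : goalApply (A ++ a ∷ B) τ ≡ goalApply C τ
    C-unifies = goalApply-join A (a ∷ B) CA (hν ∷ CB) τ τ-unifies-A (cong₂ _∷_ a≈hν (proj₂ τ-unifies-bd,B))
      where
      a≈hν : a ⟪ τ ⟫ ≡ hν ⟪ τ ⟫
      a≈hν = begin
        a ⟪ θ ⨾ σ ⟫   ≡⟨ ⟪⟫-⨾ a θ σ ⟩
        a ⟪ θ ⟫ ⟪ σ ⟫ ≡⟨ cong (_⟪ σ ⟫) (proj₁ θ-mgu) ⟩
        h ⟪ θ ⟫ ⟪ σ ⟫ ≡⟨ ⟪⟫-⨾ h θ σ ⟨
        h ⟪ τ ⟫       ≡⟨ ⟪⟫-cong h (λ z _ → proj₂ ν-mgu τ (proj₁ τ-unifies-bd,B) z) ⟨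
        h ⟪ ν ⨾ τ ⟫   ≡⟨ ⟪⟫-⨾ h ν τ ⟩
        hν ⟪ τ ⟫      ∎
        where open ≡-Reasoning

    ν-off-U : ∀ {x} → x ∈ U → ν x ≡ var x
    ν-off-U x∈U = outside ν-confined _ (U∉K x∈U)

    old-variable : ∀ {x} → x ∈ U ++ goalVars C → ν x ≡ var x × x ∈ U′ ++ goalVars CC
    old-variable {x} m with ∈-++⁻ U m
    ... | inj₁ x∈U = ν-off-U x∈U , ∈-++⁺ˡ (∈U⇒∈U′ x∈U)
    ... | inj₂ m₁ with ∈-goalVars-++⁻ CA (hν ∷ CB) m₁
    ...   | inj₁ x∈CA = outside ν-confined x (CA∉K x∈CA) , ∈-++⁺ʳ U′ (∈CC (inj₁ x∈CA))
    ...   | inj₂ m₂ with ∈-++⁻ (atomVars hν) m₂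
    ...     | inj₂ x∈CB = outside ν-confined x (CB∉K x∈CB) , ∈-++⁺ʳ U′ (∈CC (inj₂ (inj₂ x∈CB)))
    ...     | inj₁ x∈hν with ∈hν x∈hν
    ...       | x∈K , νx with ∈-++⁻ CV x∈K
    ...         | inj₁ x∈CV = νx , ∈-++⁺ˡ (∈CV⇒∈U′ x∈CV)
    ...         | inj₂ x∈Cb = νx , ∈-++⁺ʳ U′ (∈CC (inj₂ (inj₁ x∈Cb)))

    θ-stays-old : ∀ x → x ∈ U′ ++ goalVars CC → ∀ y → y ∈ vars (θ x) → y ∈ U′ ++ goalVars CC
    θ-stays-old x x∈ y y∈ with x ∈? D
    ... | yes x∈D = ∈-++⁺ˡ (∈-++⁺ʳ U (∈-++⁺ʳ CV (∈-++⁺ʳ D (∈-concatMap⁺ (λ x → vars (θ x)) (lose x∈D y∈)))))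
    ... | no  x∉D with subst (λ t → y ∈ vars t) (θ-off x x∉D) y∈
    ...   | here refl = x∈

    module _ (ρ′ : Subst) (e : goalApply (A ++ a ∷ B) ρ′ ≡ goalApply C ρ′) where
      ρ̂ : Subst
      ρ̂ = ν ⨾ ρ′

      ρ̂≈ρ′ : ∀ X → (∀ {x} → x ∈ goalVars X → ν x ≡ var x) → goalApply X ρ̂ ≡ goalApply X ρ′
      ρ̂≈ρ′ X off = trans (goalApply-⨾ X ν ρ′) (cong (λ G → goalApply G ρ′) (goalApply-fixes X ν (λ _ → off)))

      e-A : goalApply A ρ′ ≡ goalApply CA ρ′
      e-A = proj₁ (goalApply-split A (a ∷ B) CA (hν ∷ CB) ρ′ (sym |CA|) e)
      e-aB : goalApply (a ∷ B) ρ′ ≡ goalApply (hν ∷ CB) ρ′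
      e-aB = proj₂ (goalApply-split A (a ∷ B) CA (hν ∷ CB) ρ′ (sym |CA|) e)

      ρ̂-unifies-a-h : a ⟪ ρ̂ ⟫ ≡ h ⟪ ρ̂ ⟫
      ρ̂-unifies-a-h = begin
        a ⟪ ν ⨾ ρ′ ⟫    ≡⟨ ⟪⟫-⨾ a ν ρ′ ⟩
        a ⟪ ν ⟫ ⟪ ρ′ ⟫  ≡⟨ cong (_⟪ ρ′ ⟫) (trans (⟪⟫-cong a (λ x m → ν-off-U (∈a⇒∈U m))) (⟪⟫-identity a)) ⟩
        a ⟪ ρ′ ⟫        ≡⟨ ∷-injectiveˡ e-aB ⟩
        hν ⟪ ρ′ ⟫       ≡⟨ ⟪⟫-⨾ h ν ρ′ ⟨
        h ⟪ ρ̂ ⟫         ∎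
        where open ≡-Reasoning

      δ : Subst
      δ = proj₁ (proj₂ θ-mgu ρ̂ ρ̂-unifies-a-h)
      θδ≈ρ̂ : ∀ x → (θ ⨾ δ) x ≡ ρ̂ x
      θδ≈ρ̂ = proj₂ (proj₂ θ-mgu ρ̂ ρ̂-unifies-a-h)

      ρ̂-unifies-all : goalApply (A ++ bd ++ B) ρ̂ ≡ goalApply CC ρ̂
      ρ̂-unifies-all = goalApply-join A (bd ++ B) CA (Cb ++ CB) ρ̂
        (trans (ρ̂≈ρ′ A (λ m → ν-off-U (∈A⇒∈U m)))
               (trans e-A (sym (ρ̂≈ρ′ CA (λ m → outside ν-confined _ (CA∉K m))))))
        (goalApply-join bd B Cb CB ρ̂
          (trans (goalApply-⨾ bd ν ρ′) (trans (cong (λ G → goalApply G ρ′) (proj₁ ν-mgu)) (sym (goalApply-⨾ Cb ν ρ′))))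
          (trans (ρ̂≈ρ′ B (λ m → ν-off-U (∈B⇒∈U m)))
                 (trans (∷-injectiveʳ e-aB) (sym (ρ̂≈ρ′ CB (λ m → outside ν-confined _ (CB∉K m)))))))

      δ-unifies : goalApply (goalApply (A ++ bd ++ B) θ) δ ≡ goalApply CC δ
      δ-unifies = begin
        goalApply (goalApply (A ++ bd ++ B) θ) δ ≡⟨ goalApply-⨾ (A ++ bd ++ B) θ δ ⟨
        goalApply (A ++ bd ++ B) (θ ⨾ δ)         ≡⟨ goalApply-cong (A ++ bd ++ B) (λ x _ → θδ≈ρ̂ x) ⟩
        goalApply (A ++ bd ++ B) ρ̂               ≡⟨ ρ̂-unifies-all ⟩
        goalApply CC ρ̂                           ≡⟨ goalApply-cong CC (λ x _ → θδ≈ρ̂ x) ⟨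
        goalApply CC (θ ⨾ δ)                     ≡⟨ goalApply-⨾ CC θ δ ⟩
        goalApply (goalApply CC θ) δ             ≡⟨ cong (λ G → goalApply G δ) θ-fixes-CC ⟩
        goalApply CC δ                           ∎
        where open ≡-Reasoning

      δ′ : Subst
      δ′ = proj₁ (general δ δ-unifies)

      C-general : ∀ x → x ∈ U ++ goalVars C → τ x ⟨ δ′ ⟩ ≡ ρ′ x
      C-general x m = let νx , x-old = old-variable m in begin
        θ x ⟨ σ ⟩ ⟨ δ′ ⟩ ≡⟨ ⟨⟩-⨾ (θ x) σ δ′ ⟨
        θ x ⟨ σ ⨾ δ′ ⟩  ≡⟨ ⟨⟩-cong (θ x) (λ y y∈ → proj₂ (general δ δ-unifies) y (θ-stays-old x x-old y y∈)) ⟩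
        θ x ⟨ δ ⟩       ≡⟨ θδ≈ρ̂ x ⟩
        ν x ⟨ ρ′ ⟩      ≡⟨ cong (_⟨ ρ′ ⟩) νx ⟩
        ρ′ x            ∎
        where open ≡-Reasoning

    covered : CoveredBy U (A ++ a ∷ B) τ C
    covered = record
      { inv = C-inv ; length≡ = C-length ; fresh = C-fresh ; apart = C-apart ; unifies = C-unifies
      ; general = λ ρ′ e → δ′ ρ′ e , C-general ρ′ e }

  resolvent⊆usedAfter : ∀ {U} A B a rc {θ} D → (∀ x → x ∉ D → θ x ≡ var x) →
    (∀ x → x ∈ goalVars (A ++ a ∷ B) → x ∈ U) →
    ∀ y → y ∈ goalVars (goalApply (A ++ body rc ++ B) θ) → y ∈ usedAfter U rc θ D
  resolvent⊆usedAfter {U} A B a rc {θ} D θ-off G⊆U y m with ∈-goalVars-goalApply⁻ (A ++ body rc ++ B) θ m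
  ... | x , x∈ , y∈θx with x ∈? D
  ...   | yes x∈D = ∈-++⁺ʳ U (∈-++⁺ʳ (clauseVars rc) (∈-++⁺ʳ D (∈-concatMap⁺ (λ x → vars (θ x)) (lose x∈D y∈θx))))
  ...   | no  x∉D with subst (λ t → y ∈ vars t) (θ-off x x∉D) y∈θx
  ...     | here refl with ∈-goalVars-++⁻ A (body rc ++ B) x∈
  ...       | inj₁ y∈A = ∈-++⁺ˡ (G⊆U y (∈-goalVars-++⁺ˡ A (a ∷ B) y∈A))
  ...       | inj₂ m′ with ∈-goalVars-++⁻ (body rc) B m′
  ...         | inj₁ y∈bd = ∈-++⁺ʳ U (∈-++⁺ˡ (∈-++⁺ʳ (atomVars (head rc)) y∈bd))
  ...         | inj₂ y∈B  = ∈-++⁺ˡ (G⊆U y (∈-goalVars-++⁺ʳ A (a ∷ B) (∈-++⁺ʳ (atomVars a) y∈B)))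

  lift : (∀ {c} → c ∈ P → ClauseStep c) →
         ∀ {U G σ} → SLD P U G σ → (∀ x → x ∈ goalVars G → x ∈ U) → Covered U G σ
  lift ok done _ = [] , record
    { inv = [] ; length≡ = refl ; fresh = λ _ () ; apart = tt ; unifies = refl
    ; general = λ ρ _ → ρ , λ _ _ → refl }
  lift ok (step A B a c c∈P ρ ρ-inj renamed-apart θ D θ-off θ-mgu {σ} d) G⊆U
    with lift ok d (resolvent⊆usedAfter A B a (renameClause ρ c) D θ-off G⊆U)
  ... | C′ , cov with splitAt-length C′ (length A) (length bd + length B) (trans (CoveredBy.length≡ cov) |resolvent|)
    where
    bd : List Atom
    bd = body (renameClause ρ c)
    |resolvent| : length (goalApply (A ++ bd ++ B) θ) ≡ length A + (length bd + length B)
    |resolvent| = trans (length-map _ (A ++ bd ++ B)) (trans (length-++ A) (cong (λ n → length A + n) (length-++ bd)))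
  ...   | CA , C₂ , refl , |CA| , |C₂| with splitAt-length C₂ (length (body (renameClause ρ c))) (length B) |C₂|
  ...     | Cb , CB , refl , |Cb| , |CB| =
    _ , Resolution.covered ok A B a c∈P ρ ρ-inj renamed-apart D θ-off θ-mgu G⊆U CA Cb CB |CA| |Cb| |CB| cov

  varOr : Term → Var → Var
  varOr (var y) _ = y
  varOr _       x = x

  -- The query has distinct variables as arguments, so matching it against the fresh
  -- Inv-atom C is a unifier; θ being most general, it can only rename the variables of C.
  answer-renames-Inv : (∀ {c} → c ∈ P → ClauseStep c) →
    ∀ A → InO P A → ∃ λ C → ∃ λ f → Inv C × InjectiveOn (atomVars C) f × A ≡ C ⟪ rename f ⟫
  answer-renames-Inv ok _ (p , v₁ , v₂ , v₃ , v₄ , uniq , θ , derivation , refl)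
    with lift ok derivation (λ x m → m)
  ... | atom p′ c₁ c₂ c₃ c₄ ∷ [] , record { inv = sC ∷ [] ; fresh = fresh ; unifies = unifies ; general = general }
    with atom-injective (∷-injectiveˡ unifies)
  ...   | refl , _ = C , f , sC , f-injective , trans (∷-injectiveˡ unifies) (⟪⟫-cong C θ≈f)
    where
    C Q : Atom
    C = atom p c₁ c₂ c₃ c₄
    Q = atom p (var v₁) (var v₂) (var v₃) (var v₄)
    U : List Var
    U = goalVars (Q ∷ [])
    match : Bindings
    match = (v₁ , c₁) ∷ (v₂ , c₂) ∷ (v₃ , c₃) ∷ (v₄ , c₄) ∷ []
    C-fresh : ∀ {x} → x ∈ atomVars C → x ∉ U
    C-fresh m = fresh _ (∈-++⁺ˡ m)
    dom⊆U : ∀ {x} → x ∈ dom match → x ∈ U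
    dom⊆U (here refl)                         = here refl
    dom⊆U (there (here refl))                 = there (here refl)
    dom⊆U (there (there (here refl)))         = there (there (here refl))
    dom⊆U (there (there (there (here refl)))) = there (there (there (here refl)))
    μ : Subst
    μ = ⟦ match ⟧ˢ
    μ-off-C : ∀ {x} → x ∈ atomVars C → μ x ≡ var x
    μ-off-C m = ⟦⟧ˢ-off match (λ x∈dom → C-fresh m (dom⊆U x∈dom))
    μ-mgu : IsIdemMgu (bindingEqs match) μ
    μ-mgu = IsIdemMgu-solved match (Unique⇒Distinct _ uniq)
      (λ x∈dom x∈rng → C-fresh (subst (_ ∈_) (cong (λ xs → vars c₁ ++ vars c₂ ++ vars c₃ ++ xs) (++-identityʳ (vars c₄)))
                                       x∈rng)
                               (dom⊆U x∈dom))
    μ-unifies : goalApply (Q ∷ []) μ ≡ goalApply (C ∷ []) μ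
    μ-unifies with proj₁ μ-mgu
    ... | e₁ ∷ e₂ ∷ e₃ ∷ e₄ ∷ [] = cong (_∷ []) (atom-cong e₁ e₂ e₃ e₄)
    δ : Subst
    δ = proj₁ (general μ μ-unifies)
    θδ≈var : ∀ {x} → x ∈ atomVars C → θ x ⟨ δ ⟩ ≡ var x
    θδ≈var m = trans (proj₂ (general μ μ-unifies) _ (∈-++⁺ʳ U (∈-++⁺ˡ m))) (μ-off-C m)
    f : Var → Var
    f x = varOr (θ x) x
    θ≈f : ∀ x → x ∈ atomVars C → θ x ≡ var (f x)
    θ≈f x m with ⟨⟩≡var⇒var (θ x) δ (θδ≈var m)
    ... | y , e rewrite e = refl
    f-injective : InjectiveOn (atomVars C) f
    f-injective {x} {y} mx my e = var-injective (begin
      var x              ≡⟨ θδ≈var mx ⟨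
      θ x ⟨ δ ⟩          ≡⟨ cong (_⟨ δ ⟩) (trans (θ≈f x mx) (trans (cong var e) (sym (θ≈f y my)))) ⟩
      θ y ⟨ δ ⟩          ≡⟨ θδ≈var my ⟩
      var y              ∎)
      where open ≡-Reasoning

data Slot : Set where
  sn : ℕ → Slot
  sv : Var → Slot

slotTerm : Slot → Term
slotTerm (sn n) = num n
slotTerm (sv x) = var x

slotVars : Slot → List Var
slotVars (sn _) = []
slotVars (sv x) = x ∷ []

slotsVars : List Slot → List Var
slotsVars []       = []
slotsVars (s ∷ ss) = slotVars s ++ slotsVars ss

OpenSlots : Set
OpenSlots = List Slot × Var

⌜_⌝ : OpenSlots → Term
⌜ ss , t ⌝ = mkList (map slotTerm ss) (var t)

olVars : OpenSlots → List Var
olVars (ss , t) = slotsVars ss ++ t ∷ []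

olVars-∷ : ∀ s ss t → olVars (s ∷ ss , t) ≡ slotVars s ++ olVars (ss , t)
olVars-∷ s ss t = ++-assoc (slotVars s) (slotsVars ss) (t ∷ [])

vars-slotTerm : ∀ s → vars (slotTerm s) ≡ slotVars s
vars-slotTerm (sn n) = vars-num n
vars-slotTerm (sv x) = refl

vars-⌜⌝ : ∀ L → vars ⌜ L ⌝ ≡ olVars L
vars-⌜⌝ (ss , t) = go ss
  where
  go : ∀ ss → vars ⌜ ss , t ⌝ ≡ olVars (ss , t)
  go []       = refl
  go (s ∷ ss) = trans (cong₂ _++_ (vars-slotTerm s) (go ss)) (sym (olVars-∷ s ss t))

∈-vars-⌜⌝⁻ : ∀ L {y} → y ∈ vars ⌜ L ⌝ → y ∈ olVars L
∈-vars-⌜⌝⁻ L = subst (_ ∈_) (vars-⌜⌝ L)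

∈-vars-⌜⌝⁺ : ∀ L {y} → y ∈ olVars L → y ∈ vars ⌜ L ⌝
∈-vars-⌜⌝⁺ L = subst (_ ∈_) (sym (vars-⌜⌝ L))

-- At ss r s: s is the r-th slot of ss, counting from 0.
At : List Slot → ℕ → Slot → Set
At []       _       _  = ⊥
At (s ∷ ss) zero    s′ = s ≡ s′
At (s ∷ ss) (suc r) s′ = At ss r s′

At-functional : ∀ ss r {s s′} → At ss r s → At ss r s′ → s ≡ s′
At-functional (_ ∷ ss) zero    refl refl = refl
At-functional (_ ∷ ss) (suc r) a    b    = At-functional ss r a b

sn-injective : ∀ {m n} → sn m ≡ sn n → m ≡ n
sn-injective refl = refl

QueensAt⊆ : List Slot → List Slot → Set
QueensAt⊆ ss ss′ = ∀ r n → At ss r (sn n) → At ss′ r (sn n)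

record SlotMerge (s s′ : Slot) : Set where
  field
    ν         : Subst
    mgu       : IsIdemMgu ((slotTerm s , slotTerm s′) ∷ []) ν
    confined  : Confined (slotVars s ++ slotVars s′) ν
    merged    : Slot
    result    : slotTerm s ⟨ ν ⟩ ≡ slotTerm merged
    vars⊑     : slotVars merged ⊑ slotVars s ++ slotVars s′
    queen⁻    : ∀ n → merged ≡ sn n → s ≡ sn n ⊎ s′ ≡ sn n
    queenˡ    : ∀ n → s ≡ sn n → merged ≡ sn n
    queenʳ    : ∀ n → s′ ≡ sn n → merged ≡ sn n

slotMerge : ∀ s s′ → Distinct (slotVars s ++ slotVars s′) → (ρ : Subst) →
            slotTerm s ⟨ ρ ⟩ ≡ slotTerm s′ ⟨ ρ ⟩ → SlotMerge s s′
slotMerge (sn m) (sn n) _ ρ e with num-injective (trans (sym (num-⟨⟩ m ρ)) (trans e (num-⟨⟩ n ρ)))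
... | refl = record
  { ν = var ; mgu = IsIdemMgu-refl (num m) ; confined = Confined-var [] ; merged = sn m
  ; result = ⟨⟩-identity (num m) ; vars⊑ = ⊑-refl
  ; queen⁻ = λ _ e → inj₁ e ; queenˡ = λ _ e → e ; queenʳ = λ _ e → e }
slotMerge (sv x) s′ d ρ e = record
  { ν = [ x ↦ slotTerm s′ ] ; mgu = IsIdemMgu-[↦] x (slotTerm s′) x∉
  ; confined = Confined-[↦] x _ (here refl) (λ y m → there (subst (y ∈_) (vars-slotTerm s′) m))
  ; merged = s′ ; result = [↦]-at x _ ; vars⊑ = ys⊑xs++ys (x ∷ []) (slotVars s′)
  ; queen⁻ = λ _ e → inj₂ e ; queenˡ = λ _ () ; queenʳ = λ _ e → e }
  where
  x∉ : x ∉ vars (slotTerm s′)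
  x∉ m = Distinct-∷⇒∉ (slotVars s′) d (subst (x ∈_) (vars-slotTerm s′) m)
slotMerge (sn n) (sv y) _ ρ e = record
  { ν = [ y ↦ num n ] ; mgu = IsIdemMgu-[↦]′ y (num n) (∉-vars-num n)
  ; confined = Confined-[↦] y _ (here refl) (λ _ m → ⊥-elim (∉-vars-num n m))
  ; merged = sn n ; result = num-⟨⟩ n _ ; vars⊑ = mk⊑ λ _ → z≤n
  ; queen⁻ = λ _ e → inj₁ e ; queenˡ = λ _ e → e ; queenʳ = λ _ () }

record Merge (L₁ L₂ : OpenSlots) : Set where
  field
    ν        : Subst
    mgu      : IsIdemMgu ((⌜ L₁ ⌝ , ⌜ L₂ ⌝) ∷ []) ν
    confined : Confined (olVars L₁ ++ olVars L₂) ν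
    merged   : OpenSlots
    result   : ⌜ L₁ ⌝ ⟨ ν ⟩ ≡ ⌜ merged ⌝
    vars⊑    : olVars merged ⊑ olVars L₁ ++ olVars L₂
    queen⁻   : ∀ r n → At (proj₁ merged) r (sn n) → At (proj₁ L₁) r (sn n) ⊎ At (proj₁ L₂) r (sn n)
    queenˡ   : QueensAt⊆ (proj₁ L₁) (proj₁ merged)
    queenʳ   : QueensAt⊆ (proj₁ L₂) (proj₁ merged)

merge : ∀ ss₁ t₁ ss₂ t₂ → let L₁ = (ss₁ , t₁) ; L₂ = (ss₂ , t₂) in
        Distinct (olVars L₁ ++ olVars L₂) → (ρ : Subst) → ⌜ L₁ ⌝ ⟨ ρ ⟩ ≡ ⌜ L₂ ⌝ ⟨ ρ ⟩ → Merge L₁ L₂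
merge [] t₁ ss₂ t₂ d ρ e = record
  { ν = [ t₁ ↦ ⌜ L₂ ⌝ ] ; mgu = IsIdemMgu-[↦] t₁ _ t₁∉
  ; confined = Confined-[↦] t₁ _ (here refl) (λ y m → there (∈-vars-⌜⌝⁻ L₂ m))
  ; merged = L₂ ; result = [↦]-at t₁ _ ; vars⊑ = ys⊑xs++ys (t₁ ∷ []) (olVars L₂)
  ; queen⁻ = λ _ _ → inj₂ ; queenˡ = λ _ _ () ; queenʳ = λ _ _ a → a }
  where
  L₂ : OpenSlots
  L₂ = (ss₂ , t₂)
  t₁∉ : t₁ ∉ vars ⌜ L₂ ⌝
  t₁∉ m = Distinct-∷⇒∉ (olVars L₂) d (∈-vars-⌜⌝⁻ L₂ m)
merge ss₁@(_ ∷ _) t₁ [] t₂ d ρ e = record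
  { ν = [ t₂ ↦ ⌜ L₁ ⌝ ] ; mgu = IsIdemMgu-[↦]′ t₂ _ t₂∉
  ; confined = Confined-[↦] t₂ _ (∈-++⁺ʳ (olVars L₁) (here refl)) (λ y m → ∈-++⁺ˡ (∈-vars-⌜⌝⁻ L₁ m))
  ; merged = L₁ ; result = [↦]-fixes t₂ _ _ t₂∉ ; vars⊑ = xs⊑xs++ys (olVars L₁) (t₂ ∷ [])
  ; queen⁻ = λ _ _ → inj₁ ; queenˡ = λ _ _ a → a ; queenʳ = λ { _ _ () } }
  where
  L₁ : OpenSlots
  L₁ = (ss₁ , t₁)
  t₂∉ : t₂ ∉ vars ⌜ L₁ ⌝
  t₂∉ m = Distinct-++⇒disjoint (olVars L₁) (t₂ ∷ []) d (∈-vars-⌜⌝⁻ L₁ m) (here refl)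
merge (s ∷ ss) t₁ (s′ ∷ ss′) t₂ d ρ e = record
  { ν = H.ν ⨾ T.ν
  ; mgu = IsIdemMgu-resp (λ ρ u → join ρ u ∷ []) (λ ρ → λ { (u ∷ []) → split ρ u })
                         (IsIdemMgu-++ headEq tailEq H.mgu T.mgu tailEq-untouched)
  ; confined = Confined-⨾ (Confined-mono (⊑-∈ Kh⊑K) H.confined) (Confined-mono (⊑-∈ Kt⊑K) T.confined)
  ; merged = H.merged ∷ proj₁ T.merged , proj₂ T.merged
  ; result = trans (⟨⟩-⨾ ⌜ s ∷ ss , t₁ ⌝ H.ν T.ν)
                   (cong₂ cons (trans (cong (_⟨ T.ν ⟩) H.result) merged-head-fixed)
                               (trans (cong (_⟨ T.ν ⟩) tail-fixed) T.result))
  ; vars⊑ = subst (_⊑ K) (sym (olVars-∷ H.merged (proj₁ T.merged) (proj₂ T.merged)))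
                  (⊑-trans (++⁺-⊑ H.vars⊑ T.vars⊑) Kh++Kt⊑K)
  ; queen⁻ = λ { zero n a → H.queen⁻ n a ; (suc r) n a → T.queen⁻ r n a }
  ; queenˡ = λ { zero n a → H.queenˡ n a ; (suc r) n a → T.queenˡ r n a }
  ; queenʳ = λ { zero n a → H.queenʳ n a ; (suc r) n a → T.queenʳ r n a } }
  where
  A B C D K Kh Kt : List Var
  A = slotVars s
  B = olVars (ss , t₁)
  C = slotVars s′
  D = olVars (ss′ , t₂)
  K = olVars (s ∷ ss , t₁) ++ olVars (s′ ∷ ss′ , t₂)
  Kh = A ++ C
  Kt = B ++ D
  Kh++Kt⊑K : Kh ++ Kt ⊑ K
  Kh++Kt⊑K = subst (Kh ++ Kt ⊑_) (sym (cong₂ _++_ (olVars-∷ s ss t₁) (olVars-∷ s′ ss′ t₂))) (⊑-interchange A B C D)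
  Kh⊑K : Kh ⊑ K
  Kh⊑K = ⊑-trans (xs⊑xs++ys Kh Kt) Kh++Kt⊑K
  Kt⊑K : Kt ⊑ K
  Kt⊑K = ⊑-trans (ys⊑xs++ys Kh Kt) Kh++Kt⊑K
  dKhKt : Distinct (Kh ++ Kt)
  dKhKt = Distinct-⊑ Kh++Kt⊑K d
  apart : ∀ {y} → y ∈ Kh → y ∉ Kt
  apart = Distinct-++⇒disjoint Kh Kt dKhKt
  module H = SlotMerge (slotMerge s s′ (Distinct-++⁻ˡ Kh dKhKt) ρ (cons-injectiveˡ e))
  module T = Merge (merge ss t₁ ss′ t₂ (Distinct-++⁻ʳ Kh dKhKt) ρ (cons-injectiveʳ e))
  headEq tailEq : Equations
  headEq = (slotTerm s , slotTerm s′) ∷ []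
  tailEq = (⌜ ss , t₁ ⌝ , ⌜ ss′ , t₂ ⌝) ∷ []
  join : ∀ ρ → Unifies ρ (headEq ++ tailEq) → ⌜ s ∷ ss , t₁ ⌝ ⟨ ρ ⟩ ≡ ⌜ s′ ∷ ss′ , t₂ ⌝ ⟨ ρ ⟩
  join ρ (p ∷ q ∷ []) = cong₂ cons p q
  split : ∀ ρ → ⌜ s ∷ ss , t₁ ⌝ ⟨ ρ ⟩ ≡ ⌜ s′ ∷ ss′ , t₂ ⌝ ⟨ ρ ⟩ → Unifies ρ (headEq ++ tailEq)
  split ρ p = cons-injectiveˡ p ∷ cons-injectiveʳ p ∷ []
  tailEq-untouched : ∀ y → y ∈ eqsVars tailEq → H.ν y ≡ var y
  tailEq-untouched y m with ∈-++⁻ (vars ⌜ ss , t₁ ⌝) m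
  ... | inj₁ m₁ = outside H.confined y (λ h → apart h (∈-++⁺ˡ (∈-vars-⌜⌝⁻ (ss , t₁) m₁)))
  ... | inj₂ m₂ with ∈-++⁻ (vars ⌜ ss′ , t₂ ⌝) m₂
  ...   | inj₁ m₃ = outside H.confined y (λ h → apart h (∈-++⁺ʳ B (∈-vars-⌜⌝⁻ (ss′ , t₂) m₃)))
  merged-head-fixed : slotTerm H.merged ⟨ T.ν ⟩ ≡ slotTerm H.merged
  merged-head-fixed = Confined-fixes T.confined (slotTerm H.merged)
    (λ y m → apart (⊑-∈ H.vars⊑ (subst (y ∈_) (vars-slotTerm H.merged) m)))
  tail-fixed : ⌜ ss , t₁ ⌝ ⟨ H.ν ⟩ ≡ ⌜ ss , t₁ ⌝
  tail-fixed = Confined-fixes H.confined _ (λ y m h → apart h (∈-++⁺ˡ (∈-vars-⌜⌝⁻ (ss , t₁) m)))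

-- Positions r, l count from 0, so r + j ≡ l + m says that the up diagonal number k + j − m
-- of queen j (at k = r + 1) is l + 1; likewise r + m ≡ l + j for the down diagonal.
record Placement (n m : ℕ) (cs us ds : List Slot) : Set where
  field
    inRange   : ∀ r j → At cs r (sn j) → 1 ≤ j × j ≤ n
    placed    : ∀ j → 1 ≤ j → j ≤ n → ∃ λ r → At cs r (sn j)
    once      : ∀ r r′ j → At cs r (sn j) → At cs r′ (sn j) → r ≡ r′
    onUp      : ∀ r j l → At cs r (sn j) → r + j ≡ l + m → At us l (sn j)
    onDown    : ∀ r j l → At cs r (sn j) → r + m ≡ l + j → At ds l (sn j)
    apartDiag : ∀ r r′ j j′ → At cs r (sn j) → At cs r′ (sn j′) → j ≢ j′ →
                r + j ≢ r′ + j′ × r + j′ ≢ r′ + j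

placement-empty : ∀ {m us ds} → Placement 0 m [] us ds
placement-empty = record
  { inRange = λ _ _ () ; placed = λ { _ (s≤s _) () } ; once = λ _ _ _ ()
  ; onUp = λ _ _ _ () ; onDown = λ _ _ _ () ; apartDiag = λ _ _ _ _ () }

-- The recursive call of clause 2 sees Us as [Z|Us] and [Y|Ds] as Ds: the reference row
-- moves from i to i+1.
placement-shift : ∀ {i cs s us ds} w → Placement i i cs (s ∷ us) ds → Placement i (suc i) cs us (sv w ∷ ds)
placement-shift {i} {cs} {s} {us} {ds} w P = record
  { inRange = inRange ; placed = placed ; once = once ; apartDiag = apartDiag
  ; onUp = λ r j l a e → onUp r j (suc l) a (trans e (+-suc l i))
  ; onDown = down }
  where
  open Placement P
  down : ∀ r j l → At cs r (sn j) → r + suc i ≡ l + j → At (sv w ∷ ds) l (sn j)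
  down r j zero    a e = ⊥-elim (1+n≰n (≤-trans (subst (suc i ≤_) e (m≤n+m (suc i) r)) (proj₂ (inRange r j a))))
  down r j (suc l) a e = onDown r j l a (suc-injective (trans (sym (+-suc r i)) e))

-- bc, bu, bd are the lists of the pq-atom of clause 2; their only queen, i+1, sits at position k.
record NewQueen (i k : ℕ) (bc bu bd : List Slot) : Set where
  field
    only : ∀ r n → At bc r (sn n) → r ≡ k × n ≡ suc i
    atC  : At bc k (sn (suc i))
    atU  : At bu k (sn (suc i))
    atD  : At bd k (sn (suc i))

placement-extend : ∀ {i k cs us ds bc bu bd c u d} →
  Placement i (suc i) cs us ds → NewQueen i k bc bu bd →
  (∀ r n → At c r (sn n) → At cs r (sn n) ⊎ At bc r (sn n)) →
  QueensAt⊆ cs c → QueensAt⊆ bc c → QueensAt⊆ us u → QueensAt⊆ bu u → QueensAt⊆ ds d → QueensAt⊆ bd d →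
  Placement (suc i) (suc i) c u d
placement-extend {i} {k} {cs} {us} {ds} {bc} {bu} {bd} {c} {u} {d} P Q from-c cs⊆c bc⊆c us⊆u bu⊆u ds⊆d bd⊆d =
  record { inRange = inRange′ ; placed = placed′ ; once = once′ ; onUp = onUp′ ; onDown = onDown′ ; apartDiag = apart′ }
  where
  open Placement P
  open NewQueen Q
  old≢new : ∀ {r j} → At cs r (sn j) → j ≢ suc i
  old≢new a refl = 1+n≰n (proj₂ (inRange _ _ a))
  inRange′ : ∀ r j → At c r (sn j) → 1 ≤ j × j ≤ suc i
  inRange′ r j a with from-c r j a
  ... | inj₁ old = proj₁ (inRange r j old) , ≤-trans (proj₂ (inRange r j old)) (n≤1+n i)
  ... | inj₂ new with only r j new
  ...   | _ , refl = s≤s z≤n , ≤-refl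
  placed′ : ∀ j → 1 ≤ j → j ≤ suc i → ∃ λ r → At c r (sn j)
  placed′ j 1≤j j≤1+i with j ≟ suc i
  ... | yes refl = k , bc⊆c k (suc i) atC
  ... | no  j≢   = let r , a = placed j 1≤j (≤-pred (≤∧≢⇒< j≤1+i j≢)) in r , cs⊆c r j a
  once′ : ∀ r r′ j → At c r (sn j) → At c r′ (sn j) → r ≡ r′
  once′ r r′ j a a′ with from-c r j a | from-c r′ j a′
  ... | inj₁ x | inj₁ y = once r r′ j x y
  ... | inj₁ x | inj₂ y = ⊥-elim (old≢new x (proj₂ (only r′ j y)))
  ... | inj₂ x | inj₁ y = ⊥-elim (old≢new y (proj₂ (only r j x)))
  ... | inj₂ x | inj₂ y = trans (proj₁ (only r j x)) (sym (proj₁ (only r′ j y)))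
  onUp′ : ∀ r j l → At c r (sn j) → r + j ≡ l + suc i → At u l (sn j)
  onUp′ r j l a e with from-c r j a
  ... | inj₁ x = us⊆u l j (onUp r j l x e)
  ... | inj₂ x with only r j x
  ...   | refl , refl = subst (λ l → At u l (sn (suc i))) (+-cancelʳ-≡ (suc i) k l e) (bu⊆u k (suc i) atU)
  onDown′ : ∀ r j l → At c r (sn j) → r + suc i ≡ l + j → At d l (sn j)
  onDown′ r j l a e with from-c r j a
  ... | inj₁ x = ds⊆d l j (onDown r j l x e)
  ... | inj₂ x with only r j x
  ...   | refl , refl = subst (λ l → At d l (sn (suc i))) (+-cancelʳ-≡ (suc i) k l e) (bd⊆d k (suc i) atD)
  -- an old queen sharing a diagonal with the new one would share its cell in u or d
  up-apart : ∀ r j → At cs r (sn j) → k + suc i ≢ r + j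
  up-apart r j a e = old≢new a (sn-injective (At-functional u k (us⊆u k j (onUp r j k a (sym e))) (bu⊆u k (suc i) atU)))
  down-apart : ∀ r j → At cs r (sn j) → k + j ≢ r + suc i
  down-apart r j a e = old≢new a (sn-injective (At-functional d k (ds⊆d k j (onDown r j k a (sym e))) (bd⊆d k (suc i) atD)))
  apart′ : ∀ r r′ j j′ → At c r (sn j) → At c r′ (sn j′) → j ≢ j′ → r + j ≢ r′ + j′ × r + j′ ≢ r′ + j
  apart′ r r′ j j′ a a′ j≢j′ with from-c r j a | from-c r′ j′ a′
  ... | inj₁ x | inj₁ y = apartDiag r r′ j j′ x y j≢j′
  ... | inj₂ x | inj₂ y = ⊥-elim (j≢j′ (trans (proj₂ (only r j x)) (sym (proj₂ (only r′ j′ y)))))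
  ... | inj₂ x | inj₁ y with only r j x
  ...   | refl , refl = up-apart r′ j′ y , down-apart r′ j′ y
  apart′ r r′ j j′ a a′ j≢j′ | inj₁ x | inj₂ y with only r′ j′ y
  ...   | refl , refl = (λ e → up-apart r j x (sym e)) , (λ e → down-apart r j x (sym e))

slotTerm-injective : ∀ {s s′} → slotTerm s ≡ slotTerm s′ → s ≡ s′
slotTerm-injective {sn m} {sn n} e    = cong sn (num-injective e)
slotTerm-injective {sn zero}    {sv _} ()
slotTerm-injective {sn (suc _)} {sv _} ()
slotTerm-injective {sv _} {sn zero}    ()
slotTerm-injective {sv _} {sn (suc _)} ()
slotTerm-injective {sv x} {sv y} refl = refl

At⇒KthMember : ∀ ss t r s → At ss r s → KthMember (slotTerm s) (suc r) ⌜ ss , t ⌝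
At⇒KthMember (s ∷ ss)  t zero    .s refl = [] , ⌜ ss , t ⌝ , refl , refl
At⇒KthMember (s′ ∷ ss) t (suc r) s  a    with At⇒KthMember ss t r s a
... | ts , t₀ , len , e = slotTerm s′ ∷ ts , t₀ , cong suc len , cong (cons (slotTerm s′)) e

KthMember⇒At : ∀ ss t r u → KthMember u (suc r) ⌜ ss , t ⌝ → ∃ λ s → At ss r s × u ≡ slotTerm s
KthMember⇒At []       t r       u ([]     , _ , _   , ())
KthMember⇒At []       t r       u (_ ∷ _  , _ , _   , ())
KthMember⇒At (s ∷ ss) t zero    u ([]     , _ , _   , e) = s , refl , sym (cons-injectiveˡ e)
KthMember⇒At (s ∷ ss) t (suc r) u (_ ∷ ts , t₀ , len , e) =
  KthMember⇒At ss t r u (ts , t₀ , suc-injective len , cons-injectiveʳ e)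

queen-KthMember⇒At : ∀ ss t k j → KthMember (num j) k ⌜ ss , t ⌝ → ∃ λ r → k ≡ suc r × At ss r (sn j)
queen-KthMember⇒At ss t (suc r) j kth with KthMember⇒At ss t r (num j) kth
... | s , a , e = r , refl , subst (At ss r) (sym (slotTerm-injective {sn j} {s} e)) a

∈-map-slotTerm⁻ : ∀ {s} ss → slotTerm s ∈ map slotTerm ss → ∃ λ r → At ss r s
∈-map-slotTerm⁻ (s′ ∷ ss) (here e)  = zero , sym (slotTerm-injective e)
∈-map-slotTerm⁻ (s′ ∷ ss) (there m) = let r , a = ∈-map-slotTerm⁻ ss m in suc r , a

At⇒∈-slotsVars : ∀ ss r x → At ss r (sv x) → x ∈ slotsVars ss
At⇒∈-slotsVars (s ∷ ss) zero    x refl = here refl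
At⇒∈-slotsVars (s ∷ ss) (suc r) x a    = ∈-++⁺ʳ (slotVars s) (At⇒∈-slotsVars ss r x a)

slot-fresh-in-tail : ∀ s ss → Distinct (slotsVars (s ∷ ss)) →
                     (∀ r r′ j → At (s ∷ ss) r (sn j) → At (s ∷ ss) r′ (sn j) → r ≡ r′) →
                     slotTerm s ∉ map slotTerm ss
slot-fresh-in-tail (sn j) ss d once m with ∈-map-slotTerm⁻ ss m
... | r , a with once zero (suc r) j refl a
...   | ()
slot-fresh-in-tail (sv x) ss d once m with ∈-map-slotTerm⁻ ss m
... | r , a = Distinct-∷⇒∉ (slotsVars ss) d (At⇒∈-slotsVars ss r x a)

Unique-slots : ∀ ss → Distinct (slotsVars ss) → (∀ r r′ j → At ss r (sn j) → At ss r′ (sn j) → r ≡ r′) →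
               Unique (map slotTerm ss)
Unique-slots []       _ _    = []
Unique-slots (s ∷ ss) d once =
  ¬Any⇒All¬ _ (slot-fresh-in-tail s ss d once) ∷
  Unique-slots ss (Distinct-++⁻ʳ (slotVars s) d) (λ r r′ j a a′ → suc-injective (once (suc r) (suc r′) j a a′))

ℤ-diff-injective : ∀ a b c d → + a ℤ.- + c ≡ + b ℤ.- + d → a + d ≡ b + c
ℤ-diff-injective a b c d e = ℤ.+-injective (begin
  + (a + d)                          ≡⟨ ℤ.pos-+ a d ⟩
  + a ℤ.+ + d                        ≡⟨ rearrange (+ a) (+ c) (+ d) ⟩
  (+ a ℤ.- + c) ℤ.+ (+ c ℤ.+ + d)    ≡⟨ cong (ℤ._+ (+ c ℤ.+ + d)) e ⟩
  (+ b ℤ.- + d) ℤ.+ (+ c ℤ.+ + d)    ≡⟨ cancel (+ b) (+ c) (+ d) ⟩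
  + b ℤ.+ + c                        ≡⟨ ℤ.pos-+ b c ⟨
  + (b + c)                          ∎)
  where
  open ≡-Reasoning
  open import Data.Integer.Tactic.RingSolver using (solve-∀)
  rearrange : ∀ x y z → x ℤ.+ z ≡ (x ℤ.- y) ℤ.+ (y ℤ.+ z)
  rearrange = solve-∀
  cancel : ∀ x y z → (x ℤ.- z) ℤ.+ (y ℤ.+ z) ≡ x ℤ.+ y
  cancel = solve-∀

upDiag-≡ : ∀ i j k l → upDiag i j k ≡ + l → k + j ≡ l + i
upDiag-≡ i j k l e = trans (sym (+-identityʳ (k + j)))
  (ℤ-diff-injective (k + j) l i 0 (trans (cong (ℤ._- + i) (sym (ℤ.pos-+ k j))) (trans e (sym (ℤ.+-identityʳ (+ l))))))

downDiag-≡ : ∀ i j k l → downDiag i j k ≡ + l → k + i ≡ l + j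
downDiag-≡ i j k l = upDiag-≡ j i k l

upDiag-injective : ∀ i j k j′ k′ → upDiag i j k ≡ upDiag i j′ k′ → k + j ≡ k′ + j′
upDiag-injective i j k j′ k′ e = +-cancelʳ-≡ i (k + j) (k′ + j′)
  (ℤ-diff-injective (k + j) (k′ + j′) i i
    (subst₂ (λ p q → p ℤ.- + i ≡ q ℤ.- + i) (sym (ℤ.pos-+ k j)) (sym (ℤ.pos-+ k′ j′)) e))

downDiag-injective : ∀ i j k j′ k′ → downDiag i j k ≡ downDiag i j′ k′ → k + j′ ≡ k′ + j
downDiag-injective i j k j′ k′ e = +-cancelʳ-≡ i (k + j′) (k′ + j) (begin
  k + j′ + i   ≡⟨ xy∙z≈xz∙y k j′ i ⟩
  k + i + j′   ≡⟨ ℤ-diff-injective (k + i) (k′ + i) j j′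
                    (subst₂ (λ p q → p ℤ.- + j ≡ q ℤ.- + j′) (sym (ℤ.pos-+ k i)) (sym (ℤ.pos-+ k′ i)) e) ⟩
  k′ + i + j   ≡⟨ xy∙z≈xz∙y k′ i j ⟩
  k′ + j + i   ∎)
  where open ≡-Reasoning

module _ {i : ℕ} {cs us ds : OpenSlots} (d : Distinct (olVars cs))
         (P : Placement i i (proj₁ cs) (proj₁ us) (proj₁ ds)) where
  open Placement P

  private
    ss : List Slot
    ss = proj₁ cs
    t : Var
    t  = proj₂ cs

  placement-correct : CorrectUpTo i ⌜ cs ⌝
  placement-correct = gvd , ground-members , members , diagonals
    where
    gvd : GVD ⌜ cs ⌝
    gvd = Distinct⇒Unique _ (subst Distinct (sym (vars-⌜⌝ cs)) d) , map slotTerm ss , (t , refl) ,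
          Unique-slots ss (Distinct-++⁻ˡ (slotsVars ss) d) once , ground-or-var ss
      where
      ground-or-var : ∀ ss → All (λ m → Ground m ⊎ IsVar m) (map slotTerm ss)
      ground-or-var []          = []
      ground-or-var (sn n ∷ ss) = inj₁ (vars-num n) ∷ ground-or-var ss
      ground-or-var (sv x ∷ ss) = inj₂ (x , refl) ∷ ground-or-var ss
    ground-members : ∀ u → Member u ⌜ cs ⌝ × Ground u → ∃ λ j → InRange i j × u ≡ num j
    ground-members u ((suc r , kth) , g) with KthMember⇒At ss t r u kth
    ... | sn j , a , e    = j , inRange r j a , e
    ... | sv x , a , refl with g
    ...   | ()
    members : ∀ j → InRange i j → Member (num j) ⌜ cs ⌝
    members j (1≤j , j≤i) = let r , a = placed j 1≤j j≤i in suc r , At⇒KthMember ss t r (sn j) a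
    diagonals : ∀ i′ j j′ k k′ → InRange i j → InRange i j′ → j ≢ j′ →
                KthMember (num j) k ⌜ cs ⌝ → KthMember (num j′) k′ ⌜ cs ⌝ →
                upDiag i′ j k ≢ upDiag i′ j′ k′ × downDiag i′ j k ≢ downDiag i′ j′ k′
    diagonals i′ j j′ k k′ _ _ j≢j′ kth kth′
      with queen-KthMember⇒At ss t k j kth | queen-KthMember⇒At ss t k′ j′ kth′
    ... | r , refl , a | r′ , refl , a′ =
      (λ e → proj₁ (apartDiag r r′ j j′ a a′ j≢j′) (suc-injective (upDiag-injective i′ j (suc r) j′ (suc r′) e))) ,
      (λ e → proj₂ (apartDiag r r′ j j′ a a′ j≢j′) (suc-injective (downDiag-injective i′ j (suc r) j′ (suc r′) e)))

  placement-pair-correct : PairCorrectUpTo i i ⌜ cs ⌝ ⌜ us ⌝ ⌜ ds ⌝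
  placement-pair-correct j range = proj₁ (proj₂ (proj₂ placement-correct)) j range , on-diagonals
    where
    on-diagonals : ∀ k l → KthMember (num j) k ⌜ cs ⌝ → 0 < l →
                   (upDiag i j k ≡ + l → KthMember (num j) l ⌜ us ⌝) ×
                   (downDiag i j k ≡ + l → KthMember (num j) l ⌜ ds ⌝)
    on-diagonals k (suc l) kth _ with queen-KthMember⇒At ss t k j kth
    ... | r , refl , a =
      (λ e → At⇒KthMember (proj₁ us) (proj₂ us) l (sn j) (onUp r j l a (suc-injective (upDiag-≡ i j (suc r) (suc l) e)))) ,
      (λ e → At⇒KthMember (proj₁ ds) (proj₂ ds) l (sn j) (onDown r j l a (suc-injective (downDiag-≡ i j (suc r) (suc l) e))))

pqList : List Var → Var → Var → Term
pqList xs v t = mkList (map var xs) (cons (var v) (var t))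

pqAtom : Var → List Var → List Var → List Var → Var → Var → Var → Atom
pqAtom v cs us ds c₀ u₀ d₀ = atom pq (var v) (pqList cs v c₀) (pqList us v u₀) (pqList ds v d₀)

pqVars : Var → List Var → List Var → List Var → Var → Var → Var → List Var
pqVars v cs us ds c₀ u₀ d₀ = v ∷ c₀ ∷ u₀ ∷ d₀ ∷ cs ++ us ++ ds

vars-pqList : ∀ xs v t → vars (pqList xs v t) ≡ xs ++ v ∷ t ∷ []
vars-pqList []       v t = refl
vars-pqList (x ∷ xs) v t = cong (x ∷_) (vars-pqList xs v t)

∈-pqVars⇒∈-atomVars : ∀ v cs us ds c₀ u₀ d₀ {x} → x ∈ pqVars v cs us ds c₀ u₀ d₀ →
                       x ∈ atomVars (pqAtom v cs us ds c₀ u₀ d₀)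
∈-pqVars⇒∈-atomVars v cs us ds c₀ u₀ d₀ x∈
  rewrite vars-pqList cs v c₀ | vars-pqList us v u₀ | vars-pqList ds v d₀ with x∈
... | here refl                         = here refl
... | there (here refl)                 = there (∈-++⁺ˡ (∈-++⁺ʳ cs (there (here refl))))
... | there (there (here refl))         = there (∈-++⁺ʳ (cs ++ _) (∈-++⁺ˡ (∈-++⁺ʳ us (there (here refl)))))
... | there (there (there (here refl))) = there (∈-++⁺ʳ (cs ++ _) (∈-++⁺ʳ (us ++ _) (∈-++⁺ʳ ds (there (here refl)))))
... | there (there (there (there m))) with ∈-++⁻ cs m
...   | inj₁ x∈cs = there (∈-++⁺ˡ (∈-++⁺ˡ x∈cs))
...   | inj₂ m′ with ∈-++⁻ us m′
...     | inj₁ x∈us = there (∈-++⁺ʳ (cs ++ _) (∈-++⁺ˡ (∈-++⁺ˡ x∈us)))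
...     | inj₂ x∈ds = there (∈-++⁺ʳ (cs ++ _) (∈-++⁺ʳ (us ++ _) (∈-++⁺ˡ x∈ds)))

pqsAtom : ℕ → OpenSlots → OpenSlots → Var → OpenSlots → Atom
pqsAtom i cs us w ds = atom pqs (num i) ⌜ cs ⌝ ⌜ us ⌝ (cons (var w) ⌜ ds ⌝)

pqsVars : OpenSlots → OpenSlots → Var → OpenSlots → List Var
pqsVars cs us w ds = w ∷ olVars cs ++ olVars us ++ olVars ds

∈-pqsVars⇒∈-atomVars : ∀ i cs us w ds {x} → x ∈ pqsVars cs us w ds → x ∈ atomVars (pqsAtom i cs us w ds)
∈-pqsVars⇒∈-atomVars i cs us w ds (here refl) =
  ∈-++⁺ʳ (vars (num i)) (∈-++⁺ʳ (vars ⌜ cs ⌝) (∈-++⁺ʳ (vars ⌜ us ⌝) (here refl)))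
∈-pqsVars⇒∈-atomVars i cs us w ds (there m) with ∈-++⁻ (olVars cs) m
... | inj₁ m′ = ∈-++⁺ʳ (vars (num i)) (∈-++⁺ˡ (∈-vars-⌜⌝⁺ cs m′))
... | inj₂ m′ with ∈-++⁻ (olVars us) m′
...   | inj₁ m″ = ∈-++⁺ʳ (vars (num i)) (∈-++⁺ʳ (vars ⌜ cs ⌝) (∈-++⁺ˡ (∈-vars-⌜⌝⁺ us m″)))
...   | inj₂ m″ = ∈-++⁺ʳ (vars (num i)) (∈-++⁺ʳ (vars ⌜ cs ⌝) (∈-++⁺ʳ (vars ⌜ us ⌝) (there (∈-vars-⌜⌝⁺ ds m″))))

PlacedPqs : Atom → Set
PlacedPqs A = Σ ℕ λ i → Σ OpenSlots λ cs → Σ OpenSlots λ us → Σ Var λ w → Σ OpenSlots λ ds →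
  A ≡ pqsAtom i cs us w ds × 0 < i × Distinct (pqsVars cs us w ds) × Placement i i (proj₁ cs) (proj₁ us) (proj₁ ds)

Spec : Atom → Set
Spec A = S-pq A ⊎ PlacedPqs A ⊎ S-pqs2 A

Spec⇒S : ∀ A → Spec A → S A
Spec⇒S A (inj₁ s)        = inj₁ s
Spec⇒S A (inj₂ (inj₂ s)) = inj₂ (inj₂ s)
Spec⇒S A (inj₂ (inj₁ (i , cs , us , w , ds , refl , 0<i , d , P))) =
  inj₂ (inj₁ (i , ⌜ cs ⌝ , ⌜ us ⌝ , w , ⌜ ds ⌝ , refl , 0<i ,
              (λ m → w∉ (∈-++⁺ˡ (∈-vars-⌜⌝⁻ cs m))) ,
              (λ m → w∉ (∈-++⁺ʳ (olVars cs) (∈-++⁺ˡ (∈-vars-⌜⌝⁻ us m)))) ,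
              (λ m → w∉ (∈-++⁺ʳ (olVars cs) (∈-++⁺ʳ (olVars us) (∈-vars-⌜⌝⁻ ds m)))) ,
              placement-correct {us = us} {ds} (Distinct-++⁻ˡ (olVars cs) d′) P ,
              placement-pair-correct (Distinct-++⁻ˡ (olVars cs) d′) P ,
              (λ x m₁ m₂ → apart-cs (∈-vars-⌜⌝⁻ cs m₁) (∈-++⁺ˡ (∈-vars-⌜⌝⁻ us m₂))) ,
              (λ x m₁ m₂ → apart-cs (∈-vars-⌜⌝⁻ cs m₁) (∈-++⁺ʳ (olVars us) (∈-vars-⌜⌝⁻ ds m₂))) ,
              (λ x m₁ m₂ → Distinct-++⇒disjoint (olVars us) (olVars ds) (Distinct-++⁻ʳ (olVars cs) d′)
                                                (∈-vars-⌜⌝⁻ us m₁) (∈-vars-⌜⌝⁻ ds m₂))))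
  where
  d′ : Distinct (olVars cs ++ olVars us ++ olVars ds)
  d′ = Distinct-++⁻ʳ (w ∷ []) d
  w∉ : w ∉ olVars cs ++ olVars us ++ olVars ds
  w∉ = Distinct-∷⇒∉ (olVars cs ++ olVars us ++ olVars ds) d
  apart-cs : ∀ {x} → x ∈ olVars cs → x ∉ olVars us ++ olVars ds
  apart-cs = Distinct-++⇒disjoint (olVars cs) (olVars us ++ olVars ds) d′

pqList-rename : ∀ f xs v t → pqList xs v t ⟨ rename f ⟩ ≡ pqList (map f xs) (f v) (f t)
pqList-rename f []       v t = refl
pqList-rename f (x ∷ xs) v t = cong (cons (var (f x))) (pqList-rename f xs v t)

renameSlot : (Var → Var) → Slot → Slot
renameSlot f (sn n) = sn n
renameSlot f (sv x) = sv (f x)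

renameSlots : (Var → Var) → OpenSlots → OpenSlots
renameSlots f (ss , t) = map (renameSlot f) ss , f t

⌜⌝-rename : ∀ f L → ⌜ L ⌝ ⟨ rename f ⟩ ≡ ⌜ renameSlots f L ⌝
⌜⌝-rename f ([]          , t) = refl
⌜⌝-rename f (sn n ∷ ss   , t) = cong₂ cons (num-⟨⟩ n _) (⌜⌝-rename f (ss , t))
⌜⌝-rename f (sv x ∷ ss   , t) = cong (cons (var (f x))) (⌜⌝-rename f (ss , t))

olVars-rename : ∀ f L → olVars (renameSlots f L) ≡ map f (olVars L)
olVars-rename f (ss , t) = trans (cong (_++ f t ∷ []) (slotsVars-rename ss)) (sym (map-++ f (slotsVars ss) (t ∷ [])))
  where
  slotsVars-rename : ∀ ss → slotsVars (map (renameSlot f) ss) ≡ map f (slotsVars ss)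
  slotsVars-rename []          = refl
  slotsVars-rename (sn n ∷ ss) = slotsVars-rename ss
  slotsVars-rename (sv x ∷ ss) = cong (f x ∷_) (slotsVars-rename ss)

queenAt-rename⁺ : ∀ f ss r n → At ss r (sn n) → At (map (renameSlot f) ss) r (sn n)
queenAt-rename⁺ f (s ∷ ss) zero    n refl = refl
queenAt-rename⁺ f (s ∷ ss) (suc r) n a    = queenAt-rename⁺ f ss r n a

queenAt-rename⁻ : ∀ f ss r n → At (map (renameSlot f) ss) r (sn n) → At ss r (sn n)
queenAt-rename⁻ f (sn m ∷ ss) zero    n a = a
queenAt-rename⁻ f (s    ∷ ss) (suc r) n a = queenAt-rename⁻ f ss r n a

Placement-rename : ∀ f {n m cs us ds} → Placement n m cs us ds →
                   Placement n m (map (renameSlot f) cs) (map (renameSlot f) us) (map (renameSlot f) ds)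
Placement-rename f {cs = cs} {us} {ds} P = record
  { inRange   = λ r j a → inRange r j (back a)
  ; placed    = λ j 1≤j j≤n → let r , a = placed j 1≤j j≤n in r , queenAt-rename⁺ f cs r j a
  ; once      = λ r r′ j a a′ → once r r′ j (back a) (back a′)
  ; onUp      = λ r j l a e → queenAt-rename⁺ f us l j (onUp r j l (back a) e)
  ; onDown    = λ r j l a e → queenAt-rename⁺ f ds l j (onDown r j l (back a) e)
  ; apartDiag = λ r r′ j j′ a a′ → apartDiag r r′ j j′ (back a) (back a′) }
  where
  open Placement P
  back : ∀ {r n} → At (map (renameSlot f) cs) r (sn n) → At cs r (sn n)
  back = queenAt-rename⁻ f cs _ _

map-pqVars : ∀ f v cs us ds c₀ u₀ d₀ →
             map f (pqVars v cs us ds c₀ u₀ d₀) ≡ pqVars (f v) (map f cs) (map f us) (map f ds) (f c₀) (f u₀) (f d₀)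
map-pqVars f v cs us ds c₀ u₀ d₀ =
  cong (λ xs → f v ∷ f c₀ ∷ f u₀ ∷ f d₀ ∷ xs) (trans (map-++ f cs (us ++ ds)) (cong (map f cs ++_) (map-++ f us ds)))

S-pq-rename : ∀ A f → S-pq A → InjectiveOn (atomVars A) f → S-pq (A ⟪ rename f ⟫)
S-pq-rename _ f (k , v , cs , us , ds , c₀ , u₀ , d₀ , lc , lu , ld , uniq , refl) inj =
  k , f v , map f cs , map f us , map f ds , f c₀ , f u₀ , f d₀ ,
  trans (length-map f cs) lc , trans (length-map f us) lu , trans (length-map f ds) ld ,
  Distinct⇒Unique _ (subst Distinct (map-pqVars f v cs us ds c₀ u₀ d₀)
    (Distinct-map f _ (λ mx my → inj (∈-pqVars⇒∈-atomVars v cs us ds c₀ u₀ d₀ mx)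
                                     (∈-pqVars⇒∈-atomVars v cs us ds c₀ u₀ d₀ my))
                      (Unique⇒Distinct _ uniq))) ,
  atom-cong refl (pqList-rename f cs v c₀) (pqList-rename f us v u₀) (pqList-rename f ds v d₀)

PlacedPqs-rename : ∀ A f → PlacedPqs A → InjectiveOn (atomVars A) f → PlacedPqs (A ⟪ rename f ⟫)
PlacedPqs-rename _ f (i , cs , us , w , ds , refl , 0<i , d , P) inj =
  i , renameSlots f cs , renameSlots f us , f w , renameSlots f ds , shape , 0<i ,
  subst Distinct map-vars (Distinct-map f _ (λ mx my → inj (∈-atomVars mx) (∈-atomVars my)) d) , Placement-rename f P
  where
  ∈-atomVars : ∀ {x} → x ∈ pqsVars cs us w ds → x ∈ atomVars (pqsAtom i cs us w ds)
  ∈-atomVars = ∈-pqsVars⇒∈-atomVars i cs us w ds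
  shape : atom pqs (num i) ⌜ cs ⌝ ⌜ us ⌝ (cons (var w) ⌜ ds ⌝) ⟪ rename f ⟫ ≡
          atom pqs (num i) ⌜ renameSlots f cs ⌝ ⌜ renameSlots f us ⌝ (cons (var (f w)) ⌜ renameSlots f ds ⌝)
  shape rewrite num-⟨⟩ i (rename f) | ⌜⌝-rename f cs | ⌜⌝-rename f us | ⌜⌝-rename f ds = refl
  map-vars : map f (w ∷ olVars cs ++ olVars us ++ olVars ds) ≡
             f w ∷ olVars (renameSlots f cs) ++ olVars (renameSlots f us) ++ olVars (renameSlots f ds)
  map-vars rewrite olVars-rename f cs | olVars-rename f us | olVars-rename f ds
                 | map-++ f (olVars cs) (olVars us ++ olVars ds) | map-++ f (olVars us) (olVars ds) = refl

S-pqs2-rename : ∀ A f → S-pqs2 A → InjectiveOn (atomVars A) f → S-pqs2 (A ⟪ rename f ⟫)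
S-pqs2-rename _ f (c , u , d , uniq , refl) inj =
  f c , f u , f d , Distinct⇒Unique _ (Distinct-map f (c ∷ u ∷ d ∷ []) (λ mx my → inj (∈-atomVars mx) (∈-atomVars my))
                                                   (Unique⇒Distinct _ uniq)) , refl
  where
  ∈-atomVars : ∀ {x} → x ∈ c ∷ u ∷ d ∷ [] → x ∈ atomVars (atom pqs zro (var c) (var u) (var d))
  ∈-atomVars (here refl)                 = here refl
  ∈-atomVars (there (here refl))         = there (here refl)
  ∈-atomVars (there (there (here refl))) = there (there (here refl))

Spec-rename : ∀ A f → Spec A → InjectiveOn (atomVars A) f → Spec (A ⟪ rename f ⟫)
Spec-rename A f (inj₁ s)        inj = inj₁ (S-pq-rename A f s inj)
Spec-rename A f (inj₂ (inj₁ s)) inj = inj₂ (inj₁ (PlacedPqs-rename A f s inj))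
Spec-rename A f (inj₂ (inj₂ s)) inj = inj₂ (inj₂ (S-pqs2-rename A f s inj))

open Soundness NQUEENS Spec using (ClauseStep; answer-renames-Inv)

argEqs : Atom → Atom → Equations
argEqs (atom _ a b c d) (atom _ a′ b′ c′ d′) = (a , a′) ∷ (b , b′) ∷ (c , c′) ∷ (d , d′) ∷ []

predOf : Atom → Pred
predOf (atom p _ _ _ _) = p

goalEqs : List Atom → List Atom → Equations
goalEqs (a ∷ G) (b ∷ H) = argEqs a b ++ goalEqs G H
goalEqs _       _       = []

goalEqs-complete : ∀ G H ρ → goalApply G ρ ≡ goalApply H ρ → Unifies ρ (goalEqs G H)
goalEqs-complete []                     []                         ρ e = []
goalEqs-complete (atom p a b c d ∷ G) (atom q a′ b′ c′ d′ ∷ H) ρ e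
  with atom-injective (∷-injectiveˡ e)
... | _ , ea , eb , ec , ed = ea ∷ eb ∷ ec ∷ ed ∷ goalEqs-complete G H ρ (∷-injectiveʳ e)

goalEqs-sound : ∀ G H ρ → map predOf G ≡ map predOf H → Unifies ρ (goalEqs G H) → goalApply G ρ ≡ goalApply H ρ
goalEqs-sound []                     []                         ρ _     []                      = refl
goalEqs-sound (atom p a b c d ∷ G) (atom q a′ b′ c′ d′ ∷ H) ρ preds (ea ∷ eb ∷ ec ∷ ed ∷ u)
  with ∷-injectiveˡ preds
... | refl = cong₂ _∷_ (atom-cong ea eb ec ed) (goalEqs-sound G H ρ (∷-injectiveʳ preds) u)

IsIdemMgu⇒IsIdemMguᴳ : ∀ G H {ν} → map predOf G ≡ map predOf H → IsIdemMgu (goalEqs G H) ν → IsIdemMguᴳ G H ν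
IsIdemMgu⇒IsIdemMguᴳ G H preds (u , mg) =
  goalEqs-sound G H _ preds u , λ ρ e → mg ρ (goalEqs-complete G H ρ e)

≢-image : ∀ {ρ : Var → Var} → Injective _≡_ _≡_ ρ → ∀ {m n} → m ≢ n → ρ m ≢ ρ n
≢-image ρ-inj m≢n e = m≢n (ρ-inj e)

clause1-step : ClauseStep clause1
clause1-step ρ ρ-inj [] [] _ _ τ _ =
  var , (refl , λ _ _ _ → refl) , Confined-var _ ,
  inj₂ (inj₂ (ρ 0 , ρ 1 , ρ 2 , (ρ≢ (λ ()) ∷ ρ≢ (λ ()) ∷ []) ∷ (ρ≢ (λ ()) ∷ []) ∷ [] ∷ [] , refl))
  where
  ρ≢ : ∀ {m n} → m ≢ n → ρ m ≢ ρ n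
  ρ≢ = ≢-image ρ-inj

clause3-step : ClauseStep clause3
clause3-step ρ ρ-inj [] [] _ _ τ _ =
  var , (refl , λ _ _ _ → refl) , Confined-var _ ,
  inj₁ (0 , ρ 0 , [] , [] , [] , ρ 1 , ρ 2 , ρ 3 , refl , refl , refl ,
        (ρ≢ (λ ()) ∷ ρ≢ (λ ()) ∷ ρ≢ (λ ()) ∷ []) ∷ (ρ≢ (λ ()) ∷ ρ≢ (λ ()) ∷ []) ∷ (ρ≢ (λ ()) ∷ []) ∷ [] ∷ [] , refl)
  where
  ρ≢ : ∀ {m n} → m ≢ n → ρ m ≢ ρ n
  ρ≢ = ≢-image ρ-inj

pqs≢pq : ∀ {a b c d a′ b′ c′ d′} → atom pqs a b c d ≢ atom pq a′ b′ c′ d′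
pqs≢pq ()

module Clause4 (ρ : Var → Var) (ρ-inj : Injective _≡_ _≡_ ρ)
  (v : Var) (cs us ds : List Var) (c₀ u₀ d₀ : Var) (uniq : Unique (pqVars v cs us ds c₀ u₀ d₀))
  (fresh : ∀ x → x ∈ goalVars (pqAtom v cs us ds c₀ u₀ d₀ ∷ []) → x ∉ clauseVars (renameClause ρ clause4))
  where

  ρ≢ : ∀ {m n} → m ≢ n → ρ m ≢ ρ n
  ρ≢ = ≢-image ρ-inj
  rc : Clause
  rc = renameClause ρ clause4
  CV : List Var
  CV = clauseVars rc
  Lc Lu Ld : Term
  Lc = pqList cs v c₀
  Lu = pqList us v u₀
  Ld = pqList ds v d₀
  C : Atom
  C = pqAtom v cs us ds c₀ u₀ d₀
  solution : Bindings
  solution = (ρ 0 , var v) ∷ (ρ 2 , Lc) ∷ (ρ 4 , Lu) ∷ (ρ 6 , Ld) ∷ []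
  ν : Subst
  ν = ⟦ solution ⟧ˢ
  C∉CV : ∀ {x} → x ∈ atomVars C → x ∉ CV
  C∉CV m = fresh _ (∈-++⁺ˡ m)
  dom⊆CV : ∀ {x} → x ∈ dom solution → x ∈ CV
  dom⊆CV (here refl)                         = here refl
  dom⊆CV (there (here refl))                 = there (there (here refl))
  dom⊆CV (there (there (here refl)))         = there (there (there (there (here refl))))
  dom⊆CV (there (there (there (here refl)))) = there (there (there (there (there (there (here refl))))))
  range⊆C : ∀ {y} → y ∈ rangeVars solution → y ∈ atomVars C
  range⊆C {y} = subst (y ∈_) (cong (λ xs → v ∷ vars Lc ++ vars Lu ++ xs) (++-identityʳ (vars Ld)))
  ν-mgu : IsIdemMgu (bindingEqs solution) ν
  ν-mgu = IsIdemMgu-solved solution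
    (Unique⇒Distinct _ ((ρ≢ (λ ()) ∷ ρ≢ (λ ()) ∷ ρ≢ (λ ()) ∷ []) ∷ (ρ≢ (λ ()) ∷ ρ≢ (λ ()) ∷ []) ∷
                        (ρ≢ (λ ()) ∷ []) ∷ [] ∷ []))
    (λ x∈dom x∈rng → C∉CV (range⊆C x∈rng) (dom⊆CV x∈dom))
  confined : Confined (CV ++ goalVars (C ∷ [])) ν
  confined = Confined-solved solution (λ m → ∈-++⁺ˡ (dom⊆CV m)) (λ m → ∈-++⁺ʳ CV (∈-++⁺ˡ (range⊆C m)))
  ν-off-C : ∀ t → (∀ {y} → y ∈ vars t → y ∈ atomVars C) → t ⟨ ν ⟩ ≡ t
  ν-off-C t t⊆C = ⟨⟩-fixes t ν (λ y m → ⟦⟧ˢ-off solution (λ y∈dom → C∉CV (t⊆C m) (dom⊆CV y∈dom)))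
  ν-new : ∀ n → ρ n ∉ dom solution → ν (ρ n) ≡ var (ρ n)
  ν-new n = ⟦⟧ˢ-off solution
  head-value : head rc ⟪ ν ⟫ ≡ atom pq (var v) (cons (var (ρ 1)) Lc) (cons (var (ρ 3)) Lu) (cons (var (ρ 5)) Ld)
  head-value with proj₁ ν-mgu
  ... | e₀ ∷ e₂ ∷ e₄ ∷ e₆ ∷ [] = atom-cong
    (trans e₀ (ν-off-C (var v) λ { (here refl) → here refl }))
    (cong₂ cons (ν-new 1 (All¬⇒¬Any (ρ≢ (λ ()) ∷ ρ≢ (λ ()) ∷ ρ≢ (λ ()) ∷ ρ≢ (λ ()) ∷ [])))
                (trans e₂ (ν-off-C Lc λ m → there (∈-++⁺ˡ m))))
    (cong₂ cons (ν-new 3 (All¬⇒¬Any (ρ≢ (λ ()) ∷ ρ≢ (λ ()) ∷ ρ≢ (λ ()) ∷ ρ≢ (λ ()) ∷ [])))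
                (trans e₄ (ν-off-C Lu λ m → there (∈-++⁺ʳ (vars Lc) (∈-++⁺ˡ m)))))
    (cong₂ cons (ν-new 5 (All¬⇒¬Any (ρ≢ (λ ()) ∷ ρ≢ (λ ()) ∷ ρ≢ (λ ()) ∷ ρ≢ (λ ()) ∷ [])))
                (trans e₆ (ν-off-C Ld λ m → there (∈-++⁺ʳ (vars Lc) (∈-++⁺ʳ (vars Lu) m)))))
  old : List Var
  old = pqVars v cs us ds c₀ u₀ d₀
  new∉old : ∀ n → ρ n ∈ CV → ρ n ∉ old
  new∉old n m m′ = C∉CV (∈-pqVars⇒∈-atomVars v cs us ds c₀ u₀ d₀ m′) m
  extended : Distinct (ρ 1 ∷ ρ 3 ∷ ρ 5 ∷ old)
  extended = Distinct-∷⁺ (∉-++⁺ (All¬⇒¬Any (ρ≢ (λ ()) ∷ ρ≢ (λ ()) ∷ [])) (new∉old 1 (there (here refl))))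
            (Distinct-∷⁺ (∉-++⁺ (All¬⇒¬Any (ρ≢ (λ ()) ∷ [])) (new∉old 3 (there (there (there (here refl))))))
              (Distinct-∷⁺ (new∉old 5 (there (there (there (there (there (here refl))))))) (Unique⇒Distinct _ uniq)))
  rearranged : v ∷ c₀ ∷ u₀ ∷ d₀ ∷ (ρ 1 ∷ cs) ++ (ρ 3 ∷ us) ++ (ρ 5 ∷ ds) ⊑ ρ 1 ∷ ρ 3 ∷ ρ 5 ∷ old
  rearranged = ⊑-bag (⌊ v ∷ c₀ ∷ u₀ ∷ d₀ ∷ [] ⌋ ⊕ ⌊ ρ 1 ∷ [] ⌋ ⊕ ⌊ cs ⌋ ⊕ ⌊ ρ 3 ∷ [] ⌋ ⊕ ⌊ us ⌋ ⊕ ⌊ ρ 5 ∷ [] ⌋ ⊕ ⌊ ds ⌋)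
                     (⌊ ρ 1 ∷ [] ⌋ ⊕ ⌊ ρ 3 ∷ [] ⌋ ⊕ ⌊ ρ 5 ∷ [] ⌋ ⊕ ⌊ v ∷ c₀ ∷ u₀ ∷ d₀ ∷ [] ⌋ ⊕ ⌊ cs ⌋ ⊕ ⌊ us ⌋ ⊕ ⌊ ds ⌋)
                     (λ x → ≤-reflexive (permute (occ x (v ∷ c₀ ∷ u₀ ∷ d₀ ∷ [])) (occ x (ρ 1 ∷ [])) (occ x cs)
                                                 (occ x (ρ 3 ∷ [])) (occ x us) (occ x (ρ 5 ∷ [])) (occ x ds)))
    where
    open import Data.Nat.Tactic.RingSolver using (solve-∀)
    permute : ∀ a b c d e f g → a + (b + (c + (d + (e + (f + g))))) ≡ b + (d + (f + (a + (c + (e + g)))))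
    permute = solve-∀

clause4-step : ClauseStep clause4
clause4-step ρ ρ-inj (_ ∷ []) (inj₂ (inj₁ (_ , _ , _ , _ , _ , refl , _)) ∷ []) _ _ τ e =
  ⊥-elim (pqs≢pq (sym (∷-injectiveˡ e)))
clause4-step ρ ρ-inj (_ ∷ []) (inj₂ (inj₂ (_ , _ , _ , _ , refl)) ∷ []) _ _ τ e =
  ⊥-elim (pqs≢pq (sym (∷-injectiveˡ e)))
clause4-step ρ ρ-inj (_ ∷ []) (inj₁ (k , v , cs , us , ds , c₀ , u₀ , d₀ , |cs| , |us| , |ds| , uniq , refl) ∷ [])
             _ fresh τ e =
  ν , IsIdemMgu⇒IsIdemMguᴳ (body rc) (C ∷ []) refl ν-mgu , confined ,
  inj₁ (suc k , v , ρ 1 ∷ cs , ρ 3 ∷ us , ρ 5 ∷ ds , c₀ , u₀ , d₀ , cong suc |cs| , cong suc |us| , cong suc |ds| ,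
        Distinct⇒Unique _ (Distinct-⊑ rearranged extended) , head-value)
  where open Clause4 ρ ρ-inj v cs us ds c₀ u₀ d₀ uniq fresh

-- The lists of the pq-atom of clause 2 once its first argument is bound to the numeral n.
queenSlots : ℕ → List Var → List Slot
queenSlots n vs = map sv vs ++ sn n ∷ []

queenSlots-only : ∀ n vs r m → At (queenSlots n vs) r (sn m) → r ≡ length vs × m ≡ n
queenSlots-only n []       zero    m refl = refl , refl
queenSlots-only n (x ∷ vs) (suc r) m a    = let r≡ , m≡ = queenSlots-only n vs r m a in cong suc r≡ , m≡

queenSlots-at : ∀ n vs → At (queenSlots n vs) (length vs) (sn n)
queenSlots-at n []       = refl
queenSlots-at n (x ∷ vs) = queenSlots-at n vs

slotsVars-queenSlots : ∀ n vs → slotsVars (queenSlots n vs) ≡ vs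
slotsVars-queenSlots n []       = refl
slotsVars-queenSlots n (x ∷ vs) = cong (x ∷_) (slotsVars-queenSlots n vs)

olVars-queenSlots : ∀ n vs t → olVars (queenSlots n vs , t) ≡ vs ++ t ∷ []
olVars-queenSlots n vs t = cong (_++ t ∷ []) (slotsVars-queenSlots n vs)

pqList-queenSlots : ∀ vs v t n (ρ : Subst) → ρ v ≡ num n ⟨ ρ ⟩ → pqList vs v t ⟨ ρ ⟩ ≡ ⌜ queenSlots n vs , t ⌝ ⟨ ρ ⟩
pqList-queenSlots []       v t n ρ e = cong (λ u → cons u (ρ t)) e
pqList-queenSlots (x ∷ vs) v t n ρ e = cong (cons (ρ x)) (pqList-queenSlots vs v t n ρ e)

queenEqs : ℕ → OpenSlots → OpenSlots → OpenSlots → List Var → List Var → List Var → Var → Var → Var → Equations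
queenEqs n cs us ds cv uv dv c₀ u₀ d₀ =
  (⌜ cs ⌝ , ⌜ queenSlots n cv , c₀ ⌝) ∷ (⌜ us ⌝ , ⌜ queenSlots n uv , u₀ ⌝) ∷ (⌜ ds ⌝ , ⌜ queenSlots n dv , d₀ ⌝) ∷ []

queenVars : OpenSlots → OpenSlots → OpenSlots → List Var → List Var → List Var → Var → Var → Var → List Var
queenVars cs us ds cv uv dv c₀ u₀ d₀ =
  (olVars cs ++ cv ++ c₀ ∷ []) ++ (olVars us ++ uv ++ u₀ ∷ []) ++ (olVars ds ++ dv ++ d₀ ∷ [])

queenVars-olVars : ∀ n cs us ds cv uv dv c₀ u₀ d₀ →
  (olVars cs ++ olVars (queenSlots n cv , c₀)) ++ (olVars us ++ olVars (queenSlots n uv , u₀)) ++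
  (olVars ds ++ olVars (queenSlots n dv , d₀)) ≡ queenVars cs us ds cv uv dv c₀ u₀ d₀
queenVars-olVars n cs us ds cv uv dv c₀ u₀ d₀
  rewrite olVars-queenSlots n cv c₀ | olVars-queenSlots n uv u₀ | olVars-queenSlots n dv d₀ = refl

∈-eqsVars-⌜⌝⁻ : ∀ L₁ L₂ E {y} → y ∈ eqsVars ((⌜ L₁ ⌝ , ⌜ L₂ ⌝) ∷ E) → y ∈ olVars L₁ ++ olVars L₂ ⊎ y ∈ eqsVars E
∈-eqsVars-⌜⌝⁻ L₁ L₂ E m with ∈-++⁻ (vars ⌜ L₁ ⌝) m
... | inj₁ y∈ = inj₁ (∈-++⁺ˡ (∈-vars-⌜⌝⁻ L₁ y∈))
... | inj₂ m′ with ∈-++⁻ (vars ⌜ L₂ ⌝) m′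
...   | inj₁ y∈ = inj₁ (∈-++⁺ʳ (olVars L₁) (∈-vars-⌜⌝⁻ L₂ y∈))
...   | inj₂ y∈ = inj₂ y∈

eqsVars-queenEqs⊆ : ∀ n cs us ds cv uv dv c₀ u₀ d₀ {y} → y ∈ eqsVars (queenEqs n cs us ds cv uv dv c₀ u₀ d₀) →
                    y ∈ queenVars cs us ds cv uv dv c₀ u₀ d₀
eqsVars-queenEqs⊆ n cs us ds cv uv dv c₀ u₀ d₀ m = subst (_ ∈_) (queenVars-olVars n cs us ds cv uv dv c₀ u₀ d₀) (go m)
  where
  bc bu bd : OpenSlots
  bc = (queenSlots n cv , c₀)
  bu = (queenSlots n uv , u₀)
  bd = (queenSlots n dv , d₀)
  go : ∀ {y} → y ∈ eqsVars (queenEqs n cs us ds cv uv dv c₀ u₀ d₀) →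
       y ∈ (olVars cs ++ olVars bc) ++ (olVars us ++ olVars bu) ++ (olVars ds ++ olVars bd)
  go m with ∈-eqsVars-⌜⌝⁻ cs bc ((⌜ us ⌝ , ⌜ bu ⌝) ∷ (⌜ ds ⌝ , ⌜ bd ⌝) ∷ []) m
  ... | inj₁ y∈ = ∈-++⁺ˡ y∈
  ... | inj₂ m′ with ∈-eqsVars-⌜⌝⁻ us bu ((⌜ ds ⌝ , ⌜ bd ⌝) ∷ []) m′
  ...   | inj₁ y∈ = ∈-++⁺ʳ (olVars cs ++ olVars bc) (∈-++⁺ˡ y∈)
  ...   | inj₂ m″ with ∈-eqsVars-⌜⌝⁻ ds bd [] m″
  ...     | inj₁ y∈ = ∈-++⁺ʳ (olVars cs ++ olVars bc) (∈-++⁺ʳ (olVars us ++ olVars bu) y∈)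

-- Placing queen i+1: the lists cs, us, ds of the recursive call are unified with the lists
-- of the pq-atom, which carry i+1 at the same position k.
module NextQueen
  (i : ℕ) (cs us ds : OpenSlots) (P : Placement i (suc i) (proj₁ cs) (proj₁ us) (proj₁ ds))
  (Y : Var) (cv uv dv : List Var) (c₀ u₀ d₀ : Var)
  (|uv| : length uv ≡ length cv) (|dv| : length dv ≡ length cv)
  (distinct : Distinct (Y ∷ queenVars cs us ds cv uv dv c₀ u₀ d₀))
  (τ : Subst) (τ-unifies : Unifies τ (queenEqs (suc i) cs us ds cv uv dv c₀ u₀ d₀))
  where

  bc bu bd : OpenSlots
  bc = (queenSlots (suc i) cv , c₀)
  bu = (queenSlots (suc i) uv , u₀)
  bd = (queenSlots (suc i) dv , d₀)
  Kc Ku Kd : List Var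
  Kc = olVars cs ++ olVars bc
  Ku = olVars us ++ olVars bu
  Kd = olVars ds ++ olVars bd

  τ-unifies-each : ⌜ cs ⌝ ⟨ τ ⟩ ≡ ⌜ bc ⌝ ⟨ τ ⟩ × ⌜ us ⌝ ⟨ τ ⟩ ≡ ⌜ bu ⌝ ⟨ τ ⟩ × ⌜ ds ⌝ ⟨ τ ⟩ ≡ ⌜ bd ⌝ ⟨ τ ⟩
  τ-unifies-each = All.head τ-unifies , All.head (All.tail τ-unifies) , All.head (All.tail (All.tail τ-unifies))

  distinct″ : Distinct (Y ∷ Kc ++ Ku ++ Kd)
  distinct″ = subst (λ l → Distinct (Y ∷ l)) (sym (queenVars-olVars (suc i) cs us ds cv uv dv c₀ u₀ d₀)) distinct

  distinct′ : Distinct (Kc ++ Ku ++ Kd)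
  distinct′ = Distinct-++⁻ʳ (Y ∷ []) distinct″

  Kc∉Ku++Kd : ∀ {y} → y ∈ Kc → y ∉ Ku ++ Kd
  Kc∉Ku++Kd = Distinct-++⇒disjoint Kc (Ku ++ Kd) distinct′

  Ku∉Kd : ∀ {y} → y ∈ Ku → y ∉ Kd
  Ku∉Kd = Distinct-++⇒disjoint Ku Kd (Distinct-++⁻ʳ Kc distinct′)

  Y∉ : Y ∉ Kc ++ Ku ++ Kd
  Y∉ = Distinct-∷⇒∉ (Kc ++ Ku ++ Kd) distinct″

  module Mc = Merge (merge (proj₁ cs) (proj₂ cs) (proj₁ bc) c₀ (Distinct-++⁻ˡ Kc distinct′)
                           τ (proj₁ τ-unifies-each))
  module Mu = Merge (merge (proj₁ us) (proj₂ us) (proj₁ bu) u₀ (Distinct-++⁻ˡ Ku (Distinct-++⁻ʳ Kc distinct′))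
                           τ (proj₁ (proj₂ τ-unifies-each)))
  module Md = Merge (merge (proj₁ ds) (proj₂ ds) (proj₁ bd) d₀ (Distinct-++⁻ʳ Ku (Distinct-++⁻ʳ Kc distinct′))
                           τ (proj₂ (proj₂ τ-unifies-each)))

  eq-u eq-d : Equations
  eq-u = (⌜ us ⌝ , ⌜ bu ⌝) ∷ []
  eq-d = (⌜ ds ⌝ , ⌜ bd ⌝) ∷ []

  ν-ud ν : Subst
  ν-ud = Mu.ν ⨾ Md.ν
  ν = Mc.ν ⨾ ν-ud

  in-Kd : ∀ {y} → y ∈ eqsVars eq-d → y ∈ Kd
  in-Kd m with ∈-eqsVars-⌜⌝⁻ ds bd [] m
  ... | inj₁ y∈ = y∈

  in-Ku++Kd : ∀ {y} → y ∈ eqsVars (eq-u ++ eq-d) → y ∈ Ku ++ Kd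
  in-Ku++Kd m with ∈-eqsVars-⌜⌝⁻ us bu eq-d m
  ... | inj₁ y∈ = ∈-++⁺ˡ y∈
  ... | inj₂ m′ = ∈-++⁺ʳ Ku (in-Kd m′)

  ν-mgu : IsIdemMgu (queenEqs (suc i) cs us ds cv uv dv c₀ u₀ d₀) ν
  ν-mgu = IsIdemMgu-++ ((⌜ cs ⌝ , ⌜ bc ⌝) ∷ []) (eq-u ++ eq-d) Mc.mgu
            (IsIdemMgu-++ eq-u eq-d Mu.mgu Md.mgu (λ y m → outside Mu.confined y (λ y∈ → Ku∉Kd y∈ (in-Kd m))))
            (λ y m → outside Mc.confined y (λ y∈ → Kc∉Ku++Kd y∈ (in-Ku++Kd m)))

  ν-confined : Confined (queenVars cs us ds cv uv dv c₀ u₀ d₀) ν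
  ν-confined = Confined-mono (subst (_ ∈_) (queenVars-olVars (suc i) cs us ds cv uv dv c₀ u₀ d₀))
    (Confined-⨾ (Confined-mono (λ m → ∈-++⁺ˡ m) Mc.confined)
      (Confined-⨾ (Confined-mono (λ m → ∈-++⁺ʳ Kc (∈-++⁺ˡ m)) Mu.confined)
                  (Confined-mono (λ m → ∈-++⁺ʳ Kc (∈-++⁺ʳ Ku m)) Md.confined)))

  olVars-fixed : ∀ L {ν′ K} → Confined K ν′ → (∀ {y} → y ∈ olVars L → y ∉ K) → ⌜ L ⌝ ⟨ ν′ ⟩ ≡ ⌜ L ⌝
  olVars-fixed L c apart = Confined-fixes c ⌜ L ⌝ (λ y m → apart (∈-vars-⌜⌝⁻ L m))

  value-c : ⌜ cs ⌝ ⟨ ν ⟩ ≡ ⌜ Mc.merged ⌝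
  value-c = begin
    ⌜ cs ⌝ ⟨ Mc.ν ⨾ ν-ud ⟩          ≡⟨ ⟨⟩-⨾ ⌜ cs ⌝ Mc.ν ν-ud ⟩
    ⌜ cs ⌝ ⟨ Mc.ν ⟩ ⟨ ν-ud ⟩        ≡⟨ cong (_⟨ ν-ud ⟩) Mc.result ⟩
    ⌜ Mc.merged ⌝ ⟨ Mu.ν ⨾ Md.ν ⟩   ≡⟨ ⟨⟩-⨾ ⌜ Mc.merged ⌝ Mu.ν Md.ν ⟩
    ⌜ Mc.merged ⌝ ⟨ Mu.ν ⟩ ⟨ Md.ν ⟩
      ≡⟨ cong (_⟨ Md.ν ⟩) (olVars-fixed Mc.merged Mu.confined (λ m m′ → in-Kc m (∈-++⁺ˡ m′))) ⟩
    ⌜ Mc.merged ⌝ ⟨ Md.ν ⟩          ≡⟨ olVars-fixed Mc.merged Md.confined (λ m m′ → in-Kc m (∈-++⁺ʳ Ku m′)) ⟩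
    ⌜ Mc.merged ⌝                   ∎
    where
    open ≡-Reasoning
    in-Kc : ∀ {y} → y ∈ olVars Mc.merged → y ∉ Ku ++ Kd
    in-Kc m = Kc∉Ku++Kd (⊑-∈ Mc.vars⊑ m)

  value-u : ⌜ us ⌝ ⟨ ν ⟩ ≡ ⌜ Mu.merged ⌝
  value-u = begin
    ⌜ us ⌝ ⟨ Mc.ν ⨾ ν-ud ⟩          ≡⟨ ⟨⟩-⨾ ⌜ us ⌝ Mc.ν ν-ud ⟩
    ⌜ us ⌝ ⟨ Mc.ν ⟩ ⟨ ν-ud ⟩
      ≡⟨ cong (_⟨ ν-ud ⟩) (olVars-fixed us Mc.confined (λ m m′ → Kc∉Ku++Kd m′ (∈-++⁺ˡ (∈-++⁺ˡ m)))) ⟩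
    ⌜ us ⌝ ⟨ Mu.ν ⨾ Md.ν ⟩          ≡⟨ ⟨⟩-⨾ ⌜ us ⌝ Mu.ν Md.ν ⟩
    ⌜ us ⌝ ⟨ Mu.ν ⟩ ⟨ Md.ν ⟩        ≡⟨ cong (_⟨ Md.ν ⟩) Mu.result ⟩
    ⌜ Mu.merged ⌝ ⟨ Md.ν ⟩          ≡⟨ olVars-fixed Mu.merged Md.confined (λ m → Ku∉Kd (⊑-∈ Mu.vars⊑ m)) ⟩
    ⌜ Mu.merged ⌝                   ∎
    where open ≡-Reasoning

  value-d : ⌜ ds ⌝ ⟨ ν ⟩ ≡ ⌜ Md.merged ⌝
  value-d = begin
    ⌜ ds ⌝ ⟨ Mc.ν ⨾ ν-ud ⟩          ≡⟨ ⟨⟩-⨾ ⌜ ds ⌝ Mc.ν ν-ud ⟩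
    ⌜ ds ⌝ ⟨ Mc.ν ⟩ ⟨ ν-ud ⟩
      ≡⟨ cong (_⟨ ν-ud ⟩) (olVars-fixed ds Mc.confined (λ m m′ → Kc∉Ku++Kd m′ (∈-++⁺ʳ Ku (∈-++⁺ˡ m)))) ⟩
    ⌜ ds ⌝ ⟨ Mu.ν ⨾ Md.ν ⟩          ≡⟨ ⟨⟩-⨾ ⌜ ds ⌝ Mu.ν Md.ν ⟩
    ⌜ ds ⌝ ⟨ Mu.ν ⟩ ⟨ Md.ν ⟩
      ≡⟨ cong (_⟨ Md.ν ⟩) (olVars-fixed ds Mu.confined (λ m m′ → Ku∉Kd m′ (∈-++⁺ˡ m))) ⟩
    ⌜ ds ⌝ ⟨ Md.ν ⟩                 ≡⟨ Md.result ⟩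
    ⌜ Md.merged ⌝                   ∎
    where open ≡-Reasoning

  value-Y : ν Y ≡ var Y
  value-Y = outside ν-confined Y
              (λ m → Y∉ (subst (Y ∈_) (sym (queenVars-olVars (suc i) cs us ds cv uv dv c₀ u₀ d₀)) m))

  placed : PlacedPqs (atom pqs (num (suc i)) ⌜ Mc.merged ⌝ ⌜ Mu.merged ⌝ (cons (var Y) ⌜ Md.merged ⌝))
  placed = suc i , Mc.merged , Mu.merged , Y , Md.merged , refl , s≤s z≤n ,
    Distinct-⊑ (++⁺-⊑ (⊑-refl {Y ∷ []}) (++⁺-⊑ Mc.vars⊑ (++⁺-⊑ Mu.vars⊑ Md.vars⊑))) distinct″ ,
    placement-extend P new-queen Mc.queen⁻ Mc.queenˡ Mc.queenʳ Mu.queenˡ Mu.queenʳ Md.queenˡ Md.queenʳ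
    where
    new-queen : NewQueen i (length cv) (proj₁ bc) (proj₁ bu) (proj₁ bd)
    new-queen = record
      { only = queenSlots-only (suc i) cv
      ; atC  = queenSlots-at (suc i) cv
      ; atU  = subst (λ k → At (proj₁ bu) k (sn (suc i))) |uv| (queenSlots-at (suc i) uv)
      ; atD  = subst (λ k → At (proj₁ bd) k (sn (suc i))) |dv| (queenSlots-at (suc i) dv) }

module Clause2 (ρ : Var → Var) (ρ-inj : Injective _≡_ _≡_ ρ) where
  I Cs Us Y Ds Z : Var
  I  = ρ 0
  Cs = ρ 1
  Us = ρ 2
  Y  = ρ 3
  Ds = ρ 4
  Z  = ρ 5

  rc : Clause
  rc = renameClause ρ clause2
  CV : List Var
  CV = clauseVars rc

  ρ≢ : ∀ {m n} → m ≢ n → ρ m ≢ ρ n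
  ρ≢ = ≢-image ρ-inj

  -- Both cases of clause 2 end by placing queen i+1 once the pqs-atom has been matched.
  module Conclude
    (i : ℕ) (cs us ds : OpenSlots) (P : Placement i (suc i) (proj₁ cs) (proj₁ us) (proj₁ ds))
    (cv uv dv : List Var) (c₀ u₀ d₀ : Var) (|uv| : length uv ≡ length cv) (|dv| : length dv ≡ length cv)
    (Eall E₁ : Equations) (ν₁ : Subst) (ν₁-mgu : IsIdemMgu E₁ ν₁)
    (split : ∀ ρ′ → Unifies ρ′ Eall → Unifies ρ′ (E₁ ++ queenEqs (suc i) cs us ds cv uv dv c₀ u₀ d₀))
    (join : ∀ ρ′ → Unifies ρ′ (E₁ ++ queenEqs (suc i) cs us ds cv uv dv c₀ u₀ d₀) → Unifies ρ′ Eall)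
    (ν₁-off : ∀ y → y ∈ eqsVars (queenEqs (suc i) cs us ds cv uv dv c₀ u₀ d₀) → ν₁ y ≡ var y)
    (ν₁-I : ν₁ I ≡ num i) (ν₁-Cs : ν₁ Cs ≡ ⌜ cs ⌝) (ν₁-Us : ν₁ Us ≡ ⌜ us ⌝) (ν₁-Ds : ν₁ Ds ≡ ⌜ ds ⌝)
    (ν₁-Y : ν₁ Y ≡ var Y)
    (K : List Var) (ν₁-confined : Confined K ν₁)
    (distinct : Distinct (Y ∷ queenVars cs us ds cv uv dv c₀ u₀ d₀))
    (queen-vars⊆K : ∀ {y} → y ∈ queenVars cs us ds cv uv dv c₀ u₀ d₀ → y ∈ K)
    (τ : Subst) (τ-unifies : Unifies τ Eall)
    where

    E₂ : Equations
    E₂ = queenEqs (suc i) cs us ds cv uv dv c₀ u₀ d₀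

    module Q = NextQueen i cs us ds P Y cv uv dv c₀ u₀ d₀ |uv| |dv| distinct τ
                         (proj₂ (++⁻ E₁ (split τ τ-unifies)))

    ν : Subst
    ν = ν₁ ⨾ Q.ν

    ν-mgu : IsIdemMgu Eall ν
    ν-mgu = IsIdemMgu-resp join split (IsIdemMgu-++ E₁ E₂ ν₁-mgu Q.ν-mgu ν₁-off)

    ν-confined : Confined K ν
    ν-confined = Confined-⨾ ν₁-confined (Confined-mono queen-vars⊆K Q.ν-confined)

    head-value : head rc ⟪ ν ⟫ ≡ atom pqs (num (suc i)) ⌜ Q.Mc.merged ⌝ ⌜ Q.Mu.merged ⌝ (cons (var Y) ⌜ Q.Md.merged ⌝)
    head-value = atom-cong (cong suc' (trans (cong (_⟨ Q.ν ⟩) ν₁-I) (num-⟨⟩ i Q.ν)))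
                           (trans (cong (_⟨ Q.ν ⟩) ν₁-Cs) Q.value-c)
                           (trans (cong (_⟨ Q.ν ⟩) ν₁-Us) Q.value-u)
                           (cong₂ cons (trans (cong (_⟨ Q.ν ⟩) ν₁-Y) Q.value-Y)
                                       (trans (cong (_⟨ Q.ν ⟩) ν₁-Ds) Q.value-d))

    result : ∃ λ ν → IsIdemMgu Eall ν × Confined K ν × PlacedPqs (head rc ⟪ ν ⟫)
    result = ν , ν-mgu , ν-confined , subst PlacedPqs (sym head-value) Q.placed

  I∈CV : I ∈ CV
  I∈CV = here refl
  Cs∈CV : Cs ∈ CV
  Cs∈CV = there (here refl)
  Us∈CV : Us ∈ CV
  Us∈CV = there (there (here refl))
  Y∈CV : Y ∈ CV
  Y∈CV = there (there (there (here refl)))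
  Ds∈CV : Ds ∈ CV
  Ds∈CV = there (there (there (there (here refl))))
  Z∈CV : Z ∈ CV
  Z∈CV = there (there (there (there (there (there (there (here refl)))))))

  -- Against pqs(i,cs,us,[w|ds]) with i > 0, the solved part binds the clause variables and v.
  module Placed
    (i : ℕ) (cs : OpenSlots) (s₁ : Slot) (us′ : List Slot) (tu w : Var) (ds : OpenSlots)
    (distinct₁ : Distinct (pqsVars cs (s₁ ∷ us′ , tu) w ds))
    (P : Placement i i (proj₁ cs) (s₁ ∷ us′) (proj₁ ds))
    (v : Var) (cv uv dv : List Var) (c₀ u₀ d₀ : Var) (|uv| : length uv ≡ length cv) (|dv| : length dv ≡ length cv)
    (distinct₂ : Distinct (pqVars v cv uv dv c₀ u₀ d₀))
    (apart : Apart (pqsAtom i cs (s₁ ∷ us′ , tu) w ds ∷ pqAtom v cv uv dv c₀ u₀ d₀ ∷ []))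
    (fresh : ∀ x → x ∈ goalVars (pqsAtom i cs (s₁ ∷ us′ , tu) w ds ∷ pqAtom v cv uv dv c₀ u₀ d₀ ∷ []) → x ∉ CV)
    (τ : Subst)
    (τ-unifies : goalApply (body rc) τ ≡ goalApply (pqsAtom i cs (s₁ ∷ us′ , tu) w ds ∷ pqAtom v cv uv dv c₀ u₀ d₀ ∷ []) τ)
    where

    us usT dsW : OpenSlots
    us = (s₁ ∷ us′ , tu)
    usT = (us′ , tu)
    dsW = (sv w ∷ proj₁ ds , proj₂ ds)
    C₁ C₂ : Atom
    C₁ = pqsAtom i cs us w ds
    C₂ = pqAtom v cv uv dv c₀ u₀ d₀
    L₁ L₂ R₂ K : List Var
    L₁ = pqsVars cs us w ds
    L₂ = pqVars v cv uv dv c₀ u₀ d₀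
    R₂ = c₀ ∷ u₀ ∷ d₀ ∷ cv ++ uv ++ dv
    K = CV ++ goalVars (C₁ ∷ C₂ ∷ [])

    L₁⊆C₁ : ∀ {x} → x ∈ L₁ → x ∈ atomVars C₁
    L₁⊆C₁ = ∈-pqsVars⇒∈-atomVars i cs us w ds
    L₂⊆C₂ : ∀ {x} → x ∈ L₂ → x ∈ atomVars C₂
    L₂⊆C₂ = ∈-pqVars⇒∈-atomVars v cv uv dv c₀ u₀ d₀
    C₁∉CV : ∀ {x} → x ∈ L₁ → x ∉ CV
    C₁∉CV m = fresh _ (∈-++⁺ˡ (L₁⊆C₁ m))
    C₂∉CV : ∀ {x} → x ∈ L₂ → x ∉ CV
    C₂∉CV m = fresh _ (∈-++⁺ʳ (atomVars C₁) (∈-++⁺ˡ (L₂⊆C₂ m)))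
    L₁∉L₂ : ∀ {x} → x ∈ L₁ → x ∉ L₂
    L₁∉L₂ m m′ = proj₁ apart _ (∈-++⁺ˡ (L₁⊆C₁ m)) (∈-++⁺ˡ (L₂⊆C₂ m′))
    R₂∌v : ∀ {x} → x ∈ R₂ → x ≢ v
    R₂∌v m refl = Distinct-∷⇒∉ R₂ distinct₂ m
    L₁⊆K : ∀ {x} → x ∈ L₁ → x ∈ K
    L₁⊆K m = ∈-++⁺ʳ CV (∈-++⁺ˡ (L₁⊆C₁ m))
    L₂⊆K : ∀ {x} → x ∈ L₂ → x ∈ K
    L₂⊆K m = ∈-++⁺ʳ CV (∈-++⁺ʳ (atomVars C₁) (∈-++⁺ˡ (L₂⊆C₂ m)))

    cs⊆L₁ : ∀ {x} → x ∈ olVars cs → x ∈ L₁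
    cs⊆L₁ m = there (∈-++⁺ˡ m)
    us⊆L₁ : ∀ {x} → x ∈ olVars us → x ∈ L₁
    us⊆L₁ m = there (∈-++⁺ʳ (olVars cs) (∈-++⁺ˡ m))
    usT⊆L₁ : ∀ {x} → x ∈ olVars usT → x ∈ L₁
    usT⊆L₁ m = us⊆L₁ (subst (_ ∈_) (sym (olVars-∷ s₁ us′ tu)) (∈-++⁺ʳ (slotVars s₁) m))
    s₁⊆L₁ : ∀ {x} → x ∈ slotVars s₁ → x ∈ L₁
    s₁⊆L₁ m = us⊆L₁ (subst (_ ∈_) (sym (olVars-∷ s₁ us′ tu)) (∈-++⁺ˡ m))
    dsW⊆L₁ : ∀ {x} → x ∈ olVars dsW → x ∈ L₁
    dsW⊆L₁ (here refl) = here refl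
    dsW⊆L₁ (there m)   = there (∈-++⁺ʳ (olVars cs) (∈-++⁺ʳ (olVars us) m))

    solution : Bindings
    solution = (I , num i) ∷ (v , num (suc i)) ∷ (Cs , ⌜ cs ⌝) ∷ (Ds , ⌜ dsW ⌝) ∷ (Z , slotTerm s₁) ∷ (Us , ⌜ usT ⌝) ∷ []

    ν₁ : Subst
    ν₁ = ⟦ solution ⟧ˢ

    dom-cases : ∀ {x} → x ∈ dom solution → x ∈ CV ⊎ x ≡ v
    dom-cases (here refl)                                         = inj₁ I∈CV
    dom-cases (there (here refl))                                 = inj₂ refl
    dom-cases (there (there (here refl)))                         = inj₁ Cs∈CV
    dom-cases (there (there (there (here refl))))                 = inj₁ Ds∈CV
    dom-cases (there (there (there (there (here refl)))))         = inj₁ Z∈CV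
    dom-cases (there (there (there (there (there (here refl)))))) = inj₁ Us∈CV

    range⊆L₁ : ∀ {y} → y ∈ rangeVars solution → y ∈ L₁
    range⊆L₁ {y} m with ∈-++⁻ (vars (num i)) m
    ... | inj₁ y∈ = ⊥-elim (∉-vars-num i y∈)
    ... | inj₂ m₁ with ∈-++⁻ (vars (num (suc i))) m₁
    ...   | inj₁ y∈ = ⊥-elim (∉-vars-num (suc i) y∈)
    ...   | inj₂ m₂ with ∈-++⁻ (vars ⌜ cs ⌝) m₂
    ...     | inj₁ y∈ = cs⊆L₁ (∈-vars-⌜⌝⁻ cs y∈)
    ...     | inj₂ m₃ with ∈-++⁻ (vars ⌜ dsW ⌝) m₃
    ...       | inj₁ y∈ = dsW⊆L₁ (∈-vars-⌜⌝⁻ dsW y∈)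
    ...       | inj₂ m₄ with ∈-++⁻ (vars (slotTerm s₁)) m₄
    ...         | inj₁ y∈ = s₁⊆L₁ (subst (y ∈_) (vars-slotTerm s₁) y∈)
    ...         | inj₂ m₅ with ∈-++⁻ (vars ⌜ usT ⌝) m₅
    ...           | inj₁ y∈ = usT⊆L₁ (∈-vars-⌜⌝⁻ usT y∈)

    v∉CV : v ∉ CV
    v∉CV = C₂∉CV (here refl)

    L₁∉dom : ∀ {x} → x ∈ L₁ → x ∉ dom solution
    L₁∉dom x∈L₁ x∈dom with dom-cases x∈dom
    ... | inj₁ x∈CV = C₁∉CV x∈L₁ x∈CV
    ... | inj₂ refl = L₁∉L₂ x∈L₁ (here refl)

    R₂∉dom : ∀ {x} → x ∈ R₂ → x ∉ dom solution
    R₂∉dom x∈R₂ x∈dom with dom-cases x∈dom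
    ... | inj₁ x∈CV = C₂∉CV (there x∈R₂) x∈CV
    ... | inj₂ x≡v  = R₂∌v x∈R₂ x≡v

    ν₁-mgu : IsIdemMgu (bindingEqs solution) ν₁
    ν₁-mgu = IsIdemMgu-solved solution
      (Unique⇒Distinct _
        ((v≢ I∈CV ∷ ρ≢ (λ ()) ∷ ρ≢ (λ ()) ∷ ρ≢ (λ ()) ∷ ρ≢ (λ ()) ∷ []) ∷
         (≢v Cs∈CV ∷ ≢v Ds∈CV ∷ ≢v Z∈CV ∷ ≢v Us∈CV ∷ []) ∷
         (ρ≢ (λ ()) ∷ ρ≢ (λ ()) ∷ ρ≢ (λ ()) ∷ []) ∷ (ρ≢ (λ ()) ∷ ρ≢ (λ ()) ∷ []) ∷ (ρ≢ (λ ()) ∷ []) ∷ [] ∷ []))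
      (λ x∈dom x∈rng → L₁∉dom (range⊆L₁ x∈rng) x∈dom)
      where
      v≢ : ∀ {x} → x ∈ CV → x ≢ v
      v≢ m refl = v∉CV m
      ≢v : ∀ {x} → x ∈ CV → v ≢ x
      ≢v m refl = v∉CV m

    queenVars⊑ : queenVars cs usT dsW cv uv dv c₀ u₀ d₀ ⊑ L₁ ++ R₂
    queenVars⊑ = ⊑-bag
      ((⌊ olVars cs ⌋ ⊕ ⌊ cv ⌋ ⊕ ⌊ c₀ ∷ [] ⌋) ⊕ (⌊ olVars usT ⌋ ⊕ ⌊ uv ⌋ ⊕ ⌊ u₀ ∷ [] ⌋) ⊕
       ((⌊ w ∷ [] ⌋ ⊕ ⌊ olVars ds ⌋) ⊕ ⌊ dv ⌋ ⊕ ⌊ d₀ ∷ [] ⌋))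
      ((⌊ w ∷ [] ⌋ ⊕ ⌊ olVars cs ⌋ ⊕ ⌊ olVars us ⌋ ⊕ ⌊ olVars ds ⌋) ⊕
       (⌊ c₀ ∷ [] ⌋ ⊕ ⌊ u₀ ∷ [] ⌋ ⊕ ⌊ d₀ ∷ [] ⌋ ⊕ ⌊ cv ⌋ ⊕ ⌊ uv ⌋ ⊕ ⌊ dv ⌋))
      (λ x → drop-s₁ (occ x (olVars cs)) (occ x cv) (occ x (c₀ ∷ [])) (occ x (olVars usT)) (occ x uv) (occ x (u₀ ∷ []))
                     (occ x (w ∷ [])) (occ x (olVars ds)) (occ x dv) (occ x (d₀ ∷ [])) (occ x (slotVars s₁))
                     (trans (cong (occ x) (olVars-∷ s₁ us′ tu)) (occ-++ x (slotVars s₁) (olVars usT))))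
      where
      open import Data.Nat.Tactic.RingSolver using (solve-∀)
      shuffle : ∀ a b c d e f g h k l s →
                (g + (a + ((s + d) + h))) + (c + (f + (l + (b + (e + k))))) ≡
                ((a + (b + c)) + ((d + (e + f)) + ((g + h) + (k + l)))) + s
      shuffle = solve-∀
      drop-s₁ : ∀ a b c d e f g h k l s {u} → u ≡ s + d →
                (a + (b + c)) + ((d + (e + f)) + ((g + h) + (k + l))) ≤ (g + (a + (u + h))) + (c + (f + (l + (b + (e + k)))))
      drop-s₁ a b c d e f g h k l s refl =
        subst (((a + (b + c)) + ((d + (e + f)) + ((g + h) + (k + l)))) ≤_) (sym (shuffle a b c d e f g h k l s)) (m≤m+n _ s)

    Y∉L₁++R₂ : Y ∉ L₁ ++ R₂
    Y∉L₁++R₂ m with ∈-++⁻ L₁ m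
    ... | inj₁ Y∈L₁ = C₁∉CV Y∈L₁ Y∈CV
    ... | inj₂ Y∈R₂ = C₂∉CV (there Y∈R₂) Y∈CV

    distinct : Distinct (Y ∷ queenVars cs usT dsW cv uv dv c₀ u₀ d₀)
    distinct = Distinct-⊑ (++⁺-⊑ (⊑-refl {Y ∷ []}) queenVars⊑)
      (Distinct-∷⁺ Y∉L₁++R₂ (Distinct-++⁺ L₁ R₂ distinct₁ (Distinct-++⁻ʳ (v ∷ []) distinct₂) (λ m m′ → L₁∉L₂ m (there m′))))

    ν₁-off : ∀ y → y ∈ eqsVars (queenEqs (suc i) cs usT dsW cv uv dv c₀ u₀ d₀) → ν₁ y ≡ var y
    ν₁-off y m with ∈-++⁻ L₁ (⊑-∈ queenVars⊑ (eqsVars-queenEqs⊆ (suc i) cs usT dsW cv uv dv c₀ u₀ d₀ m))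
    ... | inj₁ y∈L₁ = ⟦⟧ˢ-off solution (L₁∉dom y∈L₁)
    ... | inj₂ y∈R₂ = ⟦⟧ˢ-off solution (R₂∉dom y∈R₂)

    ν₁-fixes-L₁ : ∀ L → (∀ {y} → y ∈ olVars L → y ∈ L₁) → ⌜ L ⌝ ⟨ ν₁ ⟩ ≡ ⌜ L ⌝
    ν₁-fixes-L₁ L L⊆L₁ = ⟨⟩-fixes ⌜ L ⌝ ν₁ (λ y m → ⟦⟧ˢ-off solution (L₁∉dom (L⊆L₁ (∈-vars-⌜⌝⁻ L m))))

    ν₁-values : ν₁ I ≡ num i × ν₁ Cs ≡ ⌜ cs ⌝ × ν₁ Us ≡ ⌜ usT ⌝ × ν₁ Ds ≡ ⌜ dsW ⌝
    ν₁-values with proj₁ ν₁-mgu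
    ... | eI ∷ _ ∷ eCs ∷ eDs ∷ _ ∷ eUs ∷ [] =
      trans eI (num-⟨⟩ i ν₁) , trans eCs (ν₁-fixes-L₁ cs cs⊆L₁) ,
      trans eUs (ν₁-fixes-L₁ usT usT⊆L₁) , trans eDs (ν₁-fixes-L₁ dsW dsW⊆L₁)

    ν₁-Y : ν₁ Y ≡ var Y
    ν₁-Y = ⟦⟧ˢ-off solution (All¬⇒¬Any (ρ≢ (λ ()) ∷ Y≢v ∷ ρ≢ (λ ()) ∷ ρ≢ (λ ()) ∷ ρ≢ (λ ()) ∷ ρ≢ (λ ()) ∷ []))
      where
      Y≢v : Y ≢ v
      Y≢v Y≡v = v∉CV (subst (_∈ CV) Y≡v Y∈CV)

    ν₁-confined : Confined K ν₁
    ν₁-confined = Confined-solved solution dom⊆K (λ m → L₁⊆K (range⊆L₁ m))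
      where
      dom⊆K : ∀ {x} → x ∈ dom solution → x ∈ K
      dom⊆K m with dom-cases m
      ... | inj₁ x∈CV = ∈-++⁺ˡ x∈CV
      ... | inj₂ refl = L₂⊆K (here refl)

    Eall E₂ : Equations
    Eall = goalEqs (body rc) (C₁ ∷ C₂ ∷ [])
    E₂ = queenEqs (suc i) cs usT dsW cv uv dv c₀ u₀ d₀

    split : ∀ ρ′ → Unifies ρ′ Eall → Unifies ρ′ (bindingEqs solution ++ E₂)
    split ρ′ (eI ∷ eCs ∷ eZUs ∷ eDs ∷ eIv ∷ eCs′ ∷ eUs′ ∷ eDs′ ∷ []) =
      eI ∷ ρ′v ∷ eCs ∷ eDs ∷ cons-injectiveˡ eZUs ∷ cons-injectiveʳ eZUs ∷
      trans (sym eCs) (trans eCs′ (pqList-queenSlots cv v c₀ (suc i) ρ′ ρ′v)) ∷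
      trans (sym (cons-injectiveʳ eZUs)) (trans eUs′ (pqList-queenSlots uv v u₀ (suc i) ρ′ ρ′v)) ∷
      trans (sym eDs) (trans eDs′ (pqList-queenSlots dv v d₀ (suc i) ρ′ ρ′v)) ∷ []
      where
      ρ′v : ρ′ v ≡ num (suc i) ⟨ ρ′ ⟩
      ρ′v = trans (sym eIv) (cong suc' eI)

    join : ∀ ρ′ → Unifies ρ′ (bindingEqs solution ++ E₂) → Unifies ρ′ Eall
    join ρ′ (eI ∷ ev ∷ eCs ∷ eDs ∷ eZ ∷ eUs ∷ ec ∷ eu ∷ ed ∷ []) =
      eI ∷ eCs ∷ cong₂ cons eZ eUs ∷ eDs ∷ trans (cong suc' eI) (sym ev) ∷
      trans eCs (trans ec (sym (pqList-queenSlots cv v c₀ (suc i) ρ′ ev))) ∷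
      trans eUs (trans eu (sym (pqList-queenSlots uv v u₀ (suc i) ρ′ ev))) ∷
      trans eDs (trans ed (sym (pqList-queenSlots dv v d₀ (suc i) ρ′ ev))) ∷ []

    queen-vars⊆K : ∀ {y} → y ∈ queenVars cs usT dsW cv uv dv c₀ u₀ d₀ → y ∈ K
    queen-vars⊆K m with ∈-++⁻ L₁ (⊑-∈ queenVars⊑ m)
    ... | inj₁ y∈L₁ = L₁⊆K y∈L₁
    ... | inj₂ y∈R₂ = L₂⊆K (there y∈R₂)

    module Result = Conclude i cs usT dsW (placement-shift w P) cv uv dv c₀ u₀ d₀ |uv| |dv|
      Eall (bindingEqs solution) ν₁ ν₁-mgu split join ν₁-off
      (proj₁ ν₁-values) (proj₁ (proj₂ ν₁-values)) (proj₁ (proj₂ (proj₂ ν₁-values))) (proj₂ (proj₂ (proj₂ ν₁-values))) ν₁-Y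
      K ν₁-confined distinct queen-vars⊆K τ (goalEqs-complete (body rc) (C₁ ∷ C₂ ∷ []) τ τ-unifies)

  -- Against pqs(0,c,u,d), the solved part binds c, u, d to clause variables, which then play
  -- the role of empty open lists.
  module First
    (c u d : Var) (distinct₁ : Distinct (c ∷ u ∷ d ∷ []))
    (v : Var) (cv uv dv : List Var) (c₀ u₀ d₀ : Var) (|uv| : length uv ≡ length cv) (|dv| : length dv ≡ length cv)
    (distinct₂ : Distinct (pqVars v cv uv dv c₀ u₀ d₀))
    (apart : Apart (atom pqs zro (var c) (var u) (var d) ∷ pqAtom v cv uv dv c₀ u₀ d₀ ∷ []))
    (fresh : ∀ x → x ∈ goalVars (atom pqs zro (var c) (var u) (var d) ∷ pqAtom v cv uv dv c₀ u₀ d₀ ∷ []) → x ∉ CV)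
    (τ : Subst)
    (τ-unifies : goalApply (body rc) τ ≡ goalApply (atom pqs zro (var c) (var u) (var d) ∷ pqAtom v cv uv dv c₀ u₀ d₀ ∷ []) τ)
    where

    cs us ds : OpenSlots
    cs = ([] , Cs)
    us = ([] , Us)
    ds = ([] , Ds)
    C₁ C₂ : Atom
    C₁ = atom pqs zro (var c) (var u) (var d)
    C₂ = pqAtom v cv uv dv c₀ u₀ d₀
    L₁ L₂ R₂ K : List Var
    L₁ = c ∷ u ∷ d ∷ []
    L₂ = pqVars v cv uv dv c₀ u₀ d₀
    R₂ = c₀ ∷ u₀ ∷ d₀ ∷ cv ++ uv ++ dv
    K = CV ++ goalVars (C₁ ∷ C₂ ∷ [])

    L₁⊆C₁ : ∀ {x} → x ∈ L₁ → x ∈ atomVars C₁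
    L₁⊆C₁ (here refl)                 = here refl
    L₁⊆C₁ (there (here refl))         = there (here refl)
    L₁⊆C₁ (there (there (here refl))) = there (there (here refl))
    L₂⊆C₂ : ∀ {x} → x ∈ L₂ → x ∈ atomVars C₂
    L₂⊆C₂ = ∈-pqVars⇒∈-atomVars v cv uv dv c₀ u₀ d₀
    C₁∉CV : ∀ {x} → x ∈ L₁ → x ∉ CV
    C₁∉CV m = fresh _ (∈-++⁺ˡ (L₁⊆C₁ m))
    C₂∉CV : ∀ {x} → x ∈ L₂ → x ∉ CV
    C₂∉CV m = fresh _ (∈-++⁺ʳ (atomVars C₁) (∈-++⁺ˡ (L₂⊆C₂ m)))
    L₁∉L₂ : ∀ {x} → x ∈ L₁ → x ∉ L₂
    L₁∉L₂ m m′ = proj₁ apart _ (∈-++⁺ˡ (L₁⊆C₁ m)) (∈-++⁺ˡ (L₂⊆C₂ m′))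
    R₂∌v : ∀ {x} → x ∈ R₂ → x ≢ v
    R₂∌v m refl = Distinct-∷⇒∉ R₂ distinct₂ m
    L₁⊆K : ∀ {x} → x ∈ L₁ → x ∈ K
    L₁⊆K m = ∈-++⁺ʳ CV (∈-++⁺ˡ (L₁⊆C₁ m))
    L₂⊆K : ∀ {x} → x ∈ L₂ → x ∈ K
    L₂⊆K m = ∈-++⁺ʳ CV (∈-++⁺ʳ (atomVars C₁) (∈-++⁺ˡ (L₂⊆C₂ m)))

    solution : Bindings
    solution = (I , zro) ∷ (v , num 1) ∷ (c , var Cs) ∷ (u , cons (var Z) (var Us)) ∷ (d , var Ds) ∷ []

    ν₁ : Subst
    ν₁ = ⟦ solution ⟧ˢ

    dom-cases : ∀ {x} → x ∈ dom solution → x ≡ I ⊎ x ∈ L₁ ⊎ x ≡ v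
    dom-cases (here refl)                                 = inj₁ refl
    dom-cases (there (here refl))                         = inj₂ (inj₂ refl)
    dom-cases (there (there (here refl)))                 = inj₂ (inj₁ (here refl))
    dom-cases (there (there (there (here refl))))         = inj₂ (inj₁ (there (here refl)))
    dom-cases (there (there (there (there (here refl))))) = inj₂ (inj₁ (there (there (here refl))))

    range⊆CV : ∀ {y} → y ∈ rangeVars solution → y ∈ CV
    range⊆CV (here refl)                         = Cs∈CV
    range⊆CV (there (here refl))                 = Z∈CV
    range⊆CV (there (there (here refl)))         = Us∈CV
    range⊆CV (there (there (there (here refl)))) = Ds∈CV

    v∉CV : v ∉ CV
    v∉CV = C₂∉CV (here refl)

    CV∉dom : ∀ {x} → x ∈ CV → x ≢ I → x ∉ dom solution
    CV∉dom x∈CV x≢I x∈dom with dom-cases x∈dom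
    ... | inj₁ x≡I         = x≢I x≡I
    ... | inj₂ (inj₁ x∈L₁) = C₁∉CV x∈L₁ x∈CV
    ... | inj₂ (inj₂ refl) = v∉CV x∈CV

    R₂∉dom : ∀ {x} → x ∈ R₂ → x ∉ dom solution
    R₂∉dom x∈R₂ x∈dom with dom-cases x∈dom
    ... | inj₁ refl        = C₂∉CV (there x∈R₂) I∈CV
    ... | inj₂ (inj₁ x∈L₁) = L₁∉L₂ x∈L₁ (there x∈R₂)
    ... | inj₂ (inj₂ x≡v)  = R₂∌v x∈R₂ x≡v

    ν₁-mgu : IsIdemMgu (bindingEqs solution) ν₁
    ν₁-mgu = IsIdemMgu-solved solution
      (Distinct-∷⁺ (CV∉dom′ I∈CV)
        (Distinct-∷⁺ (All¬⇒¬Any (v≢ (here refl) ∷ v≢ (there (here refl)) ∷ v≢ (there (there (here refl))) ∷ [])) distinct₁))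
      (λ x∈dom x∈rng → CV∉dom (range⊆CV x∈rng) (range≢I x∈rng) x∈dom)
      where
      CV∉dom′ : ∀ {x} → x ∈ CV → x ∉ v ∷ L₁
      CV∉dom′ x∈CV (here refl) = v∉CV x∈CV
      CV∉dom′ x∈CV (there x∈L₁) = C₁∉CV x∈L₁ x∈CV
      v≢ : ∀ {x} → x ∈ L₁ → v ≢ x
      v≢ x∈L₁ refl = L₁∉L₂ x∈L₁ (here refl)
      range≢I : ∀ {y} → y ∈ rangeVars solution → y ≢ I
      range≢I (here refl)                         = ρ≢ (λ ())
      range≢I (there (here refl))                 = ρ≢ (λ ())
      range≢I (there (there (here refl)))         = ρ≢ (λ ())
      range≢I (there (there (there (here refl)))) = ρ≢ (λ ())

    queenVars⊑ : queenVars cs us ds cv uv dv c₀ u₀ d₀ ⊑ (Cs ∷ Us ∷ Ds ∷ []) ++ R₂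
    queenVars⊑ = ⊑-bag
      ((⌊ Cs ∷ [] ⌋ ⊕ ⌊ cv ⌋ ⊕ ⌊ c₀ ∷ [] ⌋) ⊕ (⌊ Us ∷ [] ⌋ ⊕ ⌊ uv ⌋ ⊕ ⌊ u₀ ∷ [] ⌋) ⊕ (⌊ Ds ∷ [] ⌋ ⊕ ⌊ dv ⌋ ⊕ ⌊ d₀ ∷ [] ⌋))
      (⌊ Cs ∷ [] ⌋ ⊕ ⌊ Us ∷ [] ⌋ ⊕ ⌊ Ds ∷ [] ⌋ ⊕ ⌊ c₀ ∷ [] ⌋ ⊕ ⌊ u₀ ∷ [] ⌋ ⊕ ⌊ d₀ ∷ [] ⌋ ⊕ ⌊ cv ⌋ ⊕ ⌊ uv ⌋ ⊕ ⌊ dv ⌋)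
      (λ x → ≤-reflexive (shuffle (occ x (Cs ∷ [])) (occ x cv) (occ x (c₀ ∷ [])) (occ x (Us ∷ [])) (occ x uv)
                                  (occ x (u₀ ∷ [])) (occ x (Ds ∷ [])) (occ x dv) (occ x (d₀ ∷ []))))
      where
      open import Data.Nat.Tactic.RingSolver using (solve-∀)
      shuffle : ∀ a b c d e f g h k →
                (a + (b + c)) + ((d + (e + f)) + (g + (h + k))) ≡ a + (d + (g + (c + (f + (k + (b + (e + h)))))))
      shuffle = solve-∀

    distinct : Distinct (Y ∷ queenVars cs us ds cv uv dv c₀ u₀ d₀)
    distinct = Distinct-⊑ (++⁺-⊑ (⊑-refl {Y ∷ []}) queenVars⊑)
      (Distinct-∷⁺ (∉-++⁺ (All¬⇒¬Any (ρ≢ (λ ()) ∷ ρ≢ (λ ()) ∷ ρ≢ (λ ()) ∷ [])) (R₂∌ Y∈CV))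
        (Distinct-∷⁺ (∉-++⁺ (All¬⇒¬Any (ρ≢ (λ ()) ∷ ρ≢ (λ ()) ∷ [])) (R₂∌ Cs∈CV))
          (Distinct-∷⁺ (∉-++⁺ (All¬⇒¬Any (ρ≢ (λ ()) ∷ [])) (R₂∌ Us∈CV))
            (Distinct-∷⁺ (R₂∌ Ds∈CV) (Distinct-++⁻ʳ (v ∷ []) distinct₂)))))
      where
      R₂∌ : ∀ {x} → x ∈ CV → x ∉ R₂
      R₂∌ x∈CV x∈R₂ = C₂∉CV (there x∈R₂) x∈CV

    ν₁-off : ∀ y → y ∈ eqsVars (queenEqs 1 cs us ds cv uv dv c₀ u₀ d₀) → ν₁ y ≡ var y
    ν₁-off y m with ⊑-∈ queenVars⊑ (eqsVars-queenEqs⊆ 1 cs us ds cv uv dv c₀ u₀ d₀ m)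
    ... | here refl                 = ⟦⟧ˢ-off solution (CV∉dom Cs∈CV (ρ≢ (λ ())))
    ... | there (here refl)         = ⟦⟧ˢ-off solution (CV∉dom Us∈CV (ρ≢ (λ ())))
    ... | there (there (here refl)) = ⟦⟧ˢ-off solution (CV∉dom Ds∈CV (ρ≢ (λ ())))
    ... | there (there (there y∈R₂)) = ⟦⟧ˢ-off solution (R₂∉dom y∈R₂)

    ν₁-confined : Confined K ν₁
    ν₁-confined = Confined-solved solution dom⊆K (λ m → ∈-++⁺ˡ (range⊆CV m))
      where
      dom⊆K : ∀ {x} → x ∈ dom solution → x ∈ K
      dom⊆K m with dom-cases m
      ... | inj₁ refl        = ∈-++⁺ˡ I∈CV
      ... | inj₂ (inj₁ x∈L₁) = L₁⊆K x∈L₁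
      ... | inj₂ (inj₂ refl) = L₂⊆K (here refl)

    queen-vars⊆K : ∀ {y} → y ∈ queenVars cs us ds cv uv dv c₀ u₀ d₀ → y ∈ K
    queen-vars⊆K m with ⊑-∈ queenVars⊑ m
    ... | here refl                  = ∈-++⁺ˡ Cs∈CV
    ... | there (here refl)          = ∈-++⁺ˡ Us∈CV
    ... | there (there (here refl))  = ∈-++⁺ˡ Ds∈CV
    ... | there (there (there y∈R₂)) = L₂⊆K (there y∈R₂)

    Eall E₂ : Equations
    Eall = goalEqs (body rc) (C₁ ∷ C₂ ∷ [])
    E₂ = queenEqs 1 cs us ds cv uv dv c₀ u₀ d₀

    split : ∀ ρ′ → Unifies ρ′ Eall → Unifies ρ′ (bindingEqs solution ++ E₂)
    split ρ′ (eI ∷ eCs ∷ eZUs ∷ eDs ∷ eIv ∷ eCs′ ∷ eUs′ ∷ eDs′ ∷ []) =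
      eI ∷ ρ′v ∷ sym eCs ∷ sym eZUs ∷ sym eDs ∷
      trans eCs′ (pqList-queenSlots cv v c₀ 1 ρ′ ρ′v) ∷
      trans eUs′ (pqList-queenSlots uv v u₀ 1 ρ′ ρ′v) ∷
      trans eDs′ (pqList-queenSlots dv v d₀ 1 ρ′ ρ′v) ∷ []
      where
      ρ′v : ρ′ v ≡ num 1 ⟨ ρ′ ⟩
      ρ′v = trans (sym eIv) (cong suc' eI)

    join : ∀ ρ′ → Unifies ρ′ (bindingEqs solution ++ E₂) → Unifies ρ′ Eall
    join ρ′ (eI ∷ ev ∷ ec ∷ eu ∷ ed ∷ eCs ∷ eUs ∷ eDs ∷ []) =
      eI ∷ sym ec ∷ sym eu ∷ sym ed ∷ trans (cong suc' eI) (sym ev) ∷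
      trans eCs (sym (pqList-queenSlots cv v c₀ 1 ρ′ ev)) ∷
      trans eUs (sym (pqList-queenSlots uv v u₀ 1 ρ′ ev)) ∷
      trans eDs (sym (pqList-queenSlots dv v d₀ 1 ρ′ ev)) ∷ []

    ν₁-I : ν₁ I ≡ num 0
    ν₁-I = All.head (proj₁ ν₁-mgu)

    module Result = Conclude 0 cs us ds placement-empty cv uv dv c₀ u₀ d₀ |uv| |dv|
      Eall (bindingEqs solution) ν₁ ν₁-mgu split join ν₁-off ν₁-I (⟦⟧ˢ-off solution (CV∉dom Cs∈CV (ρ≢ (λ ())))) (⟦⟧ˢ-off solution (CV∉dom Us∈CV (ρ≢ (λ ()))))
      (⟦⟧ˢ-off solution (CV∉dom Ds∈CV (ρ≢ (λ ())))) (⟦⟧ˢ-off solution (CV∉dom Y∈CV (ρ≢ (λ ()))))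
      K ν₁-confined distinct queen-vars⊆K τ (goalEqs-complete (body rc) (C₁ ∷ C₂ ∷ []) τ τ-unifies)


clause2-step : ClauseStep clause2
clause2-step ρ ρ-inj (_ ∷ _ ∷ []) (_ ∷ inj₂ (inj₁ (_ , _ , _ , _ , _ , refl , _)) ∷ []) _ _ τ e =
  ⊥-elim (pqs≢pq (∷-injectiveˡ (∷-injectiveʳ (sym e))))
clause2-step ρ ρ-inj (_ ∷ _ ∷ []) (_ ∷ inj₂ (inj₂ (_ , _ , _ , _ , refl)) ∷ []) _ _ τ e =
  ⊥-elim (pqs≢pq (∷-injectiveˡ (∷-injectiveʳ (sym e))))
clause2-step ρ ρ-inj (_ ∷ _ ∷ []) (inj₁ (_ , _ , _ , _ , _ , _ , _ , _ , _ , _ , _ , _ , refl) ∷ inj₁ _ ∷ []) _ _ τ e =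
  ⊥-elim (pqs≢pq (∷-injectiveˡ e))
-- us cannot be empty: queen i lies on the up diagonal 1 w.r.t. i.
clause2-step ρ ρ-inj (_ ∷ _ ∷ []) (inj₂ (inj₁ (i , cs , ([] , tu) , w , ds , refl , 0<i , _ , P)) ∷ inj₁ _ ∷ []) _ _ τ e =
  ⊥-elim (let r , a = placed i 0<i ≤-refl in onUp r i r a refl)
  where open Placement P
clause2-step ρ ρ-inj (_ ∷ _ ∷ [])
  (inj₂ (inj₁ (i , cs , (s₁ ∷ us′ , tu) , w , ds , refl , _ , distinct₁ , P)) ∷
   inj₁ (_ , v , cv , uv , dv , c₀ , u₀ , d₀ , |cv| , |uv| , |dv| , uniq , refl) ∷ []) apart fresh τ e =
  let ν , mgu , confined , placed = Placed.Result.result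
  in  ν , IsIdemMgu⇒IsIdemMguᴳ (body (renameClause ρ clause2)) _ refl mgu , confined , inj₂ (inj₁ placed)
  where
  module Placed = Clause2.Placed ρ ρ-inj i cs s₁ us′ tu w ds distinct₁ P v cv uv dv c₀ u₀ d₀
                    (trans |uv| (sym |cv|)) (trans |dv| (sym |cv|)) (Unique⇒Distinct _ uniq) apart fresh τ e
clause2-step ρ ρ-inj (_ ∷ _ ∷ [])
  (inj₂ (inj₂ (c , u , d , uniq₁ , refl)) ∷
   inj₁ (_ , v , cv , uv , dv , c₀ , u₀ , d₀ , |cv| , |uv| , |dv| , uniq , refl) ∷ []) apart fresh τ e =
  let ν , mgu , confined , placed = First.Result.result
  in  ν , IsIdemMgu⇒IsIdemMguᴳ (body (renameClause ρ clause2)) _ refl mgu , confined , inj₂ (inj₁ placed)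
  where
  module First = Clause2.First ρ ρ-inj c u d (Unique⇒Distinct _ uniq₁) v cv uv dv c₀ u₀ d₀
                   (trans |uv| (sym |cv|)) (trans |dv| (sym |cv|)) (Unique⇒Distinct _ uniq) apart fresh τ e

NQUEENS-steps : ∀ {c} → c ∈ NQUEENS → ClauseStep c
NQUEENS-steps (here refl)                         = clause1-step
NQUEENS-steps (there (here refl))                 = clause2-step
NQUEENS-steps (there (there (here refl)))         = clause3-step
NQUEENS-steps (there (there (there (here refl)))) = clause4-step

mainTheorem3 : ∀ (A : Atom) → InO NQUEENS A → S A
mainTheorem3 A A∈O with answer-renames-Inv NQUEENS-steps A A∈O
... | C , f , C∈Spec , f-injective , refl = Spec⇒S _ (Spec-rename C f C∈Spec f-injective)
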